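{- Let $p$ be a segmented partially ordered pattern and, for a permutation $\pi$, let $N_p(\pi)$ denote the maximum number of non-overlapping occurrences of $p$ in $\pi$. Then $$\sum_\pi y^{N_p(\pi)}q^{\mathrm{inv}(\pi)}\frac{x^{|\pi|}}{[|\pi|]_q!}=\frac{A^p_q(x)}{1-yB^p_q(x)}=\frac{A^p_q(x)}{1-y((x-1)A^p_q(x)+1)},$$ where the sum is over all permutations $\pi$ of all lengths $n\ge0$.
   Context: A segmented partially ordered pattern (SPOP) of length $m$ is a word $r_1\cdots r_m$ of distinct elements of a poset; an occurrence of it in a permutation $\pi=\pi_1\cdots\pi_n$ is a factor $\pi_i\cdots\pi_{i+m-1}$ (a set of $m$ consecutive positions) with $\pi_{i+s-1}<\pi_{i+t-1}$ whenever $r_s<r_t$. Occurrences are non-overlapping if their position sets are pairwise disjoint. A permutation avoids $p$ if it has no occurrence; it quasi-avoids $p$ if it has exactly one occurrence of $p$ and that occurrence consists of its $m$ rightmost letters. $\mathrm{inv}(\pi)$ is the number of pairs $i<j$ with $\pi_i>\pi_j$; $[n]_q=1+q+\cdots+q^{n-1}$, $[n]_q!=[n]_q\cdots[1]_q$, $[0]_q!=1$. $A^p_q(x)=\sum_\pi q^{\mathrm{inv}(\pi)}x^{|\pi|}/[|\pi|]_q!$ summed over all permutations avoiding $p$, and $B^p_q(x)$ is the same sum over permutations quasi-avoiding $p$. -}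

module Defs where

open import Data.Nat as ℕ using (ℕ; zero; suc; _+_; _∸_; _⊔_; _≤ᵇ_; _<ᵇ_; _≡ᵇ_; _≤_)
open import Data.Bool using (Bool; true; false; _∧_; _∨_; not; if_then_else_)
open import Data.Fin using (Fin; toℕ)
open import Data.List.Base using (List; []; _∷_; length; map; upTo; allFin; filterᵇ; all; foldr; concatMap; _++_)
open import Data.Integer as ℤ using (ℤ; +_)
open import Data.Product using (_×_; _,_)
open import Relation.Nullary using (does)
open import Relation.Binary using (Decidable; IsStrictPartialOrder)
open import Relation.Binary.PropositionalEquality using (_≡_)

-- A SPOP r₁⋯r_m of distinct poset elements is determined (as far as
-- occurrences are concerned) by the strict partial order it induces on
-- its positions: s ≺ t iff r_s < r_t.

record SPOP : Set₁ where
  field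
    len      : ℕ
    len≥1    : 1 ≤ len
    _≺_      : Fin len → Fin len → Set
    ≺-dec    : Decidable _≺_
    ≺-strict : IsStrictPartialOrder _≡_ _≺_

-- Words / permutations as lists of naturals (0-indexed positions).

-- i-th letter (0-indexed); only used on in-range indices.
at : List ℕ → ℕ → ℕ
at []       _       = 0
at (x ∷ xs) zero    = x
at (x ∷ xs) (suc i) = at xs i

words : ℕ → ℕ → List (List ℕ)
words n zero    = [] ∷ []
words n (suc k) = concatMap (λ w → map (_∷ w) (upTo n)) (words n k)

distinct : List ℕ → Bool
distinct []       = true
distinct (x ∷ xs) = all (λ y → not (x ≡ᵇ y)) xs ∧ distinct xs

perms : ℕ → List (List ℕ)
perms n = filterᵇ distinct (words n n)

pairsBelow : ℕ → List (ℕ × ℕ)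
pairsBelow n = concatMap (λ j → map (λ i → (i , j)) (upTo j)) (upTo n)

inv : List ℕ → ℕ
inv π = length (filterᵇ (λ { (i , j) → at π j <ᵇ at π i }) (pairsBelow (length π)))

module _ (p : SPOP) where
  open SPOP p

  occursAt : List ℕ → ℕ → Bool
  occursAt π i =
    ((i + len) ≤ᵇ length π) ∧
    all (λ s → all (λ t → not (does (≺-dec s t))
                           ∨ (at π (i + toℕ s) <ᵇ at π (i + toℕ t)))
                   (allFin len))
        (allFin len)

  occurrences : List ℕ → List ℕ
  occurrences π = filterᵇ (occursAt π) (upTo (length π))

  avoids : List ℕ → Bool
  avoids π = length (occurrences π) ≡ᵇ 0

  quasiAvoids : List ℕ → Bool
  quasiAvoids π = (length (occurrences π) ≡ᵇ 1) ∧ (len ≤ᵇ length π)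
                  ∧ occursAt π (length π ∸ len)

  sublists : List ℕ → List (List ℕ)
  sublists []       = [] ∷ []
  sublists (x ∷ xs) = map (x ∷_) (sublists xs) ++ sublists xs

  nonOverlapping : List ℕ → List ℕ → Bool
  nonOverlapping π S =
    all (occursAt π) S ∧
    all (λ i → all (λ j → (i ≡ᵇ j) ∨ ((i + len) ≤ᵇ j) ∨ ((j + len) ≤ᵇ i)) S) S

  maxNonOverlap : List ℕ → ℕ
  maxNonOverlap π =
    foldr _⊔_ 0 (map length (filterᵇ (nonOverlapping π) (sublists (upTo (length π)))))

-- Poly1 = ℤ[q] and Poly2 = ℤ[y,q] are represented
-- by their coefficient functions (coefficient of q^b, resp. y^a q^b).
-- All exponents are natural numbers, so products are finite sums.

Poly1 : Set
Poly1 = ℕ → ℤ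

Poly2 : Set
Poly2 = ℕ → ℕ → ℤ

Σ< : ℕ → (ℕ → ℤ) → ℤ
Σ< zero    f = + 0
Σ< (suc n) f = Σ< n f ℤ.+ f n

conv : ℕ → (ℕ → ℕ → ℤ) → ℤ
conv n f = Σ< (suc n) (λ i → f i (n ∸ i))

lift : Poly1 → Poly2
lift P zero    b = P b
lift P (suc a) b = + 0

_+₂_ : Poly2 → Poly2 → Poly2
(P +₂ Q) a b = P a b ℤ.+ Q a b

_-₂_ : Poly2 → Poly2 → Poly2
(P -₂ Q) a b = P a b ℤ.- Q a b

_*₂_ : Poly2 → Poly2 → Poly2
(P *₂ Q) a b = conv a (λ a₁ a₂ → conv b (λ b₁ b₂ → P a₁ b₁ ℤ.* Q a₂ b₂))

y*₂ : Poly2 → Poly2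
y*₂ P zero    b = + 0
y*₂ P (suc a) b = P a b

zero₂ : Poly2
zero₂ a b = + 0

one₂ : Poly2
one₂ zero zero = + 1
one₂ _    _    = + 0

qint : ℕ → Poly1
qint n b = if b <ᵇ n then + 1 else + 0

shiftq : ℕ → Poly1 → Poly1
shiftq k P b = if k ≤ᵇ b then P (b ∸ k) else + 0

qbinom : ℕ → ℕ → Poly1
qbinom n       zero    zero    = + 1
qbinom n       zero    (suc b) = + 0
qbinom zero    (suc k) b       = + 0
qbinom (suc n) (suc k) b       = qbinom n k b ℤ.+ shiftq (suc k) (qbinom n (suc k)) b

-- Eulerian (q-exponential) formal power series in x over ℤ[y,q]:
-- f : ℕ → Poly2 stands for  Σ_n f(n) x^n / [n]_q! .

EGF : Set
EGF = ℕ → Poly2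

_≈ₑ_ : EGF → EGF → Set
f ≈ₑ g = ∀ n a b → f n a b ≡ g n a b

_+ₑ_ : EGF → EGF → EGF
(f +ₑ g) n = f n +₂ g n

_-ₑ_ : EGF → EGF → EGF
(f -ₑ g) n = f n -₂ g n

_*ₑ_ : EGF → EGF → EGF
(f *ₑ g) n = λ a b → conv n (λ k l → (lift (qbinom n k) *₂ (f k *₂ g l)) a b)

oneₑ : EGF
oneₑ zero    = one₂
oneₑ (suc n) = zero₂

yₑ : EGF → EGF
yₑ f n = y*₂ (f n)

-- multiplication by x :  x · f(n-1) x^{n-1}/[n-1]! = [n]_q f(n-1) x^n/[n]!
xₑ : EGF → EGF
xₑ f zero    = zero₂
xₑ f (suc n) = lift (qint (suc n)) *₂ f n

countℤ : List (List ℕ) → (List ℕ → Bool) → ℤ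
countℤ xs t = + length (filterᵇ t xs)

Fₚ : SPOP → EGF
Fₚ p n a b = countℤ (perms n) (λ π → (maxNonOverlap p π ≡ᵇ a) ∧ (inv π ≡ᵇ b))

Aₚ : SPOP → EGF
Aₚ p n a b = lift (λ b′ → countℤ (perms n) (λ π → avoids p π ∧ (inv π ≡ᵇ b′))) a b

Bₚ : SPOP → EGF
Bₚ p n a b = lift (λ b′ → countℤ (perms n) (λ π → quasiAvoids p π ∧ (inv π ≡ᵇ b′))) a b

{-# OPTIONS --safe #-}
-- A permutation containing p splits uniquely into the shortest prefix that quasi-avoids p
-- (it ends with the first occurrence) and the remaining suffix.  Some maximum family of
-- non-overlapping occurrences contains that first occurrence, so N(π) = 1 + N(suffix).
-- Splitting π into prefix and suffix is a shuffle: it is determined by the binary word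
-- recording which values land in the suffix, together with the standardisations of both
-- parts, and inv π is the sum of the inversions of these three; summing q^inv over binary
-- words gives the q-binomial.  Hence F = A + F·yB for the Eulerian product, that is
-- F(1 - yB) = A.  Likewise, deleting the last letter maps avoiders and quasi-avoiders of
-- length n + 1 bijectively onto (avoider, last value) pairs, so A + B = xA + 1.
-- Polynomials in y and q with natural coefficients are handled as multisets of monomials,
-- which turns these bijections into bag equalities of lists.
module Submission where

open import Defs
open import Data.Product using (_×_; _,_)

module BoolComparisons where

  open import Data.Nat using (ℕ; _≤_; _<_; _≡ᵇ_; _<ᵇ_; _≤ᵇ_)
  open import Data.Nat.Properties using (≡ᵇ⇒≡; ≡⇒≡ᵇ; <ᵇ⇒<; <⇒<ᵇ; ≤ᵇ⇒≤; ≤⇒≤ᵇ; ≤⇒≯; <⇒≱; ≰⇒>; _≟_; _≤?_)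
  open import Data.Sum using (_⊎_; inj₁; inj₂)
  open import Data.Bool using (Bool; true; false; T; _∧_; _∨_; not)
  open import Data.Bool.Properties using (T-≡)
  open import Data.Empty using (⊥-elim)
  open import Data.Unit using (tt)
  open import Function using (_∘_; Equivalence)
  open import Relation.Nullary using (¬_; yes; no)
  open import Relation.Binary.PropositionalEquality

  T⇒≡true : {b : Bool} → T b → b ≡ true
  T⇒≡true = Equivalence.to T-≡

  ≡true⇒T : {b : Bool} → b ≡ true → T b
  ≡true⇒T = Equivalence.from T-≡

  ¬T⇒≡false : {b : Bool} → ¬ T b → b ≡ false
  ¬T⇒≡false {false} _ = refl
  ¬T⇒≡false {true} ¬t = ⊥-elim (¬t tt)

  true≢false : true ≢ false
  true≢false ()

  ¬≡true⇒≡false : {b : Bool} → b ≢ true → b ≡ false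
  ¬≡true⇒≡false {false} _ = refl
  ¬≡true⇒≡false {true} ¬t = ⊥-elim (¬t refl)

  ∧-cong-when : (a : Bool) {x y : Bool} → (a ≡ true → x ≡ y) → a ∧ x ≡ a ∧ y
  ∧-cong-when true h = h refl
  ∧-cong-when false h = refl

  ∧-split : (a b : Bool) → a ∧ b ≡ true → a ≡ true × b ≡ true
  ∧-split true true e = refl , refl

  ∧-intro : {a b : Bool} → a ≡ true → b ≡ true → a ∧ b ≡ true
  ∧-intro refl refl = refl

  not-true : (b : Bool) → not b ≡ true → b ≡ false
  not-true false e = refl

  ≡ᵇ-true⁺ : (m n : ℕ) → m ≡ n → (m ≡ᵇ n) ≡ true
  ≡ᵇ-true⁺ m n = T⇒≡true ∘ ≡⇒≡ᵇ m n

  ≡ᵇ-true⁻ : (m n : ℕ) → (m ≡ᵇ n) ≡ true → m ≡ n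
  ≡ᵇ-true⁻ m n = ≡ᵇ⇒≡ m n ∘ ≡true⇒T

  ≡ᵇ-false⁺ : (m n : ℕ) → m ≢ n → (m ≡ᵇ n) ≡ false
  ≡ᵇ-false⁺ m n m≢n = ¬T⇒≡false (m≢n ∘ ≡ᵇ⇒≡ m n)

  ≡ᵇ-iff : (m n m′ n′ : ℕ) → (m ≡ n → m′ ≡ n′) → (m′ ≡ n′ → m ≡ n) → (m ≡ᵇ n) ≡ (m′ ≡ᵇ n′)
  ≡ᵇ-iff m n m′ n′ f g with m ≟ n
  ... | yes e = trans (≡ᵇ-true⁺ m n e) (sym (≡ᵇ-true⁺ m′ n′ (f e)))
  ... | no ne = trans (≡ᵇ-false⁺ m n ne) (sym (≡ᵇ-false⁺ m′ n′ (ne ∘ g)))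

  <ᵇ-true⁺ : (m n : ℕ) → m < n → (m <ᵇ n) ≡ true
  <ᵇ-true⁺ m n = T⇒≡true ∘ <⇒<ᵇ

  <ᵇ-true⁻ : (m n : ℕ) → (m <ᵇ n) ≡ true → m < n
  <ᵇ-true⁻ m n = <ᵇ⇒< m n ∘ ≡true⇒T

  <ᵇ-false⁺ : (m n : ℕ) → n ≤ m → (m <ᵇ n) ≡ false
  <ᵇ-false⁺ m n n≤m = ¬T⇒≡false (≤⇒≯ n≤m ∘ <ᵇ⇒< m n)

  ≤ᵇ-true⁺ : (m n : ℕ) → m ≤ n → (m ≤ᵇ n) ≡ true
  ≤ᵇ-true⁺ m n = T⇒≡true ∘ ≤⇒≤ᵇ

  ≤ᵇ-true⁻ : (m n : ℕ) → (m ≤ᵇ n) ≡ true → m ≤ n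
  ≤ᵇ-true⁻ m n = ≤ᵇ⇒≤ m n ∘ ≡true⇒T

  ≤ᵇ-false⁺ : (m n : ℕ) → n < m → (m ≤ᵇ n) ≡ false
  ≤ᵇ-false⁺ m n n<m = ¬T⇒≡false (<⇒≱ n<m ∘ ≤ᵇ⇒≤ m n)

  ∨-split : (a b : Bool) → a ∨ b ≡ true → a ≡ true ⊎ b ≡ true
  ∨-split true b e = inj₁ refl
  ∨-split false b e = inj₂ e

  ∨-introˡ : {a : Bool} (b : Bool) → a ≡ true → a ∨ b ≡ true
  ∨-introˡ b refl = refl

  ∨-introʳ : (a : Bool) {b : Bool} → b ≡ true → a ∨ b ≡ true
  ∨-introʳ true e = refl
  ∨-introʳ false e = e

  ≤ᵇ-iff : (a b a' b' : ℕ) → (a ≤ b → a' ≤ b') → (a' ≤ b' → a ≤ b) → (a ≤ᵇ b) ≡ (a' ≤ᵇ b')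
  ≤ᵇ-iff a b a' b' f g with a ≤? b
  ... | yes le = trans (≤ᵇ-true⁺ a b le) (sym (≤ᵇ-true⁺ a' b' (f le)))
  ... | no nle = trans (≤ᵇ-false⁺ a b (≰⇒> nle)) (sym (≤ᵇ-false⁺ a' b' (≰⇒> (λ le → nle (g le)))))

module Counting where

  open BoolComparisons
  open import Data.Nat using (ℕ; zero; suc; _+_; _*_; _≤_; _<_; z≤n; s≤s; s≤s⁻¹; z<s; _≡ᵇ_; _<ᵇ_)
  open import Data.Nat.Properties
  open import Algebra.Properties.CommutativeSemigroup +-commutativeSemigroup using (interchange)
  open import Data.Bool using (Bool; true; false; _∧_; if_then_else_)
  open import Data.List using (List; []; _∷_; _++_; map; length; filterᵇ; concatMap; upTo)
  open import Data.List.Properties using (length-++; upTo-∷ʳ; map-upTo)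
  open import Data.Sum using (inj₁; inj₂)
  open import Data.List.Membership.Propositional using (_∈_)
  open import Data.List.Membership.Propositional.Properties using (∈-∃++)
  open import Data.List.Relation.Unary.Any using (here; there)
  open import Data.List.Relation.Unary.Unique.Propositional using (Unique; tail)
  open import Data.List.Relation.Unary.AllPairs using (_∷_)
  import Data.List.Relation.Unary.Unique.Propositional.Properties as UP
  open import Data.List.Relation.Binary.Permutation.Propositional using (_↭_; ↭-sym; ↭⇒↭ₛ)
  open import Data.List.Relation.Binary.Permutation.Propositional.Properties using (shift; ∈-resp-↭)
  import Data.List.Relation.Binary.Permutation.Setoid.Properties as PS
  open import Data.Empty using (⊥-elim)
  open import Data.Product using (proj₁; proj₂)
  open import Function using (_∘_)
  open import Relation.Nullary using (yes; no)
  open import Relation.Binary.PropositionalEquality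

  private variable
    A B : Set

  countᵇ : (A → Bool) → List A → ℕ
  countᵇ t xs = length (filterᵇ t xs)

  [_]b : Bool → ℕ
  [ true ]b = 1
  [ false ]b = 0

  [∧]b : (a b : Bool) → [ a ∧ b ]b ≡ [ a ]b * [ b ]b
  [∧]b true b = sym (+-identityʳ _)
  [∧]b false b = refl

  countᵇ-∷ : (t : A → Bool) (x : A) (xs : List A) → countᵇ t (x ∷ xs) ≡ [ t x ]b + countᵇ t xs
  countᵇ-∷ t x xs with t x
  ... | true = refl
  ... | false = refl

  countᵇ-++ : (t : A → Bool) (xs ys : List A) → countᵇ t (xs ++ ys) ≡ countᵇ t xs + countᵇ t ys
  countᵇ-++ t [] ys = refl
  countᵇ-++ t (x ∷ xs) ys = begin
    countᵇ t (x ∷ xs ++ ys)                 ≡⟨ countᵇ-∷ t x (xs ++ ys) ⟩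
    [ t x ]b + countᵇ t (xs ++ ys)          ≡⟨ cong ([ t x ]b +_) (countᵇ-++ t xs ys) ⟩
    [ t x ]b + (countᵇ t xs + countᵇ t ys)  ≡⟨ +-assoc [ t x ]b _ _ ⟨
    [ t x ]b + countᵇ t xs + countᵇ t ys    ≡⟨ cong (_+ countᵇ t ys) (countᵇ-∷ t x xs) ⟨
    countᵇ t (x ∷ xs) + countᵇ t ys         ∎
    where open ≡-Reasoning

  countᵇ-map : (t : B → Bool) (f : A → B) (xs : List A) → countᵇ t (map f xs) ≡ countᵇ (t ∘ f) xs
  countᵇ-map t f [] = refl
  countᵇ-map t f (x ∷ xs) = trans (countᵇ-∷ t (f x) (map f xs))
    (trans (cong ([ t (f x) ]b +_) (countᵇ-map t f xs)) (sym (countᵇ-∷ (t ∘ f) x xs)))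

  filter-∷ : (P : A → Bool) (x : A) (xs : List A) →
    filterᵇ P (x ∷ xs) ≡ (if P x then x ∷ filterᵇ P xs else filterᵇ P xs)
  filter-∷ P x xs with P x
  ... | true = refl
  ... | false = refl

  countᵇ-filter : (t P : A → Bool) (xs : List A) → countᵇ t (filterᵇ P xs) ≡ countᵇ (λ x → P x ∧ t x) xs
  countᵇ-filter t P [] = refl
  countᵇ-filter t P (x ∷ xs) =
    trans (cong (countᵇ t) (filter-∷ P x xs)) (trans (by-cases (P x)) (sym (countᵇ-∷ (λ x → P x ∧ t x) x xs)))
    where
    by-cases : (b : Bool) → countᵇ t (if b then x ∷ filterᵇ P xs else filterᵇ P xs) ≡
                            [ b ∧ t x ]b + countᵇ (λ x → P x ∧ t x) xs
    by-cases true = trans (countᵇ-∷ t x (filterᵇ P xs)) (cong ([ t x ]b +_) (countᵇ-filter t P xs))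
    by-cases false = countᵇ-filter t P xs

  countᵇ-cong : (t u : A → Bool) (xs : List A) → (∀ x → x ∈ xs → t x ≡ u x) → countᵇ t xs ≡ countᵇ u xs
  countᵇ-cong t u [] h = refl
  countᵇ-cong t u (x ∷ xs) h = trans (countᵇ-∷ t x xs) (trans (cong₂ _+_ (cong [_]b (h x (here refl)))
    (countᵇ-cong t u xs (λ y y∈ → h y (there y∈)))) (sym (countᵇ-∷ u x xs)))

  countᵇ-false : (t : A → Bool) (xs : List A) → (∀ x → x ∈ xs → t x ≡ false) → countᵇ t xs ≡ 0
  countᵇ-false t [] h = refl
  countᵇ-false t (x ∷ xs) h = trans (countᵇ-∷ t x xs)
    (cong₂ _+_ (cong [_]b (h x (here refl))) (countᵇ-false t xs (λ y y∈ → h y (there y∈))))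

  countᵇ-true : (t : A → Bool) (xs : List A) → (∀ x → x ∈ xs → t x ≡ true) → countᵇ t xs ≡ length xs
  countᵇ-true t [] h = refl
  countᵇ-true t (x ∷ xs) h = trans (countᵇ-∷ t x xs)
    (cong₂ _+_ (cong [_]b (h x (here refl))) (countᵇ-true t xs (λ y y∈ → h y (there y∈))))

  countᵇ-≤ : (t : A → Bool) (xs : List A) → countᵇ t xs ≤ length xs
  countᵇ-≤ t [] = z≤n
  countᵇ-≤ t (x ∷ xs) with t x
  ... | true = s≤s (countᵇ-≤ t xs)
  ... | false = m≤n⇒m≤1+n (countᵇ-≤ t xs)

  x+[y+z]≡y+[x+z] : ∀ a b c → a + (b + c) ≡ b + (a + c)
  x+[y+z]≡y+[x+z] a b c = trans (sym (+-assoc a b c)) (trans (cong (_+ c) (+-comm a b)) (+-assoc b a c))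

  countᵇ-remove : (t : A → Bool) (ys zs : List A) (x : A) →
    countᵇ t (ys ++ x ∷ zs) ≡ [ t x ]b + countᵇ t (ys ++ zs)
  countᵇ-remove t ys zs x = begin
    countᵇ t (ys ++ x ∷ zs)                   ≡⟨ countᵇ-++ t ys (x ∷ zs) ⟩
    countᵇ t ys + countᵇ t (x ∷ zs)           ≡⟨ cong (countᵇ t ys +_) (countᵇ-∷ t x zs) ⟩
    countᵇ t ys + ([ t x ]b + countᵇ t zs)    ≡⟨ x+[y+z]≡y+[x+z] (countᵇ t ys) [ t x ]b (countᵇ t zs) ⟩
    [ t x ]b + (countᵇ t ys + countᵇ t zs)    ≡⟨ cong ([ t x ]b +_) (countᵇ-++ t ys zs) ⟨
    [ t x ]b + countᵇ t (ys ++ zs)            ∎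
    where open ≡-Reasoning

  _∼bag_ : List A → List A → Set
  xs ∼bag ys = ∀ t → countᵇ t xs ≡ countᵇ t ys

  ∼bag-length : {xs ys : List A} → xs ∼bag ys → length xs ≡ length ys
  ∼bag-length {xs = xs} {ys} e = trans (sym (countᵇ-true (λ _ → true) xs (λ _ _ → refl)))
    (trans (e (λ _ → true)) (countᵇ-true (λ _ → true) ys (λ _ _ → refl)))

  ∈-tail : {x y : A} {xs : List A} → y ∈ x ∷ xs → y ≢ x → y ∈ xs
  ∈-tail (here p) ne = ⊥-elim (ne p)
  ∈-tail (there p) ne = p

  unique-↭ : {xs ys : List A} → xs ↭ ys → Unique xs → Unique ys
  unique-↭ p = PS.Unique-resp-↭ (setoid _) (↭⇒↭ₛ p)

  private
    ⊆-remove : {x : A} {xs : List A} (ys zs : List A) → Unique (x ∷ xs) →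
      (∀ z → z ∈ x ∷ xs → z ∈ ys ++ x ∷ zs) → ∀ z → z ∈ xs → z ∈ ys ++ zs
    ⊆-remove ys zs u f z z∈ =
      ∈-tail (∈-resp-↭ (shift _ ys zs) (f z (there z∈))) (λ { refl → UP.Unique[x∷xs]⇒x∉xs u z∈ })

  unique-same-members⇒∼bag : (xs ys : List A) → Unique xs → Unique ys →
    (∀ z → z ∈ xs → z ∈ ys) → (∀ z → z ∈ ys → z ∈ xs) → xs ∼bag ys
  unique-same-members⇒∼bag [] [] ux uy f g t = refl
  unique-same-members⇒∼bag [] (y ∷ ys) ux uy f g t with g y (here refl)
  ... | ()
  unique-same-members⇒∼bag (x ∷ xs) ys ux uy f g t with ∈-∃++ (f x (here refl))
  ... | ys₁ , ys₂ , refl = trans (countᵇ-∷ t x xs) (trans (cong ([ t x ]b +_) ih) (sym (countᵇ-remove t ys₁ ys₂ x)))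
    where
    u′ : Unique (x ∷ ys₁ ++ ys₂)
    u′ = unique-↭ (shift x ys₁ ys₂) uy
    ih : countᵇ t xs ≡ countᵇ t (ys₁ ++ ys₂)
    ih = unique-same-members⇒∼bag xs (ys₁ ++ ys₂) (tail ux) (tail u′) (⊆-remove ys₁ ys₂ ux f)
      (λ z z∈ → ∈-tail (g z (∈-resp-↭ (↭-sym (shift x ys₁ ys₂)) (there z∈)))
                       (λ { refl → UP.Unique[x∷xs]⇒x∉xs u′ z∈ }))
      t

  length-insert : (ys zs : List A) (x : A) → length (ys ++ x ∷ zs) ≡ suc (length (ys ++ zs))
  length-insert ys zs x = trans (length-++ ys) (trans (+-suc (length ys) (length zs)) (cong suc (sym (length-++ ys))))

  unique-⊆-≤ : (xs ys : List A) → Unique xs → (∀ z → z ∈ xs → z ∈ ys) → length xs ≤ length ys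
  unique-⊆-≤ [] ys ux f = z≤n
  unique-⊆-≤ (x ∷ xs) ys ux f with ∈-∃++ (f x (here refl))
  ... | ys₁ , ys₂ , refl = subst (suc (length xs) ≤_) (sym (length-insert ys₁ ys₂ x))
    (s≤s (unique-⊆-≤ xs (ys₁ ++ ys₂) (tail ux) (⊆-remove ys₁ ys₂ ux f)))

  unique-⊆-length⇒⊇ : (xs ys : List A) → Unique xs → (∀ z → z ∈ xs → z ∈ ys) → length ys ≤ length xs →
    ∀ z → z ∈ ys → z ∈ xs
  unique-⊆-length⇒⊇ [] [] ux f le z ()
  unique-⊆-length⇒⊇ [] (y ∷ ys) ux f () z z∈
  unique-⊆-length⇒⊇ (x ∷ xs) ys ux f le z z∈ with ∈-∃++ (f x (here refl))
  ... | ys₁ , ys₂ , refl with ∈-resp-↭ (shift x ys₁ ys₂) z∈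
  ... | here p = here p
  ... | there z∈′ = there (unique-⊆-length⇒⊇ xs (ys₁ ++ ys₂) (tail ux) (⊆-remove ys₁ ys₂ ux f)
          (s≤s⁻¹ (subst (_≤ suc (length xs)) (length-insert ys₁ ys₂ x) le)) z z∈′)

  countᵇ-upTo-∷ʳ : (t : ℕ → Bool) (n : ℕ) → countᵇ t (upTo (suc n)) ≡ countᵇ t (upTo n) + [ t n ]b
  countᵇ-upTo-∷ʳ t n = trans (cong (countᵇ t) (sym (upTo-∷ʳ n)))
    (trans (countᵇ-++ t (upTo n) (n ∷ [])) (cong (countᵇ t (upTo n) +_) (trans (countᵇ-∷ t n []) (+-identityʳ _))))

  countᵇ-upTo-cut : (t : ℕ → Bool) (j n : ℕ) → j ≤ n → (∀ i → j ≤ i → i < n → t i ≡ false) →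
    countᵇ t (upTo n) ≡ countᵇ t (upTo j)
  countᵇ-upTo-cut t j zero z≤n h = refl
  countᵇ-upTo-cut t j (suc n) j≤1+n h with m≤n⇒m<n∨m≡n j≤1+n
  ... | inj₂ refl = refl
  ... | inj₁ (s≤s j≤n) = trans (countᵇ-upTo-∷ʳ t n)
    (trans (cong₂ _+_ (countᵇ-upTo-cut t j n j≤n (λ i j≤i i<n → h i j≤i (m<n⇒m<1+n i<n))) (cong [_]b (h n j≤n ≤-refl)))
           (+-identityʳ _))

  upTo-suc : (m : ℕ) → upTo (suc m) ≡ 0 ∷ map suc (upTo m)
  upTo-suc m = cong (0 ∷_) (sym (map-upTo suc m))

  countᵇ-upTo-suc : (t : ℕ → Bool) (m : ℕ) → countᵇ t (upTo (suc m)) ≡ [ t 0 ]b + countᵇ (t ∘ suc) (upTo m)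
  countᵇ-upTo-suc t m = trans (cong (countᵇ t) (upTo-suc m)) (trans (countᵇ-∷ t 0 _) (cong ([ t 0 ]b +_) (countᵇ-map t suc (upTo m))))

  countᵇ-upTo-< : (x m : ℕ) → (m ≤ x → countᵇ (_<ᵇ x) (upTo m) ≡ m) × (x ≤ m → countᵇ (_<ᵇ x) (upTo m) ≡ x)
  countᵇ-upTo-< x zero = (λ _ → refl) , (λ { z≤n → refl })
  countᵇ-upTo-< x (suc m) = below , above
    where
    ih = countᵇ-upTo-< x m
    step : countᵇ (_<ᵇ x) (upTo (suc m)) ≡ countᵇ (_<ᵇ x) (upTo m) + [ m <ᵇ x ]b
    step = trans (cong (countᵇ (_<ᵇ x)) (sym (upTo-∷ʳ m))) (trans (countᵇ-++ (_<ᵇ x) (upTo m) (m ∷ []))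
             (cong (countᵇ (_<ᵇ x) (upTo m) +_) (trans (countᵇ-∷ (_<ᵇ x) m []) (+-identityʳ _))))
      where open import Data.List.Properties using (upTo-∷ʳ)
    below : suc m ≤ x → countᵇ (_<ᵇ x) (upTo (suc m)) ≡ suc m
    below le = trans step (trans (cong₂ _+_ (proj₁ ih (<⇒≤ le)) (cong [_]b (<ᵇ-true⁺ m x le))) (+-comm m 1))
    above : x ≤ suc m → countᵇ (_<ᵇ x) (upTo (suc m)) ≡ x
    above le with m≤n⇒m<n∨m≡n le
    ... | inj₁ (s≤s lt) = trans step (trans (cong₂ _+_ (proj₂ ih lt) (cong [_]b (<ᵇ-false⁺ m x lt))) (+-identityʳ x))
    ... | inj₂ refl = trans step (trans (cong₂ _+_ (proj₁ ih (n≤1+n m)) (cong [_]b (<ᵇ-true⁺ m (suc m) ≤-refl))) (+-comm m 1))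

  countᵇ-lt-len : (t : A → Bool) (xs : List A) (z : A) → z ∈ xs → t z ≡ false → countᵇ t xs < length xs
  countᵇ-lt-len t (x ∷ xs) z (here refl) tz = subst (λ w → w < suc (length xs))
      (sym (trans (countᵇ-∷ t x xs) (cong (λ b → [ b ]b + countᵇ t xs) tz))) (s≤s (countᵇ-≤ t xs))
  countᵇ-lt-len t (x ∷ xs) z (there z∈) tz = ≤-<-trans (≤-reflexive (countᵇ-∷ t x xs)) (by-cases (t x))
    where
    ih = countᵇ-lt-len t xs z z∈ tz
    by-cases : (b : Bool) → [ b ]b + countᵇ t xs < suc (length xs)
    by-cases true = s≤s ih
    by-cases false = m≤n⇒m≤1+n ih

  countᵇ-mono : (t u : A → Bool) (xs : List A) → (∀ z → t z ≡ true → u z ≡ true) → countᵇ t xs ≤ countᵇ u xs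
  countᵇ-mono t u [] h = z≤n
  countᵇ-mono t u (x ∷ xs) h = subst₂ _≤_ (sym (countᵇ-∷ t x xs)) (sym (countᵇ-∷ u x xs)) (by-cases (t x) (u x) refl refl)
    where
    ih = countᵇ-mono t u xs h
    by-cases : (a b : Bool) → t x ≡ a → u x ≡ b → [ a ]b + countᵇ t xs ≤ [ b ]b + countᵇ u xs
    by-cases true true _ _ = s≤s ih
    by-cases true false e1 e2 = ⊥-elim (true≢false (trans (sym (h x e1)) e2))
    by-cases false true _ _ = m≤n⇒m≤1+n ih
    by-cases false false _ _ = ih

  countᵇ-strict : (t u : A → Bool) (xs : List A) (z : A) → (∀ w → t w ≡ true → u w ≡ true) → z ∈ xs → t z ≡ false → u z ≡ true → countᵇ t xs <
      countᵇ u xs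
  countᵇ-strict t u (x ∷ xs) z h (here refl) tz uz = subst₂ _<_ (sym (countᵇ-∷ t x xs)) (sym (countᵇ-∷ u x xs))
    (subst₂ (λ a b → [ a ]b + countᵇ t xs < [ b ]b + countᵇ u xs) (sym tz) (sym uz) (s≤s (countᵇ-mono t u xs h)))
  countᵇ-strict t u (x ∷ xs) z h (there z∈) tz uz = subst₂ _<_ (sym (countᵇ-∷ t x xs)) (sym (countᵇ-∷ u x xs)) (by-cases (t x) (u x) refl refl)
    where
    ih = countᵇ-strict t u xs z h z∈ tz uz
    by-cases : (a b : Bool) → t x ≡ a → u x ≡ b → [ a ]b + countᵇ t xs < [ b ]b + countᵇ u xs
    by-cases true true _ _ = s≤s ih
    by-cases true false e1 e2 = ⊥-elim (true≢false (trans (sym (h x e1)) e2))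
    by-cases false true _ _ = m≤n⇒m≤1+n ih
    by-cases false false _ _ = ih

  Σℕ : ℕ → (ℕ → ℕ) → ℕ
  Σℕ zero f = 0
  Σℕ (suc n) f = Σℕ n f + f n

  concat< : ℕ → (ℕ → List A) → List A
  concat< zero f = []
  concat< (suc n) f = concat< n f ++ f n

  countᵇ-concat< : (t : A → Bool) (n : ℕ) (f : ℕ → List A) →
    countᵇ t (concat< n f) ≡ Σℕ n (λ k → countᵇ t (f k))
  countᵇ-concat< t zero f = refl
  countᵇ-concat< t (suc n) f =
    trans (countᵇ-++ t (concat< n f) (f n)) (cong (_+ countᵇ t (f n)) (countᵇ-concat< t n f))

  concat<-[] : (n : ℕ) (f : ℕ → List A) → (∀ k → k < n → f k ≡ []) → concat< n f ≡ []
  concat<-[] zero f h = refl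
  concat<-[] (suc n) f h = cong₂ _++_ (concat<-[] n f (λ k k< → h k (m<n⇒m<1+n k<))) (h n ≤-refl)

  Σℕ-cong : (n : ℕ) (f g : ℕ → ℕ) → (∀ k → k < n → f k ≡ g k) → Σℕ n f ≡ Σℕ n g
  Σℕ-cong zero f g h = refl
  Σℕ-cong (suc n) f g h = cong₂ _+_ (Σℕ-cong n f g (λ k k< → h k (m≤n⇒m≤1+n k<))) (h n ≤-refl)

  Σℕ-+ : (n : ℕ) (f g : ℕ → ℕ) → Σℕ n (λ k → f k + g k) ≡ Σℕ n f + Σℕ n g
  Σℕ-+ zero f g = refl
  Σℕ-+ (suc n) f g = trans (cong (_+ (f n + g n)) (Σℕ-+ n f g)) (interchange (Σℕ n f) (Σℕ n g) (f n) (g n))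

  Σℕ-*ˡ : (n c : ℕ) (f : ℕ → ℕ) → Σℕ n (λ k → c * f k) ≡ c * Σℕ n f
  Σℕ-*ˡ zero c f = sym (*-zeroʳ c)
  Σℕ-*ˡ (suc n) c f = trans (cong (_+ c * f n) (Σℕ-*ˡ n c f)) (sym (*-distribˡ-+ c (Σℕ n f) (f n)))

  Σℕ-zero : (n : ℕ) (f : ℕ → ℕ) → (∀ k → k < n → f k ≡ 0) → Σℕ n f ≡ 0
  Σℕ-zero zero f h = refl
  Σℕ-zero (suc n) f h = cong₂ _+_ (Σℕ-zero n f (λ k k< → h k (m≤n⇒m≤1+n k<))) (h n ≤-refl)

  Σℕ-single : (n k₀ : ℕ) (f : ℕ → ℕ) → k₀ < n → (∀ k → k < n → k ≢ k₀ → f k ≡ 0) → Σℕ n f ≡ f k₀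
  Σℕ-single (suc n) k₀ f lt h with k₀ ≟ n
  ... | yes refl = cong (_+ f k₀) (Σℕ-zero n f (λ k k< → h k (m≤n⇒m≤1+n k<) (λ { refl → <-irrefl refl k< })))
  ... | no ne = trans (cong₂ _+_ (Σℕ-single n k₀ f (≤∧≢⇒< (s≤s⁻¹ lt) ne) (λ k k< → h k (m≤n⇒m≤1+n k<)))
                                (h n ≤-refl (ne ∘ sym)))
                     (+-identityʳ (f k₀))

  filter-∼bag-concat< : (L : List A) (P : A → Bool) (n : ℕ) (Q : ℕ → A → Bool) →
    (∀ x → x ∈ L → Σℕ n (λ k → [ Q k x ]b) ≡ [ P x ]b) →
    filterᵇ P L ∼bag concat< n (λ k → filterᵇ (Q k) L)
  filter-∼bag-concat< L P n Q h t = trans (countᵇ-filter t P L) (trans (by-induction L h) (sym (trans (countᵇ-concat< t n _)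
      (Σℕ-cong n _ _ (λ k _ → countᵇ-filter t (Q k) L)))))
    where
    by-induction : (L : List _) → (∀ x → x ∈ L → Σℕ n (λ k → [ Q k x ]b) ≡ [ P x ]b) →
         countᵇ (λ x → P x ∧ t x) L ≡ Σℕ n (λ k → countᵇ (λ x → Q k x ∧ t x) L)
    by-induction [] h = sym (Σℕ-zero n _ (λ _ _ → refl))
    by-induction (x ∷ L) h = begin
      countᵇ (λ x → P x ∧ t x) (x ∷ L)                                        ≡⟨ countᵇ-∷ _ x L ⟩
      [ P x ∧ t x ]b + countᵇ (λ x → P x ∧ t x) L                               ≡⟨ cong₂ _+_ head (by-induction L (λ y y∈ → h y (there y∈))) ⟩
      Σℕ n (λ k → [ Q k x ∧ t x ]b) + Σℕ n (λ k → countᵇ (λ x → Q k x ∧ t x) L) ≡⟨ Σℕ-+ n _ _ ⟨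
      Σℕ n (λ k → [ Q k x ∧ t x ]b + countᵇ (λ x → Q k x ∧ t x) L)              ≡⟨ Σℕ-cong n _ _ (λ k _ → sym (countᵇ-∷ _ x L)) ⟩
      Σℕ n (λ k → countᵇ (λ x → Q k x ∧ t x) (x ∷ L))                           ∎
      where
      open ≡-Reasoning
      head : [ P x ∧ t x ]b ≡ Σℕ n (λ k → [ Q k x ∧ t x ]b)
      head = begin
        [ P x ∧ t x ]b                      ≡⟨ [∧]b (P x) (t x) ⟩
        [ P x ]b * [ t x ]b                 ≡⟨ *-comm [ P x ]b _ ⟩
        [ t x ]b * [ P x ]b                 ≡⟨ cong ([ t x ]b *_) (h x (here refl)) ⟨
        [ t x ]b * Σℕ n (λ k → [ Q k x ]b)  ≡⟨ Σℕ-*ˡ n [ t x ]b (λ k → [ Q k x ]b) ⟨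
        Σℕ n (λ k → [ t x ]b * [ Q k x ]b)  ≡⟨ Σℕ-cong n _ _ (λ k _ → trans (*-comm [ t x ]b _) (sym ([∧]b (Q k x) (t x)))) ⟩
        Σℕ n (λ k → [ Q k x ∧ t x ]b)       ∎

  countᵇ-pos : (t : A → Bool) {x : A} (xs : List A) → x ∈ xs → t x ≡ true → 0 < countᵇ t xs
  countᵇ-pos t (y ∷ ys) (here refl) tx = subst (0 <_) (sym (countᵇ-∷ t y ys)) (subst (λ b → 0 < [ b ]b + countᵇ t ys) (sym tx) z<s)
  countᵇ-pos t (y ∷ ys) (there x∈) tx = subst (0 <_) (sym (countᵇ-∷ t y ys)) (≤-trans (countᵇ-pos t ys x∈ tx) (m≤n+m _ [ t y ]b))

  countᵇ-zero⁻ : (t : A → Bool) (xs : List A) → countᵇ t xs ≡ 0 → ∀ x → x ∈ xs → t x ≡ false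
  countᵇ-zero⁻ t xs e x x∈ with t x in tx
  ... | false = refl
  ... | true = ⊥-elim (<-irrefl (sym e) (countᵇ-pos t xs x∈ tx))

  countᵇ-split : (P Q R : A → Bool) (L : List A) → (∀ x → x ∈ L → [ P x ]b ≡ [ Q x ]b + [ R x ]b) →
    countᵇ P L ≡ countᵇ Q L + countᵇ R L
  countᵇ-split P Q R [] h = refl
  countᵇ-split P Q R (x ∷ L) h = begin
    countᵇ P (x ∷ L)                                      ≡⟨ countᵇ-∷ P x L ⟩
    [ P x ]b + countᵇ P L                                 ≡⟨ cong₂ _+_ (h x (here refl)) (countᵇ-split P Q R L (λ y y∈ → h y (there y∈))) ⟩
    ([ Q x ]b + [ R x ]b) + (countᵇ Q L + countᵇ R L)     ≡⟨ interchange [ Q x ]b [ R x ]b _ _ ⟩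
    ([ Q x ]b + countᵇ Q L) + ([ R x ]b + countᵇ R L)     ≡⟨ cong₂ _+_ (countᵇ-∷ Q x L) (countᵇ-∷ R x L) ⟨
    countᵇ Q (x ∷ L) + countᵇ R (x ∷ L)                   ∎
    where open ≡-Reasoning

  sumL : (A → ℕ) → List A → ℕ
  sumL h [] = 0
  sumL h (x ∷ xs) = h x + sumL h xs

  sumL-cong : (h h′ : A → ℕ) (xs : List A) → (∀ x → x ∈ xs → h x ≡ h′ x) → sumL h xs ≡ sumL h′ xs
  sumL-cong h h′ [] e = refl
  sumL-cong h h′ (x ∷ xs) e = cong₂ _+_ (e x (here refl)) (sumL-cong h h′ xs (λ y y∈ → e y (there y∈)))

  sumL-+ : (h h′ : A → ℕ) (xs : List A) → sumL (λ x → h x + h′ x) xs ≡ sumL h xs + sumL h′ xs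
  sumL-+ h h′ [] = refl
  sumL-+ h h′ (x ∷ xs) = trans (cong (h x + h′ x +_) (sumL-+ h h′ xs)) (interchange (h x) (h′ x) (sumL h xs) (sumL h′ xs))

  sumL-map : (h : B → ℕ) (f : A → B) (xs : List A) → sumL h (map f xs) ≡ sumL (h ∘ f) xs
  sumL-map h f [] = refl
  sumL-map h f (x ∷ xs) = cong (h (f x) +_) (sumL-map h f xs)

  sumL-++ : (h : A → ℕ) (xs ys : List A) → sumL h (xs ++ ys) ≡ sumL h xs + sumL h ys
  sumL-++ h [] ys = refl
  sumL-++ h (x ∷ xs) ys = trans (cong (h x +_) (sumL-++ h xs ys)) (sym (+-assoc (h x) _ _))

  countᵇ-sumL : (t : A → Bool) (xs : List A) → countᵇ t xs ≡ sumL (λ x → [ t x ]b) xs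
  countᵇ-sumL t [] = refl
  countᵇ-sumL t (x ∷ xs) = trans (countᵇ-∷ t x xs) (cong ([ t x ]b +_) (countᵇ-sumL t xs))

  sumL-upTo-suc : (h : ℕ → ℕ) (m : ℕ) → sumL h (upTo (suc m)) ≡ h 0 + sumL (h ∘ suc) (upTo m)
  sumL-upTo-suc h m = trans (cong (sumL h) (upTo-suc m)) (cong (h 0 +_) (sumL-map h suc (upTo m)))

  countᵇ-concatMap : (t : B → Bool) (f : A → List B) (L : List A) →
    countᵇ t (concatMap f L) ≡ sumL (λ x → countᵇ t (f x)) L
  countᵇ-concatMap t f [] = refl
  countᵇ-concatMap t f (x ∷ L) =
    trans (countᵇ-++ t (f x) (concatMap f L)) (cong (countᵇ t (f x) +_) (countᵇ-concatMap t f L))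

  private
    countᵇ-≡ᵇ-pos⇒∈ : (x : ℕ) (ys : List ℕ) → 0 < countᵇ (_≡ᵇ x) ys → x ∈ ys
    countᵇ-≡ᵇ-pos⇒∈ x (y ∷ ys) pos with y ≡ᵇ x in e
    ... | true = here (sym (≡ᵇ-true⁻ y x e))
    ... | false = there (countᵇ-≡ᵇ-pos⇒∈ x ys pos)

    sumL-remove : (g : ℕ → ℕ) (ys zs : List ℕ) (x : ℕ) → sumL g (ys ++ x ∷ zs) ≡ g x + sumL g (ys ++ zs)
    sumL-remove g [] zs x = refl
    sumL-remove g (y ∷ ys) zs x = trans (cong (g y +_) (sumL-remove g ys zs x)) (x+[y+z]≡y+[x+z] (g y) (g x) _)

  sumL-resp-∼bag : (g : ℕ → ℕ) (xs ys : List ℕ) → xs ∼bag ys → sumL g xs ≡ sumL g ys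
  sumL-resp-∼bag g [] [] e = refl
  sumL-resp-∼bag g [] (y ∷ ys) e with ∼bag-length {xs = []} {ys = y ∷ ys} e
  ... | ()
  sumL-resp-∼bag g (x ∷ xs) ys e
    with ∈-∃++ (countᵇ-≡ᵇ-pos⇒∈ x ys (subst (0 <_) (e (_≡ᵇ x)) (countᵇ-pos (_≡ᵇ x) (x ∷ xs) (here refl) (≡ᵇ-true⁺ x x refl))))
  ... | ys₁ , ys₂ , refl = trans (cong (g x +_) (sumL-resp-∼bag g xs (ys₁ ++ ys₂) e′)) (sym (sumL-remove g ys₁ ys₂ x))
    where
    e′ : xs ∼bag (ys₁ ++ ys₂)
    e′ t = +-cancelˡ-≡ [ t x ]b _ _ (trans (sym (countᵇ-∷ t x xs)) (trans (e t) (countᵇ-remove t ys₁ ys₂ x)))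

module Lists where

  open BoolComparisons
  open Counting using (filter-∷)
  open import Data.Nat using (ℕ; zero; suc; _<_; z≤n; s≤s; _≡ᵇ_)
  open import Data.Nat.Properties using (_≟_)
  open import Data.Bool using (Bool; true; false; _∧_; _∨_; if_then_else_; T?)
  open import Data.List using (List; []; _∷_; _++_; map; length; filterᵇ; concatMap; upTo; all; take; drop)
  open import Data.List.Properties using (map-upTo; map-applyUpTo)
  open import Data.List.Membership.Propositional using (_∈_; _∉_)
  open import Data.List.Membership.Propositional.Properties using (∈-filter⁻; ∈-filter⁺; ∈-++⁺ʳ; ∈-map⁻; ∈-concatMap⁻)
  open import Data.List.Relation.Unary.Any using (Any; here; there)
  open import Data.List.Relation.Unary.All using (All; []; _∷_)
  import Data.List.Relation.Unary.All as All
  open import Data.List.Relation.Unary.Unique.Propositional using (Unique)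
  open import Data.List.Relation.Unary.AllPairs using ([]; _∷_)
  import Data.List.Relation.Unary.Unique.Propositional.Properties as UP
  open import Data.Product using (_×_; _,_; proj₁; proj₂)
  open import Data.Empty using (⊥; ⊥-elim)
  open import Function using (_∘_; id)
  open import Relation.Nullary using (yes; no)
  open import Relation.Binary.PropositionalEquality

  private variable
    A B : Set

  ∈-filterᵇ⁻ : (P : A → Bool) {x : A} (xs : List A) → x ∈ filterᵇ P xs → x ∈ xs × P x ≡ true
  ∈-filterᵇ⁻ P xs x∈ with ∈-filter⁻ (T? ∘ P) {xs = xs} x∈
  ... | x∈xs , Px = x∈xs , T⇒≡true Px

  ∈-filterᵇ⁺ : (P : A → Bool) {x : A} (xs : List A) → x ∈ xs → P x ≡ true → x ∈ filterᵇ P xs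
  ∈-filterᵇ⁺ P xs x∈ Px = ∈-filter⁺ (T? ∘ P) x∈ (≡true⇒T Px)

  unique-filterᵇ : (P : A → Bool) {xs : List A} → Unique xs → Unique (filterᵇ P xs)
  unique-filterᵇ P = UP.filter⁺ _

  unique-++ : {xs ys : List A} → Unique xs → Unique ys → (∀ z → z ∈ xs → z ∈ ys → ⊥) → Unique (xs ++ ys)
  unique-++ ux uy disjoint = UP.++⁺ ux uy (λ (z∈xs , z∈ys) → disjoint _ z∈xs z∈ys)

  unique-concatMap : (f : A → List B) (L : List A) → Unique L → (∀ x → x ∈ L → Unique (f x)) →
    (∀ x y → x ≢ y → ∀ z → z ∈ f x → z ∈ f y → ⊥) → Unique (concatMap f L)
  unique-concatMap f [] uL uf d = []
  unique-concatMap f (x ∷ L) (a ∷ uL) uf d = unique-++ (uf x (here refl)) (unique-concatMap f L uL (λ y y∈ → uf y (there y∈)) d)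
    (λ z z∈fx z∈rest → not-in-rest z z∈fx L a (∈-concatMap⁻ f z∈rest))
    where
    not-in-rest : ∀ z → z ∈ f x → (L′ : List _) → All (x ≢_) L′ → Any (λ y → z ∈ f y) L′ → ⊥
    not-in-rest z z∈fx (y ∷ L′) (x≢y ∷ _) (here z∈fy) = d x y x≢y z z∈fx z∈fy
    not-in-rest z z∈fx (y ∷ L′) (_ ∷ x≢L′) (there z∈) = not-in-rest z z∈fx L′ x≢L′ z∈

  unique-map-on : (f : A → B) (L : List A) → Unique L → (∀ x y → x ∈ L → y ∈ L → f x ≡ f y → x ≡ y) → Unique (map f L)
  unique-map-on f [] u inj = []
  unique-map-on f (x ∷ L) (a ∷ u) inj = All.tabulate h ∷ unique-map-on f L u (λ x y x∈ y∈ → inj x y (there x∈) (there y∈))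
    where
    h : ∀ {z} → z ∈ map f L → f x ≢ z
    h z∈ e with ∈-map⁻ f z∈
    ... | y , y∈ , refl = All.lookup a y∈ (inj x y (here refl) (there y∈) e)

  lookupD : A → List A → ℕ → A
  lookupD d [] i = d
  lookupD d (x ∷ xs) zero = x
  lookupD d (x ∷ xs) (suc i) = lookupD d xs i

  map-upTo-suc : (g : ℕ → A) (m : ℕ) → map g (upTo (suc m)) ≡ g 0 ∷ map (g ∘ suc) (upTo m)
  map-upTo-suc g m = cong (g 0 ∷_) (trans (map-applyUpTo suc g m) (sym (map-upTo (g ∘ suc) m)))

  all-true⁻ : (p : A → Bool) (xs : List A) → all p xs ≡ true → ∀ x → x ∈ xs → p x ≡ true
  all-true⁻ p (y ∷ xs) e x (here refl) = proj₁ (∧-split (p y) _ e)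
  all-true⁻ p (y ∷ xs) e x (there x∈) = all-true⁻ p xs (proj₂ (∧-split (p y) _ e)) x x∈

  all-true⁺ : (p : A → Bool) (xs : List A) → (∀ x → x ∈ xs → p x ≡ true) → all p xs ≡ true
  all-true⁺ p [] h = refl
  all-true⁺ p (y ∷ xs) h = ∧-intro (h y (here refl)) (all-true⁺ p xs (λ x x∈ → h x (there x∈)))

  all-cong : (p q : A → Bool) (xs : List A) → (∀ x → x ∈ xs → p x ≡ q x) → all p xs ≡ all q xs
  all-cong p q [] h = refl
  all-cong p q (y ∷ xs) h = cong₂ _∧_ (h y (here refl)) (all-cong p q xs (λ x x∈ → h x (there x∈)))

  map-cong-∈ : (f g : A → B) (xs : List A) → (∀ x → x ∈ xs → f x ≡ g x) → map f xs ≡ map g xs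
  map-cong-∈ f g [] h = refl
  map-cong-∈ f g (x ∷ xs) h = cong₂ _∷_ (h x (here refl)) (map-cong-∈ f g xs (λ y y∈ → h y (there y∈)))

  map-id' : (xs : List A) → map id xs ≡ xs
  map-id' [] = refl
  map-id' (x ∷ xs) = cong (x ∷_) (map-id' xs)

  map-∘' : (f : B → ℕ) (g : A → B) (xs : List A) → map f (map g xs) ≡ map (f ∘ g) xs
  map-∘' f g [] = refl
  map-∘' f g (x ∷ xs) = cong (f (g x) ∷_) (map-∘' f g xs)

  _∈ᵇ_ : ℕ → List ℕ → Bool
  v ∈ᵇ [] = false
  v ∈ᵇ (x ∷ xs) = (v ≡ᵇ x) ∨ v ∈ᵇ xs

  ∈ᵇ-true⁻ : (v : ℕ) (xs : List ℕ) → v ∈ᵇ xs ≡ true → v ∈ xs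
  ∈ᵇ-true⁻ v (x ∷ xs) e with v ≟ x
  ... | yes refl = here refl
  ... | no ne = there (∈ᵇ-true⁻ v xs (trans (cong (_∨ v ∈ᵇ xs) (sym (≡ᵇ-false⁺ v x ne))) e))

  ∈ᵇ-true⁺ : (v : ℕ) (xs : List ℕ) → v ∈ xs → v ∈ᵇ xs ≡ true
  ∈ᵇ-true⁺ v (x ∷ xs) (here refl) = cong (_∨ v ∈ᵇ xs) (≡ᵇ-true⁺ v v refl)
  ∈ᵇ-true⁺ v (x ∷ xs) (there v∈) = trans (cong ((v ≡ᵇ x) ∨_) (∈ᵇ-true⁺ v xs v∈)) (∨-zeroʳ _)
    where open import Data.Bool.Properties using (∨-zeroʳ)

  ∈ᵇ-false⁺ : (v : ℕ) (xs : List ℕ) → v ∉ xs → v ∈ᵇ xs ≡ false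
  ∈ᵇ-false⁺ v xs v∉ with v ∈ᵇ xs in e
  ... | true = ⊥-elim (v∉ (∈ᵇ-true⁻ v xs e))
  ... | false = refl

  filterᵇ-cong : {A : Set} (f g : A → Bool) (L : List A) → (∀ x → x ∈ L → f x ≡ g x) → filterᵇ f L ≡ filterᵇ g L
  filterᵇ-cong f g [] h = refl
  filterᵇ-cong f g (x ∷ L) h = trans (filter-∷ f x L) (trans (step (f x) (g x) (h x (here refl))) (sym (filter-∷ g x L)))
    where
    ih = filterᵇ-cong f g L (λ y y∈ → h y (there y∈))
    step : (a b : Bool) → a ≡ b → (if a then x ∷ filterᵇ f L else filterᵇ f L) ≡ (if b then x ∷ filterᵇ g L else filterᵇ g L)
    step true .true refl = cong (x ∷_) ih
    step false .false refl = ih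

  all-map : {A : Set} (f : ℕ → Bool) (g : A → ℕ) (xs : List A) → all f (map g xs) ≡ all (f ∘ g) xs
  all-map f g [] = refl
  all-map f g (x ∷ xs) = cong (f (g x) ∧_) (all-map f g xs)

  take-++-len : (xs ys : List A) → take (length xs) (xs ++ ys) ≡ xs
  take-++-len [] ys = refl
  take-++-len (x ∷ xs) ys = cong (x ∷_) (take-++-len xs ys)

  drop-++-len : (xs ys : List A) → drop (length xs) (xs ++ ys) ≡ ys
  drop-++-len [] ys = refl
  drop-++-len (x ∷ xs) ys = drop-++-len xs ys

  unique-++-disj : (xs ys : List A) → Unique (xs ++ ys) → ∀ z → z ∈ xs → z ∈ ys → ⊥
  unique-++-disj (x ∷ xs) ys (a ∷ u) z (here refl) z∈ = All.lookup a (∈-++⁺ʳ xs z∈) refl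
  unique-++-disj (x ∷ xs) ys (a ∷ u) z (there z∈₁) z∈ = unique-++-disj xs ys u z z∈₁ z∈

  lookup-map-upTo : (g : ℕ → Bool) (n v : ℕ) → v < n → lookupD false (map g (upTo n)) v ≡ g v
  lookup-map-upTo g (suc n) zero lt = refl
  lookup-map-upTo g (suc n) (suc v) (s≤s lt) = trans (cong (λ l → lookupD false l (suc v)) (map-upTo-suc g n)) (lookup-map-upTo (g ∘ suc) n v lt)

  list-ext : (g : ℕ → Bool) (c : List Bool) → (∀ v → v < length c → g v ≡ lookupD false c v) → map g (upTo (length c)) ≡ c
  list-ext g [] h = refl
  list-ext g (x ∷ c) h = trans (map-upTo-suc g (length c)) (cong₂ _∷_ (h 0 (s≤s z≤n)) (list-ext (g ∘ suc) c (λ v lt → h (suc v) (s≤s lt))))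

module PolynomialAlgebra where

  open Counting
  open import Data.Nat as ℕ using (ℕ; zero; suc; _∸_; _<_)
  open import Data.Nat.Properties using (m≤n⇒m≤1+n; ≤-refl)
  open import Data.Integer as ℤ using (ℤ; +_; _+_; _-_; _*_)
  import Data.Integer.Properties as ℤP
  open import Data.Integer.Solver using (module +-*-Solver)
  open import Relation.Binary.PropositionalEquality
  open +-*-Solver

  _≈₂_ : Poly2 → Poly2 → Set
  P ≈₂ Q = ∀ a b → P a b ≡ Q a b

  Σ<-cong : (n : ℕ) (f g : ℕ → ℤ) → (∀ i → i < n → f i ≡ g i) → Σ< n f ≡ Σ< n g
  Σ<-cong zero f g h = refl
  Σ<-cong (suc n) f g h = cong₂ _+_ (Σ<-cong n f g (λ i i< → h i (m≤n⇒m≤1+n i<))) (h n ≤-refl)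

  Σ<-pos : (n : ℕ) (f : ℕ → ℕ) → Σ< n (λ i → + f i) ≡ + Σℕ n f
  Σ<-pos zero f = refl
  Σ<-pos (suc n) f = trans (cong (_+ + f n) (Σ<-pos n f)) (sym (ℤP.pos-+ (Σℕ n f) (f n)))

  Σ<-sub : (n : ℕ) (f g : ℕ → ℤ) → Σ< n (λ i → f i - g i) ≡ Σ< n f - Σ< n g
  Σ<-sub zero f g = refl
  Σ<-sub (suc n) f g = trans (cong (_+ (f n - g n)) (Σ<-sub n f g)) ([a-b]+[c-d]≡[a+c]-[b+d] (Σ< n f) (Σ< n g) (f n) (g n))
    where
    [a-b]+[c-d]≡[a+c]-[b+d] : ∀ a b c d → (a - b) + (c - d) ≡ (a + c) - (b + d)
    [a-b]+[c-d]≡[a+c]-[b+d] = solve 4 (λ a b c d → (a :- b) :+ (c :- d) := (a :+ c) :- (b :+ d)) refl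

  convℕ : ℕ → (ℕ → ℕ → ℕ) → ℕ
  convℕ n f = Σℕ (suc n) (λ i → f i (n ∸ i))

  conv-cong : (n : ℕ) (f g : ℕ → ℕ → ℤ) → (∀ i j → f i j ≡ g i j) → conv n f ≡ conv n g
  conv-cong n f g h = Σ<-cong (suc n) _ _ (λ i _ → h i (n ∸ i))

  conv-pos : (n : ℕ) (f : ℕ → ℕ → ℕ) → conv n (λ i j → + f i j) ≡ + convℕ n f
  conv-pos n f = Σ<-pos (suc n) _

  conv-sub : (n : ℕ) (f g : ℕ → ℕ → ℤ) → conv n (λ i j → f i j - g i j) ≡ conv n f - conv n g
  conv-sub n f g = Σ<-sub (suc n) _ _

  *₂-cong : {P P′ Q Q′ : Poly2} → P ≈₂ P′ → Q ≈₂ Q′ → (P *₂ Q) ≈₂ (P′ *₂ Q′)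
  *₂-cong P≈ Q≈ a b = conv-cong a _ _ (λ a₁ a₂ → conv-cong b _ _ (λ b₁ b₂ → cong₂ _*_ (P≈ a₁ b₁) (Q≈ a₂ b₂)))

  *₂-distribˡ--₂ : (P Q R : Poly2) → (P *₂ (Q -₂ R)) ≈₂ ((P *₂ Q) -₂ (P *₂ R))
  *₂-distribˡ--₂ P Q R a b = begin
    conv a (λ a₁ a₂ → conv b (λ b₁ b₂ → P a₁ b₁ * (Q a₂ b₂ - R a₂ b₂)))
      ≡⟨ conv-cong a _ _ (λ a₁ a₂ → trans
           (conv-cong b _ _ (λ b₁ b₂ → x*[y-z]≡x*y-x*z (P a₁ b₁) (Q a₂ b₂) (R a₂ b₂)))
           (conv-sub b (λ b₁ b₂ → P a₁ b₁ * Q a₂ b₂) (λ b₁ b₂ → P a₁ b₁ * R a₂ b₂))) ⟩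
    conv a (λ a₁ a₂ → conv b (λ b₁ b₂ → P a₁ b₁ * Q a₂ b₂) - conv b (λ b₁ b₂ → P a₁ b₁ * R a₂ b₂))
      ≡⟨ conv-sub a (λ a₁ a₂ → conv b (λ b₁ b₂ → P a₁ b₁ * Q a₂ b₂)) (λ a₁ a₂ → conv b (λ b₁ b₂ → P a₁ b₁ * R a₂ b₂)) ⟩
    (P *₂ Q) a b - (P *₂ R) a b ∎
    where
    open ≡-Reasoning
    x*[y-z]≡x*y-x*z : ∀ x y z → x * (y - z) ≡ x * y - x * z
    x*[y-z]≡x*y-x*z = solve 3 (λ x y z → x :* (y :- z) := x :* y :- x :* z) refl

  ≈ₑ-refl : {f : EGF} → f ≈ₑ f
  ≈ₑ-refl n a b = refl

  ≈ₑ-trans : {f g h : EGF} → f ≈ₑ g → g ≈ₑ h → f ≈ₑ h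
  ≈ₑ-trans f≈g g≈h n a b = trans (f≈g n a b) (g≈h n a b)

  yₑ-cong : {f g : EGF} → f ≈ₑ g → yₑ f ≈ₑ yₑ g
  yₑ-cong f≈g n zero b = refl
  yₑ-cong f≈g n (suc a) b = f≈g n a b

  -ₑ-congˡ : (f : EGF) {g h : EGF} → g ≈ₑ h → (f -ₑ g) ≈ₑ (f -ₑ h)
  -ₑ-congˡ f g≈h n a b = cong (f n a b -_) (g≈h n a b)

  *ₑ-cong : {f f′ g g′ : EGF} → f ≈ₑ f′ → g ≈ₑ g′ → (f *ₑ g) ≈ₑ (f′ *ₑ g′)
  *ₑ-cong f≈ g≈ n a b =
    conv-cong n _ _ (λ k l → *₂-cong {P = lift (qbinom n k)} (λ _ _ → refl) (*₂-cong (f≈ k) (g≈ l)) a b)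

  *ₑ-distribˡ--ₑ : (f g h : EGF) → (f *ₑ (g -ₑ h)) ≈ₑ ((f *ₑ g) -ₑ (f *ₑ h))
  *ₑ-distribˡ--ₑ f g h n a b = trans
    (conv-cong n _ _ (λ k l → trans
       (*₂-cong {P = lift (qbinom n k)} (λ _ _ → refl) (*₂-distribˡ--₂ (f k) (g l) (h l)) a b)
       (*₂-distribˡ--₂ (lift (qbinom n k)) (f k *₂ g l) (f k *₂ h l) a b)))
    (conv-sub n (λ k l → (lift (qbinom n k) *₂ (f k *₂ g l)) a b) (λ k l → (lift (qbinom n k) *₂ (f k *₂ h l)) a b))

module Monomials where

  open BoolComparisons
  open Counting
  open PolynomialAlgebra
  open import Data.Nat as ℕ using (ℕ; suc; _+_; _*_; _∸_; _≤_; _<_; s≤s; s≤s⁻¹; _≡ᵇ_)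
  open import Data.Nat.Properties
  open import Data.Integer as ℤ using (+_)
  import Data.Integer.Properties as ℤP
  open import Data.Bool using (Bool; false; _∧_)
  open import Data.Bool.Properties using (∧-zeroʳ)
  open import Data.List using (List; []; _∷_; _++_; map; concatMap)
  open import Data.List.Properties using (++-identityʳ; map-id)
  open import Data.Product using (_×_; _,_)
  open import Relation.Nullary using (Dec; yes; no)
  open import Function using (_∘_)
  open import Relation.Binary.PropositionalEquality

  -- (a , b) stands for y^a q^b; a list of monomials stands for the sum of its entries.
  Monomial : Set
  Monomial = ℕ × ℕ

  _*ₘ_ : Monomial → Monomial → Monomial
  (a , b) *ₘ (c , d) = (a + c , b + d)

  hasExponents : ℕ → ℕ → Monomial → Bool
  hasExponents a b (i , j) = (i ≡ᵇ a) ∧ (j ≡ᵇ b)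

  coeff : List Monomial → ℕ → ℕ → ℕ
  coeff L a b = countᵇ (hasExponents a b) L

  poly : List Monomial → Poly2
  poly L a b = + coeff L a b

  _⊗_ : List Monomial → List Monomial → List Monomial
  L ⊗ M = concatMap (λ x → map (x *ₘ_) M) L

  private
    convℕ-δ-in : (n c : ℕ) (g : ℕ → ℕ) → c ≤ n → convℕ n (λ i j → [ c ≡ᵇ i ]b * g j) ≡ g (n ∸ c)
    convℕ-δ-in n c g c≤n = trans
      (Σℕ-single (suc n) c _ (s≤s c≤n) (λ k _ k≢c → cong (λ b → [ b ]b * g (n ∸ k)) (≡ᵇ-false⁺ c k (k≢c ∘ sym))))
      (trans (cong (λ b → [ b ]b * g (n ∸ c)) (≡ᵇ-true⁺ c c refl)) (+-identityʳ _))

    convℕ-δ-out : (n c : ℕ) (g : ℕ → ℕ) → n < c → convℕ n (λ i j → [ c ≡ᵇ i ]b * g j) ≡ 0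
    convℕ-δ-out n c g n<c = Σℕ-zero (suc n) _
      (λ k k≤n → cong (λ b → [ b ]b * g (n ∸ k)) (≡ᵇ-false⁺ c k (λ { refl → <⇒≱ n<c (s≤s⁻¹ k≤n) })))

    x+y≡ᵇa⇔y≡ᵇa∸x : (x y a : ℕ) → x ≤ a → (x + y ≡ᵇ a) ≡ (y ≡ᵇ a ∸ x)
    x+y≡ᵇa⇔y≡ᵇa∸x x y a x≤a = ≡ᵇ-iff _ _ _ _
      (λ e → trans (sym (m+n∸m≡n x y)) (cong (_∸ x) e)) (λ e → trans (cong (λ z → x + z) e) (m+[n∸m]≡n x≤a))

    x+y≡ᵇa-false : (x y a : ℕ) → a < x → (x + y ≡ᵇ a) ≡ false
    x+y≡ᵇa-false x y a a<x = ≡ᵇ-false⁺ _ _ (λ e → <⇒≱ a<x (subst (x ≤_) e (m≤m+n x y)))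

  coeff-map-*ₘ : (x : Monomial) (M : List Monomial) (a b : ℕ) →
    convℕ a (λ a₁ a₂ → convℕ b (λ b₁ b₂ → [ hasExponents a₁ b₁ x ]b * coeff M a₂ b₂)) ≡ coeff (map (x *ₘ_) M) a b
  coeff-map-*ₘ (x₁ , x₂) M a b = begin
    convℕ a (λ a₁ a₂ → convℕ b (λ b₁ b₂ → [ (x₁ ≡ᵇ a₁) ∧ (x₂ ≡ᵇ b₁) ]b * coeff M a₂ b₂))
      ≡⟨ Σℕ-cong (suc a) _ _ (λ i _ → trans (Σℕ-cong (suc b) _ _ (λ j _ → [∧]b-* (x₁ ≡ᵇ i) (x₂ ≡ᵇ j) _))
                                             (Σℕ-*ˡ (suc b) [ x₁ ≡ᵇ i ]b _)) ⟩
    convℕ a (λ a₁ a₂ → [ x₁ ≡ᵇ a₁ ]b * inner a₂)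
      ≡⟨ by-cases (x₁ ℕ.≤? a) (x₂ ℕ.≤? b) ⟩
    countᵇ (hasExponents a b) (map ((x₁ , x₂) *ₘ_) M) ∎
    where
    open ≡-Reasoning
    [∧]b-* : (p q : Bool) (m : ℕ) → [ p ∧ q ]b * m ≡ [ p ]b * ([ q ]b * m)
    [∧]b-* p q m = trans (cong (_* m) ([∧]b p q)) (*-assoc [ p ]b _ _)
    inner : ℕ → ℕ
    inner a₂ = convℕ b (λ b₁ b₂ → [ x₂ ≡ᵇ b₁ ]b * coeff M a₂ b₂)
    shifted : countᵇ (hasExponents a b) (map ((x₁ , x₂) *ₘ_) M) ≡ countᵇ (λ { (y₁ , y₂) → (x₁ + y₁ ≡ᵇ a) ∧ (x₂ + y₂ ≡ᵇ b) }) M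
    shifted = countᵇ-map _ _ M
    by-cases : Dec (x₁ ≤ a) → Dec (x₂ ≤ b) →
      convℕ a (λ a₁ a₂ → [ x₁ ≡ᵇ a₁ ]b * inner a₂) ≡ countᵇ (hasExponents a b) (map ((x₁ , x₂) *ₘ_) M)
    by-cases (yes x₁≤a) (yes x₂≤b) = trans (convℕ-δ-in a x₁ inner x₁≤a) (trans (convℕ-δ-in b x₂ (coeff M (a ∸ x₁)) x₂≤b)
      (sym (trans shifted (countᵇ-cong _ _ M (λ { (y₁ , y₂) _ →
        cong₂ _∧_ (x+y≡ᵇa⇔y≡ᵇa∸x x₁ y₁ a x₁≤a) (x+y≡ᵇa⇔y≡ᵇa∸x x₂ y₂ b x₂≤b) })))))
    by-cases (yes x₁≤a) (no x₂≰b) = trans (convℕ-δ-in a x₁ inner x₁≤a) (trans (convℕ-δ-out b x₂ (coeff M (a ∸ x₁)) (≰⇒> x₂≰b))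
      (sym (trans shifted (countᵇ-false _ M (λ { (y₁ , y₂) _ →
        trans (cong ((x₁ + y₁ ≡ᵇ a) ∧_) (x+y≡ᵇa-false x₂ y₂ b (≰⇒> x₂≰b))) (∧-zeroʳ _) })))))
    by-cases (no x₁≰a) _ = trans (convℕ-δ-out a x₁ inner (≰⇒> x₁≰a))
      (sym (trans shifted (countᵇ-false _ M (λ { (y₁ , y₂) _ →
        cong (_∧ (x₂ + y₂ ≡ᵇ b)) (x+y≡ᵇa-false x₁ y₁ a (≰⇒> x₁≰a)) }))))

  convℕ-coeff : (L M : List Monomial) (a b : ℕ) →
    convℕ a (λ a₁ a₂ → convℕ b (λ b₁ b₂ → coeff L a₁ b₁ * coeff M a₂ b₂)) ≡ coeff (L ⊗ M) a b
  convℕ-coeff [] M a b = Σℕ-zero (suc a) _ (λ i _ → Σℕ-zero (suc b) _ (λ j _ → refl))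
  convℕ-coeff (x ∷ L) M a b = begin
    convℕ a (λ a₁ a₂ → convℕ b (λ b₁ b₂ → coeff (x ∷ L) a₁ b₁ * coeff M a₂ b₂))
      ≡⟨ Σℕ-cong (suc a) _ _ (λ i _ → trans (Σℕ-cong (suc b) _ _ (λ j _ →
           trans (cong (_* coeff M (a ∸ i) (b ∸ j)) (countᵇ-∷ (hasExponents i j) x L))
                 (*-distribʳ-+ (coeff M (a ∸ i) (b ∸ j)) [ hasExponents i j x ]b (coeff L i j))))
           (Σℕ-+ (suc b) _ _)) ⟩
    Σℕ (suc a) (λ i → headTerm i + tailTerm i)
      ≡⟨ Σℕ-+ (suc a) headTerm tailTerm ⟩
    Σℕ (suc a) headTerm + Σℕ (suc a) tailTerm
      ≡⟨ cong₂ _+_ (coeff-map-*ₘ x M a b) (convℕ-coeff L M a b) ⟩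
    coeff (map (x *ₘ_) M) a b + coeff (L ⊗ M) a b
      ≡⟨ countᵇ-++ _ (map (x *ₘ_) M) (L ⊗ M) ⟨
    coeff ((x ∷ L) ⊗ M) a b ∎
    where
    open ≡-Reasoning
    headTerm tailTerm : ℕ → ℕ
    headTerm i = convℕ b (λ b₁ b₂ → [ hasExponents i b₁ x ]b * coeff M (a ∸ i) b₂)
    tailTerm i = convℕ b (λ b₁ b₂ → coeff L i b₁ * coeff M (a ∸ i) b₂)

  poly-*₂ : (L M : List Monomial) → (poly L *₂ poly M) ≈₂ poly (L ⊗ M)
  poly-*₂ L M a b = begin
    conv a (λ a₁ a₂ → conv b (λ b₁ b₂ → + coeff L a₁ b₁ ℤ.* + coeff M a₂ b₂))
      ≡⟨ conv-cong a _ _ (λ a₁ a₂ → trans (conv-cong b _ _ (λ b₁ b₂ → sym (ℤP.pos-* (coeff L a₁ b₁) (coeff M a₂ b₂))))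
                                          (conv-pos b (λ b₁ b₂ → coeff L a₁ b₁ * coeff M a₂ b₂))) ⟩
    conv a (λ a₁ a₂ → + convℕ b (λ b₁ b₂ → coeff L a₁ b₁ * coeff M a₂ b₂))
      ≡⟨ conv-pos a (λ a₁ a₂ → convℕ b (λ b₁ b₂ → coeff L a₁ b₁ * coeff M a₂ b₂)) ⟩
    + convℕ a (λ a₁ a₂ → convℕ b (λ b₁ b₂ → coeff L a₁ b₁ * coeff M a₂ b₂))
      ≡⟨ cong +_ (convℕ-coeff L M a b) ⟩
    poly (L ⊗ M) a b ∎
    where open ≡-Reasoning

  poly-*ₑ : (f g : EGF) (qbinomᴸ : ℕ → ℕ → List Monomial) (fᴸ gᴸ : ℕ → List Monomial) →
    (∀ n k → lift (qbinom n k) ≈₂ poly (qbinomᴸ n k)) → (∀ n → f n ≈₂ poly (fᴸ n)) → (∀ n → g n ≈₂ poly (gᴸ n)) →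
    ∀ n → (f *ₑ g) n ≈₂ poly (concat< (suc n) (λ k → qbinomᴸ n k ⊗ (fᴸ k ⊗ gᴸ (n ∸ k))))
  poly-*ₑ f g qbinomᴸ fᴸ gᴸ q≈ f≈ g≈ n a b = begin
    conv n (λ k l → (lift (qbinom n k) *₂ (f k *₂ g l)) a b)
      ≡⟨ conv-cong n _ _ (λ k l → trans
           (*₂-cong (q≈ n k) (λ a′ b′ → trans (*₂-cong (f≈ k) (g≈ l) a′ b′) (poly-*₂ (fᴸ k) (gᴸ l) a′ b′)) a b)
           (poly-*₂ (qbinomᴸ n k) (fᴸ k ⊗ gᴸ l) a b)) ⟩
    Σ< (suc n) (λ k → + coeff (term k) a b)
      ≡⟨ Σ<-pos (suc n) _ ⟩
    + Σℕ (suc n) (λ k → coeff (term k) a b)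
      ≡⟨ cong +_ (countᵇ-concat< (hasExponents a b) (suc n) term) ⟨
    poly (concat< (suc n) term) a b ∎
    where
    open ≡-Reasoning
    term : ℕ → List Monomial
    term k = qbinomᴸ n k ⊗ (fᴸ k ⊗ gᴸ (n ∸ k))

  countᵇ-⊗ : (t : Monomial → Bool) (L M : List Monomial) →
    countᵇ t (L ⊗ M) ≡ sumL (λ x → countᵇ (λ y → t (x *ₘ y)) M) L
  countᵇ-⊗ t L M = trans (countᵇ-concatMap t (λ x → map (x *ₘ_) M) L) (sumL-cong _ _ L (λ x _ → countᵇ-map t (x *ₘ_) M))

  ⊗-zeroʳ : (L : List Monomial) → L ⊗ [] ≡ []
  ⊗-zeroʳ [] = refl
  ⊗-zeroʳ (x ∷ L) = ⊗-zeroʳ L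

  ⊗-identityˡ : (L : List Monomial) → ((0 , 0) ∷ []) ⊗ L ≡ L
  ⊗-identityˡ L = trans (++-identityʳ (map ((0 , 0) *ₘ_) L)) (map-id L)

  ⊗-identityʳ : (L : List Monomial) → L ⊗ ((0 , 0) ∷ []) ≡ L
  ⊗-identityʳ [] = refl
  ⊗-identityʳ ((a , b) ∷ L) = cong₂ _∷_ (cong₂ _,_ (+-identityʳ a) (+-identityʳ b)) (⊗-identityʳ L)

  poly-++ : (L M : List Monomial) → poly (L ++ M) ≈₂ (poly L +₂ poly M)
  poly-++ L M a b = trans (cong +_ (countᵇ-++ (hasExponents a b) L M)) (ℤP.pos-+ (coeff L a b) (coeff M a b))

  poly-resp-∼bag : (L M : List Monomial) → L ∼bag M → poly L ≈₂ poly M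
  poly-resp-∼bag L M L∼M a b = cong +_ (L∼M (hasExponents a b))

module Permutations where

  open BoolComparisons
  open Counting
  open Lists
  open import Data.Nat as ℕ using (ℕ; zero; suc; _<_; _≡ᵇ_)
  open import Data.Nat.Properties
  open import Data.Bool using (true; not)
  open import Data.List using (List; []; _∷_; map; length; upTo; all)
  open import Data.List.Properties using (length-upTo)
  open import Data.List.Membership.Propositional using (_∈_; find)
  open import Data.List.Membership.Propositional.Properties using (∈-map⁺; ∈-map⁻; ∈-concatMap⁺; ∈-concatMap⁻; ∈-upTo⁻; ∈-upTo⁺)
  open import Data.List.Relation.Unary.Any using (here)
  open import Data.List.Relation.Unary.All using (All; []; _∷_)
  import Data.List.Relation.Unary.All as All
  open import Data.List.Relation.Unary.Unique.Propositional using (Unique)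
  open import Data.List.Relation.Unary.AllPairs using ([]; _∷_)
  import Data.List.Relation.Unary.Unique.Propositional.Properties as UP
  open import Data.Product using (_×_; _,_)
  open import Data.Empty using (⊥)
  open import Relation.Binary.PropositionalEquality

  private variable
    A B : Set

  IsPerm : ℕ → List ℕ → Set
  IsPerm n π = length π ≡ n × All (_< n) π × Unique π

  words-∈⁻ : (n k : ℕ) (π : List ℕ) → π ∈ words n k → length π ≡ k × All (_< n) π
  words-∈⁻ n zero .[] (here refl) = refl , []
  words-∈⁻ n (suc k) π π∈ with find (∈-concatMap⁻ (λ w → map (_∷ w) (upTo n)) {xs = words n k} π∈)
  ... | w , w∈ , π∈′ with ∈-map⁻ (_∷ w) π∈′
  ... | x , x∈ , refl with words-∈⁻ n k w w∈
  ... | ℓ , bounded = cong suc ℓ , ∈-upTo⁻ x∈ ∷ bounded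

  words-∈⁺ : (n k : ℕ) (π : List ℕ) → length π ≡ k → All (_< n) π → π ∈ words n k
  words-∈⁺ n zero [] refl a = here refl
  words-∈⁺ n (suc k) (x ∷ π) refl (x< ∷ a) =
    ∈-concatMap⁺ (λ w → map (_∷ w) (upTo n)) (Data.List.Relation.Unary.Any.map (λ { refl → ∈-map⁺ (_∷ π) (∈-upTo⁺ x<) }) (words-∈⁺ n k π refl a))

  words-unique : (n k : ℕ) → Unique (words n k)
  words-unique n zero = [] ∷ []
  words-unique n (suc k) = unique-concatMap (λ w → map (_∷ w) (upTo n)) (words n k) (words-unique n k)
    (λ w _ → UP.map⁺ (λ { refl → refl }) (UP.upTo⁺ n))
    different-tails
    where
    different-tails : ∀ w w′ → w ≢ w′ → ∀ z → z ∈ map (_∷ w) (upTo n) → z ∈ map (_∷ w′) (upTo n) → ⊥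
    different-tails w w′ w≢w′ z z∈ z∈′ with ∈-map⁻ (_∷ w) z∈ | ∈-map⁻ (_∷ w′) z∈′
    ... | x , _ , refl | y , _ , refl = w≢w′ refl

  all-not-≡ᵇ⁻ : (x : ℕ) (xs : List ℕ) → all (λ y → not (x ≡ᵇ y)) xs ≡ true → All (x ≢_) xs
  all-not-≡ᵇ⁻ x xs e = All.tabulate (λ {y} y∈ x≡y →
    true≢false (trans (sym (≡ᵇ-true⁺ x y x≡y)) (not-true _ (all-true⁻ (λ y → not (x ≡ᵇ y)) xs e y y∈))))

  all-not-≡ᵇ⁺ : (x : ℕ) (xs : List ℕ) → All (x ≢_) xs → all (λ y → not (x ≡ᵇ y)) xs ≡ true
  all-not-≡ᵇ⁺ x xs a = all-true⁺ (λ y → not (x ≡ᵇ y)) xs (λ y y∈ → cong not (≡ᵇ-false⁺ x y (All.lookup a y∈)))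

  distinct⁻ : (π : List ℕ) → distinct π ≡ true → Unique π
  distinct⁻ [] e = []
  distinct⁻ (x ∷ π) e = let a , b = ∧-split _ _ e in all-not-≡ᵇ⁻ x π a ∷ distinct⁻ π b

  distinct⁺ : (π : List ℕ) → Unique π → distinct π ≡ true
  distinct⁺ [] u = refl
  distinct⁺ (x ∷ π) (a ∷ u) = ∧-intro (all-not-≡ᵇ⁺ x π a) (distinct⁺ π u)

  perms-∈⁻ : (n : ℕ) (π : List ℕ) → π ∈ perms n → IsPerm n π
  perms-∈⁻ n π π∈ = let a , b = ∈-filterᵇ⁻ distinct (words n n) π∈ ; l , al = words-∈⁻ n n π a in l , al , distinct⁻ π b

  perms-∈⁺ : (n : ℕ) (π : List ℕ) → IsPerm n π → π ∈ perms n
  perms-∈⁺ n π (l , al , u) = ∈-filterᵇ⁺ distinct (words n n) (words-∈⁺ n n π l al) (distinct⁺ π u)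

  perms-unique : (n : ℕ) → Unique (perms n)
  perms-unique n = unique-filterᵇ distinct (words-unique n n)

  perm-has : (n : ℕ) (π : List ℕ) → IsPerm n π → ∀ v → v < n → v ∈ π
  perm-has n π (l , al , u) v v< = unique-⊆-length⇒⊇ π (upTo n) u (λ z z∈ → ∈-upTo⁺ (All.lookup al z∈))
    (≤-reflexive (trans (length-upTo n) (sym l))) v (∈-upTo⁺ v<)

  perm-∼bag-upTo : (n : ℕ) (π : List ℕ) → IsPerm n π → π ∼bag upTo n
  perm-∼bag-upTo n π ip@(l , al , u) = unique-same-members⇒∼bag π (upTo n) u (UP.upTo⁺ n) (λ z z∈ → ∈-upTo⁺ (All.lookup al z∈))
    (λ z z∈ → perm-has n π ip z (∈-upTo⁻ z∈))

module Inversions where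

  open BoolComparisons
  open Counting
  open Lists
  open import Data.Nat as ℕ using (ℕ; suc; _+_; _≤_; _<_; _<ᵇ_)
  open import Data.Nat.Properties
  open import Data.Bool using (Bool)
  open import Data.List using (List; []; _∷_; _++_; map; length; upTo)
  open import Data.Product using (_,_)
  open import Data.Sum using (inj₁; inj₂)
  open import Relation.Nullary using (yes; no)
  open import Relation.Binary using (tri<; tri≈; tri>)
  open import Data.Empty using (⊥-elim)
  open import Relation.Binary.PropositionalEquality

  countᵇ-at : (t : ℕ → Bool) (xs : List ℕ) → countᵇ (λ j → t (at xs j)) (upTo (length xs)) ≡ countᵇ t xs
  countᵇ-at t [] = refl
  countᵇ-at t (x ∷ xs) = trans (countᵇ-upTo-suc (λ j → t (at (x ∷ xs) j)) (length xs))
    (trans (cong ([ t x ]b +_) (countᵇ-at t xs)) (sym (countᵇ-∷ t x xs)))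

  invRec : List ℕ → ℕ
  invRec [] = 0
  invRec (x ∷ xs) = countᵇ (_<ᵇ x) xs + invRec xs

  invBelow : List ℕ → ℕ → ℕ
  invBelow π m = sumL (λ j → countᵇ (λ i → at π j <ᵇ at π i) (upTo j)) (upTo m)

  inv≡invBelow : (π : List ℕ) → inv π ≡ invBelow π (length π)
  inv≡invBelow π = trans (countᵇ-concatMap _ (λ j → map (λ i → (i , j)) (upTo j)) (upTo (length π)))
    (sumL-cong _ _ (upTo (length π)) (λ j _ → countᵇ-map _ (λ i → (i , j)) (upTo j)))

  invBelow-∷ : (x : ℕ) (xs : List ℕ) (m : ℕ) → invBelow (x ∷ xs) (suc m) ≡ countᵇ (λ j → at xs j <ᵇ x) (upTo m) + invBelow xs m
  invBelow-∷ x xs m = begin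
    invBelow (x ∷ xs) (suc m) ≡⟨ sumL-upTo-suc (λ j → countᵇ (λ i → at (x ∷ xs) j <ᵇ at (x ∷ xs) i) (upTo j)) m ⟩
    0 + sumL (λ j → countᵇ (λ i → at xs j <ᵇ at (x ∷ xs) i) (upTo (suc j))) (upTo m)
      ≡⟨ sumL-cong _ _ (upTo m) (λ j _ → countᵇ-upTo-suc (λ i → at xs j <ᵇ at (x ∷ xs) i) j) ⟩
    sumL (λ j → [ at xs j <ᵇ x ]b + countᵇ (λ i → at xs j <ᵇ at xs i) (upTo j)) (upTo m)
      ≡⟨ sumL-+ _ _ (upTo m) ⟩
    sumL (λ j → [ at xs j <ᵇ x ]b) (upTo m) + invBelow xs m ≡⟨ cong (_+ invBelow xs m) (sym (countᵇ-sumL _ (upTo m))) ⟩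
    countᵇ (λ j → at xs j <ᵇ x) (upTo m) + invBelow xs m ∎
    where open ≡-Reasoning

  inv≡invRec : (π : List ℕ) → inv π ≡ invRec π
  inv≡invRec π = trans (inv≡invBelow π) (invBelow≡invRec π)
    where
    invBelow≡invRec : (π : List ℕ) → invBelow π (length π) ≡ invRec π
    invBelow≡invRec [] = refl
    invBelow≡invRec (x ∷ xs) = trans (invBelow-∷ x xs (length xs)) (cong₂ _+_ (countᵇ-at (_<ᵇ x) xs) (invBelow≡invRec xs))

  crossInv : List ℕ → List ℕ → ℕ
  crossInv xs ys = sumL (λ x → countᵇ (_<ᵇ x) ys) xs

  invRec-++ : (xs ys : List ℕ) → invRec (xs ++ ys) ≡ crossInv xs ys + (invRec xs + invRec ys)
  invRec-++ [] ys = refl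
  invRec-++ (x ∷ xs) ys = begin
    countᵇ (_<ᵇ x) (xs ++ ys) + invRec (xs ++ ys) ≡⟨ cong₂ _+_ (countᵇ-++ (_<ᵇ x) xs ys) (invRec-++ xs ys) ⟩
    (countᵇ (_<ᵇ x) xs + countᵇ (_<ᵇ x) ys) + (crossInv xs ys + (invRec xs + invRec ys)) ≡⟨ regroup (countᵇ (_<ᵇ x) xs) (countᵇ (_<ᵇ x) ys)
        (crossInv xs ys) (invRec xs) (invRec ys) ⟩
    (countᵇ (_<ᵇ x) ys + crossInv xs ys) + ((countᵇ (_<ᵇ x) xs + invRec xs) + invRec ys) ∎
    where
    open ≡-Reasoning
    open import Data.Nat.Solver using (module +-*-Solver)
    open +-*-Solver
    regroup : ∀ a b c d e → (a + b) + (c + (d + e)) ≡ (b + c) + ((a + d) + e)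
    regroup = solve 5 (λ a b c d e → (a :+ b) :+ (c :+ (d :+ e)) := (b :+ c) :+ ((a :+ d) :+ e)) refl

  StrictMono : (ℕ → ℕ) → Set
  StrictMono e = ∀ {x y} → x < y → e x < e y

  <ᵇ-mono : (e : ℕ → ℕ) → StrictMono e → (x y : ℕ) → (e x <ᵇ e y) ≡ (x <ᵇ y)
  <ᵇ-mono e sm x y with x ℕ.<? y
  ... | yes lt = trans (<ᵇ-true⁺ _ _ (sm lt)) (sym (<ᵇ-true⁺ _ _ lt))
  ... | no nlt = trans (<ᵇ-false⁺ _ _ (mono-≤ (≮⇒≥ nlt))) (sym (<ᵇ-false⁺ _ _ (≮⇒≥ nlt)))
    where
    mono-≤ : ∀ {a b} → a ≤ b → e a ≤ e b
    mono-≤ {a} {b} le with m≤n⇒m<n∨m≡n le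
    ... | inj₁ lt = <⇒≤ (sm lt)
    ... | inj₂ refl = ≤-refl

  StrictMono⇒injective : (e : ℕ → ℕ) → StrictMono e → ∀ {x y} → e x ≡ e y → x ≡ y
  StrictMono⇒injective e sm {x} {y} eq with <-cmp x y
  ... | tri< lt _ _ = ⊥-elim (<-irrefl eq (sm lt))
  ... | tri≈ _ e' _ = e'
  ... | tri> _ _ gt = ⊥-elim (<-irrefl (sym eq) (sm gt))

  invRec-map : (e : ℕ → ℕ) → StrictMono e → (xs : List ℕ) → invRec (map e xs) ≡ invRec xs
  invRec-map e sm [] = refl
  invRec-map e sm (x ∷ xs) = cong₂ _+_ (trans (countᵇ-map _ e xs) (countᵇ-cong _ _ xs (λ y _ → <ᵇ-mono e sm y x))) (invRec-map e sm xs)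

module Standardisation where

  open BoolComparisons
  open Counting
  open Lists
  open Permutations
  open Inversions
  open import Data.Nat as ℕ using (ℕ; _≤_; _<_; _<ᵇ_)
  open import Data.Nat.Properties
  open import Data.Bool using (Bool; true)
  open import Data.List using (List; map; length; filterᵇ; upTo)
  open import Data.List.Properties using (length-map)
  open import Data.List.Membership.Propositional using (_∈_)
  open import Data.List.Membership.Propositional.Properties using (∈-map⁻; ∈-upTo⁺; ∈-upTo⁻)
  import Data.List.Relation.Unary.Unique.Propositional.Properties as UP
  import Data.List.Relation.Unary.All as All
  open import Data.List.Relation.Unary.Unique.Propositional using (Unique)
  open import Data.Product using (_,_; proj₂)
  open import Data.Empty using (⊥-elim)
  open import Function using (id)
  open import Relation.Binary using (tri<; tri≈; tri>)
  open import Relation.Binary.PropositionalEquality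

  rank : List ℕ → ℕ → ℕ
  rank xs x = countᵇ (_<ᵇ x) xs

  standardise : List ℕ → List ℕ
  standardise xs = map (rank xs) xs

  rank-perm : (m : ℕ) (σ : List ℕ) → IsPerm m σ → (x : ℕ) → x ≤ m → rank σ x ≡ x
  rank-perm m σ ip x le = trans (perm-∼bag-upTo m σ ip (_<ᵇ x)) (proj₂ (countᵇ-upTo-< x m) le)

  rank-map : (e : ℕ → ℕ) → StrictMono e → (xs : List ℕ) (x : ℕ) → rank (map e xs) (e x) ≡ rank xs x
  rank-map e sm xs x = trans (countᵇ-map _ e xs) (countᵇ-cong _ _ xs (λ y _ → <ᵇ-mono e sm y x))

  standardise-map : (m : ℕ) (σ : List ℕ) → IsPerm m σ → (e : ℕ → ℕ) → StrictMono e → standardise (map e σ) ≡ σ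
  standardise-map m σ ip@(l , al , u) e sm = trans (map-∘' (rank (map e σ)) e σ)
    (trans (map-cong-∈ _ id σ (λ x x∈ → trans (rank-map e sm σ x) (rank-perm m σ ip x (<⇒≤ (All.lookup al x∈))))) (map-id' σ))

  rank-strict : (xs : List ℕ) (x y : ℕ) → x ∈ xs → x < y → rank xs x < rank xs y
  rank-strict xs x y x∈ lt = countᵇ-strict (_<ᵇ x) (_<ᵇ y) xs x
    (λ w e → <ᵇ-true⁺ w y (<-trans (<ᵇ-true⁻ w x e) lt)) x∈ (<ᵇ-false⁺ x x ≤-refl) (<ᵇ-true⁺ x y lt)

  standardise-isPerm : (P : List ℕ) → Unique P → IsPerm (length P) (standardise P)
  standardise-isPerm P u = length-map (rank P) P
    , All.tabulate (λ {z} z∈ → values-bounded z z∈)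
    , unique-map-on (rank P) P u rank-injective
    where
    values-bounded : ∀ z → z ∈ standardise P → z < length P
    values-bounded z z∈ with ∈-map⁻ (rank P) z∈
    ... | x , x∈ , refl = countᵇ-lt-len (_<ᵇ x) P x x∈ (<ᵇ-false⁺ x x ≤-refl)
    rank-injective : ∀ x y → x ∈ P → y ∈ P → rank P x ≡ rank P y → x ≡ y
    rank-injective x y x∈ y∈ e with <-cmp x y
    ... | tri< lt _ _ = ⊥-elim (<-irrefl e (rank-strict P x y x∈ lt))
    ... | tri≈ _ eq _ = eq
    ... | tri> _ _ gt = ⊥-elim (<-irrefl (sym e) (rank-strict P y x y∈ gt))

  rank≡countᵇ : (P : List ℕ) (x : ℕ) (t : ℕ → Bool) → Unique P → (∀ u → u < x → u ∈ P → t u ≡ true) → (∀ u → u < x → t u ≡ true → u ∈ P) →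
    rank P x ≡ countᵇ t (upTo x)
  rank≡countᵇ P x t u h1 h2 = ∼bag-length {xs = filterᵇ (_<ᵇ x) P} {ys = filterᵇ t (upTo x)}
      (unique-same-members⇒∼bag (filterᵇ (_<ᵇ x) P) (filterᵇ t (upTo x))
    (unique-filterᵇ _ u) (unique-filterᵇ t (UP.upTo⁺ x))
    (λ z z∈ → let a , b = ∈-filterᵇ⁻ (_<ᵇ x) P z∈ ; lt = <ᵇ-true⁻ z x b in ∈-filterᵇ⁺ t (upTo x) (∈-upTo⁺ lt) (h1 z lt a))
    (λ z z∈ → let a , b = ∈-filterᵇ⁻ t (upTo x) z∈ ; lt = ∈-upTo⁻ a in ∈-filterᵇ⁺ (_<ᵇ x) P (h2 z lt b) (<ᵇ-true⁺ z x lt)))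

module BinaryWords where

  open BoolComparisons
  open Counting
  open Lists
  open Permutations
  open Inversions
  open Standardisation
  open import Data.Nat as ℕ using (ℕ; zero; suc; _+_; _∸_; _≤_; _<_; z≤n; s≤s; _≡ᵇ_; _<ᵇ_)
  open import Data.Nat.Properties
  open import Data.Integer as ℤ using (ℤ; +_)
  import Data.Integer.Properties as ℤP
  open import Data.Bool using (Bool; true; false; not; if_then_else_)
  open import Data.List using (List; []; _∷_; _++_; map; length; upTo; replicate; _∷ʳ_)
  open import Data.List.Properties using (length-++; length-map; map-++; length-upTo; upTo-∷ʳ; ∷ʳ-injective; map-id; map-∘)
  open import Data.List.Membership.Propositional using (_∈_)
  open import Data.List.Membership.Propositional.Properties using (∈-map⁺; ∈-map⁻; ∈-++⁺ˡ; ∈-++⁺ʳ; ∈-++⁻; ∈-upTo⁻)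
  open import Data.List.Relation.Unary.Any using (here)
  open import Data.List.Relation.Unary.All using (All; []; _∷_)
  import Data.List.Relation.Unary.All as All
  open import Data.List.Relation.Unary.Unique.Propositional using (Unique)
  open import Data.List.Relation.Unary.AllPairs using ([]; _∷_)
  import Data.List.Relation.Unary.Unique.Propositional.Properties as UP
  open import Data.Product using (_×_; _,_; proj₁; proj₂; ∃₂; ∃)
  open import Data.Sum using (inj₁; inj₂)
  open import Data.Empty using (⊥; ⊥-elim)
  open import Relation.Nullary using (yes; no)
  open import Function using (_∘_; id)
  open import Relation.Binary.PropositionalEquality

  isBit : Bool → Bool → Bool
  isBit true x = x
  isBit false x = not x

  countBit : Bool → List Bool → ℕ
  countBit b c = countᵇ (isBit b) c

  bitAt : List Bool → ℕ → Bool
  bitAt = lookupD false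

  bitPosStep : Bool → (ℕ → ℕ) → ℕ → ℕ
  bitPosStep true r zero = 0
  bitPosStep true r (suc i) = suc (r i)
  bitPosStep false r i = suc (r i)

  -- bitPos b c i is the position of the i-th (from 0) letter b in c; past the last such letter it is junk.
  bitPos : Bool → List Bool → ℕ → ℕ
  bitPos b [] i = i
  bitPos b (x ∷ c) = bitPosStep (isBit b x) (bitPos b c)

  bitPos-mono : (b : Bool) (c : List Bool) → StrictMono (bitPos b c)
  bitPos-mono b [] lt = lt
  bitPos-mono b (x ∷ c) = by-bit (isBit b x)
    where
    by-bit : (t : Bool) → StrictMono (bitPosStep t (bitPos b c))
    by-bit true {zero} {suc y} lt = s≤s z≤n
    by-bit true {suc x} {suc y} (s≤s lt) = s≤s (bitPos-mono b c lt)
    by-bit false lt = s≤s (bitPos-mono b c lt)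

  bitPos-countBefore : (b : Bool) (c : List Bool) (v : ℕ) → v < length c → isBit b (bitAt c v) ≡ true →
    bitPos b c (countᵇ (λ u → isBit b (bitAt c u)) (upTo v)) ≡ v
  bitPos-countBefore b (x ∷ c) zero lt e = by-bit (isBit b x) e
    where
    by-bit : (t : Bool) → t ≡ true → bitPosStep t (bitPos b c) 0 ≡ 0
    by-bit true _ = refl
  bitPos-countBefore b (x ∷ c) (suc v) (s≤s lt) e = trans (cong (bitPos b (x ∷ c)) (countᵇ-upTo-suc (λ u → isBit b (bitAt (x ∷ c) u)) v))
    (by-bit (isBit b x))
    where
    ih = bitPos-countBefore b c v lt e
    by-bit : (t : Bool) → bitPosStep t (bitPos b c) ([ t ]b + countᵇ (λ u → isBit b (bitAt c u)) (upTo v)) ≡ suc v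
    by-bit true = cong suc ih
    by-bit false = cong suc ih

  bitPos-valid : (b : Bool) (c : List Bool) (i : ℕ) → i < countBit b c → bitPos b c i < length c × isBit b (bitAt c (bitPos b c i)) ≡ true
  bitPos-valid b (x ∷ c) i lt = by-bit (isBit b x) refl i (subst (i <_) (countᵇ-∷ (isBit b) x c) lt)
    where
    by-bit : (t : Bool) → isBit b x ≡ t → (i : ℕ) → i < [ t ]b + countBit b c → bitPosStep t (bitPos b c) i < suc (length c) × isBit b
        (bitAt (x ∷ c) (bitPosStep t (bitPos b c) i)) ≡ true
    by-bit true e zero lt = s≤s z≤n , e
    by-bit true e (suc i) (s≤s lt) = let a , b' = bitPos-valid b c i lt in s≤s a , b'
    by-bit false e i lt = let a , b' = bitPos-valid b c i lt in s≤s a , b'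

  bitPositions : Bool → List Bool → List ℕ
  bitPositions b c = map (bitPos b c) (upTo (countBit b c))

  -- The inversions of the binary word c: pairs of a one and a later zero.
  binInv : List Bool → ℕ
  binInv c = crossInv (bitPositions false c) (bitPositions true c)

  bitPositions-< : (b : Bool) (c : List Bool) → All (_< length c) (bitPositions b c)
  bitPositions-< b c = All.tabulate (λ {z} z∈ → h z∈)
    where
    h : ∀ {z} → z ∈ bitPositions b c → z < length c
    h z∈ with ∈-map⁻ (bitPos b c) z∈
    ... | i , i∈ , refl = proj₁ (bitPos-valid b c i (∈-upTo⁻ i∈))

  bitPos-snoc : (b : Bool) (c : List Bool) (x : Bool) (i : ℕ) → i < countBit b c → bitPos b (c ++ x ∷ []) i ≡ bitPos b c i
  bitPos-snoc b (y ∷ c) x i lt = by-bit (isBit b y) i (subst (i <_) (countᵇ-∷ (isBit b) y c) lt)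
    where
    by-bit : (t : Bool) (i : ℕ) → i < [ t ]b + countBit b c → bitPosStep t (bitPos b (c ++ x ∷ [])) i ≡ bitPosStep t (bitPos b c) i
    by-bit true zero lt = refl
    by-bit true (suc i) (s≤s lt) = cong suc (bitPos-snoc b c x i lt)
    by-bit false i lt = cong suc (bitPos-snoc b c x i lt)

  bitPos-snoc-last : (b : Bool) (c : List Bool) (x : Bool) → isBit b x ≡ true → bitPos b (c ++ x ∷ []) (countBit b c) ≡ length c
  bitPos-snoc-last b [] x e = by-bit (isBit b x) e
    where
    by-bit : (t : Bool) → t ≡ true → bitPosStep t (bitPos b []) 0 ≡ 0
    by-bit true _ = refl
  bitPos-snoc-last b (y ∷ c) x e = trans (cong (bitPos b ((y ∷ c) ++ x ∷ [])) (countᵇ-∷ (isBit b) y c)) (by-bit (isBit b y))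
    where
    by-bit : (t : Bool) → bitPosStep t (bitPos b (c ++ x ∷ [])) ([ t ]b + countBit b c) ≡ suc (length c)
    by-bit true = cong suc (bitPos-snoc-last b c x e)
    by-bit false = cong suc (bitPos-snoc-last b c x e)

  countBit-snoc : (b : Bool) (c : List Bool) (x : Bool) → countBit b (c ++ x ∷ []) ≡ countBit b c + [ isBit b x ]b
  countBit-snoc b c x = trans (countᵇ-++ (isBit b) c (x ∷ [])) (cong (λ z → countBit b c + z) (trans (countᵇ-∷ (isBit b) x []) (+-identityʳ _)))

  bitPositions-snoc-other : (b : Bool) (c : List Bool) (x : Bool) → isBit b x ≡ false → bitPositions b (c ++ x ∷ []) ≡ bitPositions b c
  bitPositions-snoc-other b c x e = trans (cong (λ m → map (bitPos b (c ++ x ∷ [])) (upTo m))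
      (trans (countBit-snoc b c x) (trans (cong (λ t → countBit b c + [ t ]b) e) (+-identityʳ _))))
    (map-cong-∈ _ _ (upTo (countBit b c)) (λ i i∈ → bitPos-snoc b c x i (∈-upTo⁻ i∈)))

  bitPositions-snoc-same : (b : Bool) (c : List Bool) (x : Bool) → isBit b x ≡ true → bitPositions b (c ++ x ∷ []) ≡ bitPositions b c ++ length c ∷ []
  bitPositions-snoc-same b c x e = begin
    map (bitPos b c') (upTo (countBit b c')) ≡⟨ cong (λ m → map (bitPos b c') (upTo m))
        (trans (countBit-snoc b c x) (trans (cong (λ t → countBit b c + [ t ]b) e) (+-comm (countBit b c) 1))) ⟩
    map (bitPos b c') (upTo (suc (countBit b c))) ≡⟨ cong (map (bitPos b c')) (sym (upTo-∷ʳ (countBit b c))) ⟩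
    map (bitPos b c') (upTo (countBit b c) ++ countBit b c ∷ []) ≡⟨ map-++ (bitPos b c') (upTo (countBit b c)) _ ⟩
    map (bitPos b c') (upTo (countBit b c)) ++ bitPos b c' (countBit b c) ∷ [] ≡⟨ cong₂ (λ u v → u ++ v ∷ [])
        (map-cong-∈ _ _ (upTo (countBit b c)) (λ i i∈ → bitPos-snoc b c x i (∈-upTo⁻ i∈))) (bitPos-snoc-last b c x e) ⟩
    bitPositions b c ++ length c ∷ [] ∎
    where
    open ≡-Reasoning
    c' = c ++ x ∷ []

  crossInv-[] : (xs : List ℕ) → crossInv xs [] ≡ 0
  crossInv-[] [] = refl
  crossInv-[] (x ∷ xs) = crossInv-[] xs

  crossInv-snocʳ : (xs ys : List ℕ) (v : ℕ) → All (_≤ v) xs → crossInv xs (ys ++ v ∷ []) ≡ crossInv xs ys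
  crossInv-snocʳ [] ys v a = refl
  crossInv-snocʳ (x ∷ xs) ys v (le ∷ a) = cong₂ _+_ (trans (countᵇ-++ (_<ᵇ x) ys (v ∷ []))
      (trans (cong (λ z → countᵇ (_<ᵇ x) ys + z) (trans (countᵇ-∷ (_<ᵇ x) v []) (cong (λ t → [ t ]b + 0) (<ᵇ-false⁺ v x le)))) (+-identityʳ _)))
    (crossInv-snocʳ xs ys v a)

  crossInv-snocˡ : (xs ys : List ℕ) (v : ℕ) → All (_< v) ys → crossInv (xs ++ v ∷ []) ys ≡ crossInv xs ys + length ys
  crossInv-snocˡ xs ys v a = trans (sumL-++ (λ x → countᵇ (_<ᵇ x) ys) xs (v ∷ []))
    (cong (λ z → crossInv xs ys + z) (trans (+-identityʳ _) (countᵇ-true (_<ᵇ v) ys (λ y y∈ → <ᵇ-true⁺ y v (All.lookup a y∈)))))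

  length-bitPositions : (b : Bool) (c : List Bool) → length (bitPositions b c) ≡ countBit b c
  length-bitPositions b c = trans (length-map (bitPos b c) (upTo (countBit b c))) (length-upTo (countBit b c))

  binInv-snoc-true : (c : List Bool) → binInv (c ++ true ∷ []) ≡ binInv c
  binInv-snoc-true c = trans (cong₂ crossInv (bitPositions-snoc-other false c true refl) (bitPositions-snoc-same true c true refl))
    (crossInv-snocʳ (bitPositions false c) (bitPositions true c) (length c) (All.map <⇒≤ (bitPositions-< false c)))

  binInv-snoc-false : (c : List Bool) → binInv (c ++ false ∷ []) ≡ binInv c + countBit true c
  binInv-snoc-false c = trans (cong₂ crossInv (bitPositions-snoc-same false c false refl) (bitPositions-snoc-other true c false refl))
    (trans (crossInv-snocˡ (bitPositions false c) (bitPositions true c) (length c) (bitPositions-< true c))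
        (cong (λ z → binInv c + z) (length-bitPositions true c)))

  countBit-false+true : (c : List Bool) → countBit false c + countBit true c ≡ length c
  countBit-false+true [] = refl
  countBit-false+true (true ∷ c) = trans (+-suc (countBit false c) _) (cong suc (countBit-false+true c))
  countBit-false+true (false ∷ c) = cong suc (countBit-false+true c)

  bitPos-surjective : (b : Bool) (c : List Bool) (v : ℕ) → v < length c → isBit b (bitAt c v) ≡ true → ∃ λ j → j < countBit b c × bitPos b c j ≡ v
  bitPos-surjective b (x ∷ c) v lt e = by-bit (isBit b x) refl v lt e
    where
    by-bit : (t : Bool) → isBit b x ≡ t → (v : ℕ) → v < suc (length c) → isBit b (bitAt (x ∷ c) v) ≡ true →
           ∃ λ j → j < countBit b (x ∷ c) × bitPosStep t (bitPos b c) j ≡ v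
    by-bit true ex zero lt e = 0 , subst (0 <_) (sym (countᵇ-∷ (isBit b) x c)) (subst (λ w → 0 < [ w ]b + countBit b c) (sym ex) (s≤s z≤n)) , refl
    by-bit true ex (suc v) (s≤s lt) e = let j , j< , ej = bitPos-surjective b c v lt e in
      suc j , subst (suc j <_) (sym (countᵇ-∷ (isBit b) x c)) (subst (λ w → suc j < [ w ]b + countBit b c) (sym ex) (s≤s j<)) , cong suc ej
    by-bit false ex zero lt e = ⊥-elim (true≢false (trans (sym e) ex))
    by-bit false ex (suc v) (s≤s lt) e = let j , j< , ej = bitPos-surjective b c v lt e in
      j , subst (j <_) (sym (countᵇ-∷ (isBit b) x c)) (subst (λ w → j < [ w ]b + countBit b c) (sym ex) j<) , cong suc ej

  bitPos-standardise : (b : Bool) (c : List Bool) (X : List ℕ) → Unique X → (∀ x → x ∈ X → x < length c) →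
    (∀ u → u < length c → u ∈ X → isBit b (bitAt c u) ≡ true) →
    (∀ u → u < length c → isBit b (bitAt c u) ≡ true → u ∈ X) →
    map (bitPos b c) (standardise X) ≡ X
  bitPos-standardise b c X uX X< X⇒b b⇒X = begin
    map (bitPos b c) (map (rank X) X)  ≡⟨ map-∘ X ⟨
    map (bitPos b c ∘ rank X) X        ≡⟨ map-cong-∈ _ id X restore ⟩
    map id X                           ≡⟨ map-id X ⟩
    X                                  ∎
    where
    open ≡-Reasoning
    restore : ∀ x → x ∈ X → bitPos b c (rank X x) ≡ x
    restore x x∈ = trans
      (cong (bitPos b c) (rank≡countᵇ X x (isBit b ∘ bitAt c) uX
         (λ u u<x u∈ → X⇒b u (<-trans u<x (X< x x∈)) u∈) (λ u u<x ub → b⇒X u (<-trans u<x (X< x x∈)) ub)))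
      (bitPos-countBefore b c x (X< x x∈) (X⇒b x (X< x x∈) x∈))

  binWords : ℕ → ℕ → List (List Bool)
  binWords n zero = replicate n false ∷ []
  binWords zero (suc k) = []
  binWords (suc n) (suc k) = map (_∷ʳ true) (binWords n k) ++ map (_∷ʳ false) (binWords n (suc k))

  countBit-replicate : (n : ℕ) → countBit true (replicate n false) ≡ 0
  countBit-replicate zero = refl
  countBit-replicate (suc n) = countBit-replicate n

  length-replicate-false : (n : ℕ) → length (replicate n false) ≡ n
  length-replicate-false zero = refl
  length-replicate-false (suc n) = cong suc (length-replicate-false n)

  binWords-∈⁻ : (n k : ℕ) (c : List Bool) → c ∈ binWords n k → length c ≡ n × countBit true c ≡ k
  binWords-∈⁻ n zero c (here refl) = length-replicate-false n , countBit-replicate n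
  binWords-∈⁻ (suc n) (suc k) c c∈ with ∈-++⁻ (map (_∷ʳ true) (binWords n k)) c∈
  ... | inj₁ p with ∈-map⁻ (_∷ʳ true) p
  ... | c' , c'∈ , refl = let a , b = binWords-∈⁻ n k c' c'∈ in
    trans (length-++ c') (trans (+-comm _ 1) (cong suc a)) , trans (countBit-snoc true c' true) (trans (+-comm _ 1) (cong suc b))
  binWords-∈⁻ (suc n) (suc k) c c∈ | inj₂ p with ∈-map⁻ (_∷ʳ false) p
  ... | c' , c'∈ , refl = let a , b = binWords-∈⁻ n (suc k) c' c'∈ in
    trans (length-++ c') (trans (+-comm _ 1) (cong suc a)) , trans (countBit-snoc true c' false) (trans (+-identityʳ _) b)

  snoc-view : {A : Set} (n : ℕ) (c : List A) → length c ≡ suc n → ∃₂ λ c' x → c ≡ c' ++ x ∷ [] × length c' ≡ n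
  snoc-view zero (x ∷ []) refl = [] , x , refl , refl
  snoc-view (suc n) (y ∷ c) e with snoc-view n c (suc-injective e)
  ... | c' , x , refl , l = y ∷ c' , x , refl , cong suc l

  noTrue⇒replicate : (c : List Bool) → countBit true c ≡ 0 → c ≡ replicate (length c) false
  noTrue⇒replicate [] e = refl
  noTrue⇒replicate (true ∷ c) ()
  noTrue⇒replicate (false ∷ c) e = cong (false ∷_) (noTrue⇒replicate c e)

  binWords-∈⁺ : (n k : ℕ) (c : List Bool) → length c ≡ n → countBit true c ≡ k → c ∈ binWords n k
  binWords-∈⁺ n zero c refl e = here (noTrue⇒replicate c e)
  binWords-∈⁺ zero (suc k) [] refl ()
  binWords-∈⁺ (suc n) (suc k) c l e with snoc-view n c l
  ... | c' , true , refl , l' = ∈-++⁺ˡ (∈-map⁺ (_∷ʳ true) (binWords-∈⁺ n k c' l'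
      (suc-injective (trans (+-comm 1 _) (trans (sym (countBit-snoc true c' true)) e)))))
  ... | c' , false , refl , l' = ∈-++⁺ʳ (map (_∷ʳ true) (binWords n k))
      (∈-map⁺ (_∷ʳ false) (binWords-∈⁺ n (suc k) c' l' (trans (sym (+-identityʳ _)) (trans (sym (countBit-snoc true c' false)) e))))

  binWords-unique : (n k : ℕ) → Unique (binWords n k)
  binWords-unique n zero = [] ∷ []
  binWords-unique zero (suc k) = []
  binWords-unique (suc n) (suc k) = unique-++ (UP.map⁺ (λ {x} {y} e → proj₁ (∷ʳ-injective x y e)) (binWords-unique n k))
    (UP.map⁺ (λ {x} {y} e → proj₁ (∷ʳ-injective x y e)) (binWords-unique n (suc k))) d
    where
    d : ∀ z → z ∈ map (_∷ʳ true) (binWords n k) → z ∈ map (_∷ʳ false) (binWords n (suc k)) → ⊥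
    d z z1 z2 with ∈-map⁻ (_∷ʳ true) z1 | ∈-map⁻ (_∷ʳ false) z2
    ... | c1 , _ , refl | c2 , _ , e = true≢false (proj₂ (∷ʳ-injective c1 c2 e))

  binInv-allFalse : (n : ℕ) → binInv (replicate n false) ≡ 0
  binInv-allFalse n = trans (cong (λ m → crossInv (bitPositions false (replicate n false)) (map (bitPos true (replicate n false)) (upTo m)))
                                  (countBit-replicate n))
                            (crossInv-[] (bitPositions false (replicate n false)))

  binInv-∷ʳ-false : (n k : ℕ) (c : List Bool) → c ∈ binWords n k → binInv (c ∷ʳ false) ≡ binInv c + k
  binInv-∷ʳ-false n k c c∈ = trans (binInv-snoc-false c) (cong (λ z → binInv c + z) (proj₂ (binWords-∈⁻ n k c c∈)))

  -- Appending a one creates no inversion and appending a zero creates one per one already present: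
  -- this is the q-Pascal rule defining qbinom.
  qbinom-binWords : (n k b : ℕ) → qbinom n k b ≡ + countᵇ (λ c → binInv c ≡ᵇ b) (binWords n k)
  qbinom-binWords n zero b = trans (single b) (cong +_ (sym (countᵇ-∷ (λ c → binInv c ≡ᵇ b) (replicate n false) [])))
    where
    single : (b : ℕ) → qbinom n zero b ≡ + ([ binInv (replicate n false) ≡ᵇ b ]b + 0)
    single zero = cong (λ z → + ([ z ≡ᵇ 0 ]b + 0)) (sym (binInv-allFalse n))
    single (suc b) = cong (λ z → + ([ z ≡ᵇ suc b ]b + 0)) (sym (binInv-allFalse n))
  qbinom-binWords zero (suc k) b = refl
  qbinom-binWords (suc n) (suc k) b = begin
    qbinom n k b ℤ.+ shiftq (suc k) (qbinom n (suc k)) b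
      ≡⟨ cong₂ ℤ._+_ (trans (qbinom-binWords n k b) (cong +_ ending-in-one)) ending-in-zero ⟩
    + countᵇ T (map (_∷ʳ true) (binWords n k)) ℤ.+ + countᵇ T (map (_∷ʳ false) (binWords n (suc k)))
      ≡⟨ ℤP.pos-+ (countᵇ T (map (_∷ʳ true) (binWords n k))) (countᵇ T (map (_∷ʳ false) (binWords n (suc k)))) ⟨
    + (countᵇ T (map (_∷ʳ true) (binWords n k)) + countᵇ T (map (_∷ʳ false) (binWords n (suc k))))
      ≡⟨ cong +_ (countᵇ-++ T (map (_∷ʳ true) (binWords n k)) (map (_∷ʳ false) (binWords n (suc k)))) ⟨
    + countᵇ T (binWords (suc n) (suc k)) ∎
    where
    open ≡-Reasoning
    T : List Bool → Bool
    T c = binInv c ≡ᵇ b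
    ending-in-one : countᵇ T (binWords n k) ≡ countᵇ T (map (_∷ʳ true) (binWords n k))
    ending-in-one = trans (countᵇ-cong T (T ∘ (_∷ʳ true)) (binWords n k) (λ c _ → cong (_≡ᵇ b) (sym (binInv-snoc-true c))))
                          (sym (countᵇ-map T (_∷ʳ true) (binWords n k)))
    ending-in-zero : shiftq (suc k) (qbinom n (suc k)) b ≡ + countᵇ T (map (_∷ʳ false) (binWords n (suc k)))
    ending-in-zero with suc k ℕ.≤? b
    ... | yes 1+k≤b = begin
      (if suc k ℕ.≤ᵇ b then qbinom n (suc k) (b ∸ suc k) else + 0)
        ≡⟨ cong (λ t → if t then qbinom n (suc k) (b ∸ suc k) else + 0) (≤ᵇ-true⁺ (suc k) b 1+k≤b) ⟩
      qbinom n (suc k) (b ∸ suc k)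
        ≡⟨ qbinom-binWords n (suc k) (b ∸ suc k) ⟩
      + countᵇ (λ c → binInv c ≡ᵇ b ∸ suc k) (binWords n (suc k))
        ≡⟨ cong +_ (countᵇ-cong _ _ (binWords n (suc k)) (λ c c∈ → trans
             (≡ᵇ-iff _ _ _ _ (λ e → trans (cong (_+ suc k) e) (m∸n+n≡m 1+k≤b))
                             (λ e → trans (sym (m+n∸n≡m (binInv c) (suc k))) (cong (_∸ suc k) e)))
             (cong (_≡ᵇ b) (sym (binInv-∷ʳ-false n (suc k) c c∈))))) ⟩
      + countᵇ (T ∘ (_∷ʳ false)) (binWords n (suc k))
        ≡⟨ cong +_ (countᵇ-map T (_∷ʳ false) (binWords n (suc k))) ⟨
      + countᵇ T (map (_∷ʳ false) (binWords n (suc k))) ∎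
    ... | no 1+k≰b = trans (cong (λ t → if t then qbinom n (suc k) (b ∸ suc k) else + 0) (≤ᵇ-false⁺ (suc k) b (≰⇒> 1+k≰b)))
      (cong +_ (sym (trans (countᵇ-map T (_∷ʳ false) (binWords n (suc k))) (countᵇ-false _ (binWords n (suc k)) (λ c c∈ →
        trans (cong (_≡ᵇ b) (binInv-∷ʳ-false n (suc k) c c∈))
              (≡ᵇ-false⁺ _ _ (λ e → 1+k≰b (subst (suc k ≤_) e (m≤n+m (suc k) (binInv c))))))))))

  binWords-overfull : (n k : ℕ) → n < k → binWords n k ≡ []
  binWords-overfull zero (suc k) lt = refl
  binWords-overfull (suc n) (suc k) (s≤s lt) = cong₂ _++_ (cong (map _) (binWords-overfull n k lt))
      (cong (map _) (binWords-overfull n (suc k) (m<n⇒m<1+n lt)))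

  replicate-∷ʳ : (n : ℕ) → replicate n true ++ true ∷ [] ≡ true ∷ replicate n true
  replicate-∷ʳ zero = refl
  replicate-∷ʳ (suc n) = cong (true ∷_) (replicate-∷ʳ n)

  binWords-full : (n : ℕ) → binWords n n ≡ replicate n true ∷ []
  binWords-full zero = refl
  binWords-full (suc n) = trans (cong₂ _++_ (cong (map (Data.List._∷ʳ true)) (binWords-full n)) (cong (map _) (binWords-overfull n (suc n) ≤-refl)))
    (cong (_∷ []) (replicate-∷ʳ n))

  binInv-allTrue : (n : ℕ) → binInv (replicate n true) ≡ 0
  binInv-allTrue n = cong (λ m → crossInv (map (bitPos false (replicate n true)) (upTo m)) (bitPositions true (replicate n true)))
                          (no-zeros n)
    where
    no-zeros : (n : ℕ) → countBit false (replicate n true) ≡ 0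
    no-zeros zero = refl
    no-zeros (suc n) = no-zeros n

module Shuffle where

  open BoolComparisons
  open Counting
  open Lists
  open Permutations
  open Inversions
  open Standardisation
  open BinaryWords
  open import Data.Nat as ℕ using (ℕ; _+_; _∸_; _≤_; _<_; _⊓_)
  open import Data.Nat.Properties
  open import Data.Bool using (Bool; true; false; not)
  open import Data.List using (List; _++_; map; length; filterᵇ; concatMap; upTo; take; drop)
  open import Data.List.Properties using (length-++; length-map; length-upTo; take++drop≡id; length-take; length-drop)
  open import Data.List.Membership.Propositional using (_∈_; _∉_; find)
  open import Data.List.Membership.Propositional.Properties using (∈-map⁺; ∈-map⁻; ∈-++⁺ˡ; ∈-++⁺ʳ; ∈-++⁻; ∈-concatMap⁺; ∈-concatMap⁻; ∈-upTo⁺)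
  open import Data.List.Relation.Unary.Any using (Any)
  import Data.List.Relation.Unary.Any as Any
  open import Data.List.Relation.Unary.All using (All)
  import Data.List.Relation.Unary.All as All
  open import Data.List.Relation.Unary.Unique.Propositional using (Unique)
  import Data.List.Relation.Unary.Unique.Propositional.Properties as UP
  open import Data.Product using (_×_; _,_; proj₁; proj₂)
  open import Data.Sum using (_⊎_; inj₁; inj₂)
  open import Data.Empty using (⊥; ⊥-elim)
  open import Relation.Binary.PropositionalEquality

  ShuffleData : Set
  ShuffleData = List Bool × List ℕ × List ℕ

  shuffle : ShuffleData → List ℕ
  shuffle (c , τ , σ) = map (bitPos false c) σ ++ map (bitPos true c) τ

  triplesWith : ℕ → ℕ → List Bool → List ℕ → List ShuffleData
  triplesWith n k c τ = map (λ σ → (c , τ , σ)) (perms (n ∸ k))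

  triplesWithWord : ℕ → ℕ → List Bool → List ShuffleData
  triplesWithWord n k c = concatMap (triplesWith n k c) (perms k)

  shuffleData : ℕ → ℕ → List ShuffleData
  shuffleData n k = concatMap (triplesWithWord n k) (binWords n k)

  indicator : ℕ → List ℕ → List Bool
  indicator n S = map (λ v → v ∈ᵇ S) (upTo n)

  unshuffle : ℕ → ℕ → List ℕ → ShuffleData
  unshuffle n k π = indicator n (drop (n ∸ k) π) , standardise (drop (n ∸ k) π) , standardise (take (n ∸ k) π)

  shuffleData-∈⁻ : (n k : ℕ) (c : List Bool) (τ σ : List ℕ) → (c , τ , σ) ∈ shuffleData n k →
    c ∈ binWords n k × τ ∈ perms k × σ ∈ perms (n ∸ k)
  shuffleData-∈⁻ n k c τ σ t∈ with find (∈-concatMap⁻ (triplesWithWord n k) {xs = binWords n k} t∈)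
  ... | c′ , c′∈ , t∈′ with find (∈-concatMap⁻ (triplesWith n k c′) {xs = perms k} t∈′)
  ... | τ′ , τ′∈ , t∈″ with ∈-map⁻ (λ σ → (c′ , τ′ , σ)) t∈″
  ... | σ′ , σ′∈ , refl = c′∈ , τ′∈ , σ′∈

  shuffleData-∈⁺ : (n k : ℕ) (c : List Bool) (τ σ : List ℕ) → c ∈ binWords n k → τ ∈ perms k → σ ∈ perms (n ∸ k) →
    (c , τ , σ) ∈ shuffleData n k
  shuffleData-∈⁺ n k c τ σ c∈ τ∈ σ∈ = ∈-concatMap⁺ (triplesWithWord n k) (Any.map
    (λ { refl → ∈-concatMap⁺ (triplesWith n k c) (Any.map (λ { refl → ∈-map⁺ (λ σ → (c , τ , σ)) σ∈ }) τ∈) }) c∈)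

  shuffleData-unique : (n k : ℕ) → Unique (shuffleData n k)
  shuffleData-unique n k = unique-concatMap (triplesWithWord n k) (binWords n k) (binWords-unique n k)
    (λ c _ → unique-concatMap (triplesWith n k c) (perms k) (perms-unique k)
               (λ τ _ → UP.map⁺ (λ { refl → refl }) (perms-unique (n ∸ k))) (different-suffix c))
    (λ c c′ c≢c′ z z∈ z∈′ → c≢c′ (trans (sym (word-of c z∈)) (word-of c′ z∈′)))
    where
    different-suffix : ∀ c τ τ′ → τ ≢ τ′ → ∀ z → z ∈ triplesWith n k c τ → z ∈ triplesWith n k c τ′ → ⊥
    different-suffix c τ τ′ τ≢τ′ z z∈ z∈′ with ∈-map⁻ (λ σ → (c , τ , σ)) z∈ | ∈-map⁻ (λ σ → (c , τ′ , σ)) z∈′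
    ... | σ , _ , refl | σ′ , _ , refl = τ≢τ′ refl
    word-of : ∀ c {z} → z ∈ triplesWithWord n k c → proj₁ z ≡ c
    word-of c z∈ with find (∈-concatMap⁻ (triplesWith n k c) {xs = perms k} z∈)
    ... | τ , _ , z∈′ with ∈-map⁻ (λ σ → (c , τ , σ)) z∈′
    ... | σ , _ , refl = refl

  module _ (n k : ℕ) (c : List Bool) (τ σ : List ℕ) (c∈ : c ∈ binWords n k) (τ-perm : IsPerm k τ) (σ-perm : IsPerm (n ∸ k) σ) where

    private
      length-c : length c ≡ n
      length-c = proj₁ (binWords-∈⁻ n k c c∈)
      ones-c : countBit true c ≡ k
      ones-c = proj₂ (binWords-∈⁻ n k c c∈)
      k≤n : k ≤ n
      k≤n = subst₂ _≤_ ones-c length-c (countᵇ-≤ (isBit true) c)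
      zeros-c : countBit false c ≡ n ∸ k
      zeros-c = trans (sym (m+n∸n≡m (countBit false c) (countBit true c))) (cong₂ _∸_ (trans (countBit-false+true c) length-c) ones-c)
      atZeros atOnes : ℕ → ℕ
      atZeros = bitPos false c
      atOnes = bitPos true c

    shuffle-isPerm : IsPerm n (shuffle (c , τ , σ))
    shuffle-isPerm = length-shuffle , All.tabulate (λ {z} z∈ → values<n z z∈) , unique-++ (UP.map⁺ (StrictMono⇒injective atZeros (bitPos-mono false c)) (proj₂ (proj₂ σ-perm)))
        (UP.map⁺ (StrictMono⇒injective atOnes (bitPos-mono true c)) (proj₂ (proj₂ τ-perm))) disjoint-values
      where
      length-shuffle : length (shuffle (c , τ , σ)) ≡ n
      length-shuffle = trans (length-++ (map atZeros σ)) (trans (cong₂ _+_ (trans (length-map atZeros σ) (proj₁ σ-perm)) (trans (length-map atOnes τ) (proj₁ τ-perm))) (m∸n+n≡m k≤n))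
      values<n : ∀ z → z ∈ shuffle (c , τ , σ) → z < n
      values<n z z∈ with ∈-++⁻ (map atZeros σ) z∈
      ... | inj₁ p with ∈-map⁻ atZeros p
      ... | i , i∈ , refl = subst (atZeros i <_) length-c (proj₁ (bitPos-valid false c i (subst (i <_) (sym zeros-c) (All.lookup (proj₁ (proj₂ σ-perm)) i∈))))
      values<n z z∈ | inj₂ p with ∈-map⁻ atOnes p
      ... | i , i∈ , refl = subst (atOnes i <_) length-c (proj₁ (bitPos-valid true c i (subst (i <_) (sym ones-c) (All.lookup (proj₁ (proj₂ τ-perm)) i∈))))
      disjoint-values : ∀ z → z ∈ map atZeros σ → z ∈ map atOnes τ → ⊥
      disjoint-values z z1 z2 with ∈-map⁻ atZeros z1 | ∈-map⁻ atOnes z2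
      ... | i , i∈ , refl | j , j∈ , e = true≢false (trans (sym one-at) (trans (cong (bitAt c) (sym e)) (not-true _ zero-at)))
        where
        zero-at = proj₂ (bitPos-valid false c i (subst (i <_) (sym zeros-c) (All.lookup (proj₁ (proj₂ σ-perm)) i∈)))
        one-at = proj₂ (bitPos-valid true c j (subst (j <_) (sym ones-c) (All.lookup (proj₁ (proj₂ τ-perm)) j∈)))

    unshuffle-shuffle : unshuffle n k (shuffle (c , τ , σ)) ≡ (c , τ , σ)
    unshuffle-shuffle = cong₂ _,_ (trans (cong (indicator n) drop-suffix) indicator-word)
        (cong₂ _,_ (trans (cong standardise drop-suffix) (standardise-map k τ τ-perm atOnes (bitPos-mono true c)))
                                                                (trans (cong standardise take-prefix) (standardise-map (n ∸ k) σ σ-perm atZeros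
                                                                    (bitPos-mono false c))))
      where
      prefix-length : length (map atZeros σ) ≡ n ∸ k
      prefix-length = trans (length-map atZeros σ) (proj₁ σ-perm)
      take-prefix : take (n ∸ k) (shuffle (c , τ , σ)) ≡ map atZeros σ
      take-prefix = trans (cong (λ m → take m (shuffle (c , τ , σ))) (sym prefix-length)) (take-++-len (map atZeros σ) (map atOnes τ))
      drop-suffix : drop (n ∸ k) (shuffle (c , τ , σ)) ≡ map atOnes τ
      drop-suffix = trans (cong (λ m → drop m (shuffle (c , τ , σ))) (sym prefix-length)) (drop-++-len (map atZeros σ) (map atOnes τ))
      indicator-at : ∀ v → v < length c → v ∈ᵇ (map atOnes τ) ≡ bitAt c v
      indicator-at v v< with bitAt c v in e
      ... | true = let j , j< , ej = bitPos-surjective true c v v< e in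
          ∈ᵇ-true⁺ v (map atOnes τ) (subst (_∈ map atOnes τ) ej (∈-map⁺ atOnes (perm-has k τ τ-perm j (subst (j <_) ones-c j<))))
      ... | false = ∈ᵇ-false⁺ v (map atOnes τ) v∉
        where
        v∉ : v ∉ map atOnes τ
        v∉ v∈ with ∈-map⁻ atOnes v∈
        ... | j , j∈ , refl = true≢false (trans (sym (proj₂ (bitPos-valid true c j (subst (j <_) (sym ones-c) (All.lookup (proj₁ (proj₂ τ-perm)) j∈))))) e)
      indicator-word : indicator n (map atOnes τ) ≡ c
      indicator-word = trans (cong (λ m → map (λ v → v ∈ᵇ (map atOnes τ)) (upTo m)) (sym length-c)) (list-ext _ c indicator-at)

  module _ (n k : ℕ) (π : List ℕ) (π-perm : IsPerm n π) (k≤n : k ≤ n) where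

    private
      d = n ∸ k
      P = take d π
      S = drop d π
      P++S≡π : P ++ S ≡ π
      P++S≡π = take++drop≡id d π
      P++S-unique : Unique (P ++ S)
      P++S-unique = subst Unique (sym P++S≡π) (proj₂ (proj₂ π-perm))
      P-unique : Unique P
      P-unique = UP.take⁺ d (proj₂ (proj₂ π-perm))
      S-unique : Unique S
      S-unique = UP.drop⁺ d (proj₂ (proj₂ π-perm))
      P-length : length P ≡ d
      P-length = trans (length-take d π) (trans (cong (d ⊓_) (proj₁ π-perm)) (m≤n⇒m⊓n≡m (m∸n≤m n k)))
      S-length : length S ≡ k
      S-length = trans (length-drop d π) (trans (cong (_∸ d) (proj₁ π-perm)) (m∸[m∸n]≡n k≤n))
      P++S<n : ∀ z → z ∈ P ++ S → z < n
      P++S<n z z∈ = All.lookup (proj₁ (proj₂ π-perm)) (subst (z ∈_) P++S≡π z∈)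
      P-or-S : ∀ u → u < n → u ∈ P ⊎ u ∈ S
      P-or-S u lt = ∈-++⁻ P (subst (u ∈_) (sym P++S≡π) (perm-has n π π-perm u lt))
      c = indicator n S
      bitAt-indicator : ∀ u → u < n → bitAt c u ≡ u ∈ᵇ S
      bitAt-indicator u lt = lookup-map-upTo (λ v → v ∈ᵇ S) n u lt
      length-c : length c ≡ n
      length-c = trans (length-map _ (upTo n)) (length-upTo n)
      ones-c : countBit true c ≡ k
      ones-c = trans (countᵇ-map (isBit true) (λ v → v ∈ᵇ S) (upTo n)) (trans (∼bag-length {xs = filterᵇ (λ v → v ∈ᵇ S) (upTo n)} {ys = S}
             (unique-same-members⇒∼bag _ S (unique-filterᵇ _ (UP.upTo⁺ n)) S-unique
                (λ z z∈ → let a , b = ∈-filterᵇ⁻ (λ v → v ∈ᵇ S) (upTo n) z∈ in ∈ᵇ-true⁻ z S b)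
                (λ z z∈ → ∈-filterᵇ⁺ (λ v → v ∈ᵇ S) (upTo n) (∈-upTo⁺ (P++S<n z (∈-++⁺ʳ P z∈))) (∈ᵇ-true⁺ z S z∈)))) S-length)
      P⇒∉S : ∀ u → u ∈ P → u ∈ᵇ S ≡ false
      P⇒∉S u u∈ = ∈ᵇ-false⁺ u S (unique-++-disj P S P++S-unique u u∈)
      ∉S⇒P : ∀ u → u < n → u ∈ᵇ S ≡ false → u ∈ P
      ∉S⇒P u lt e with P-or-S u lt
      ... | inj₁ p = p
      ... | inj₂ p = ⊥-elim (true≢false (trans (sym (∈ᵇ-true⁺ u S p)) e))
      bounded : ∀ {X} → (∀ z → z ∈ X → z ∈ P ++ S) → ∀ x → x ∈ X → x < length c
      bounded X⊆ x x∈ = subst (x <_) (sym length-c) (P++S<n x (X⊆ x x∈))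
      restore-prefix : map (bitPos false c) (standardise P) ≡ P
      restore-prefix = bitPos-standardise false c P P-unique (bounded (λ _ → ∈-++⁺ˡ))
        (λ u u< u∈ → cong not (trans (bitAt-indicator u (subst (u <_) length-c u<)) (P⇒∉S u u∈)))
        (λ u u< e → ∉S⇒P u (subst (u <_) length-c u<) (trans (sym (bitAt-indicator u (subst (u <_) length-c u<))) (not-true _ e)))
      restore-suffix : map (bitPos true c) (standardise S) ≡ S
      restore-suffix = bitPos-standardise true c S S-unique (bounded (λ _ → ∈-++⁺ʳ P))
        (λ u u< u∈ → trans (bitAt-indicator u (subst (u <_) length-c u<)) (∈ᵇ-true⁺ u S u∈))
        (λ u u< e → ∈ᵇ-true⁻ u S (trans (sym (bitAt-indicator u (subst (u <_) length-c u<))) e))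

    shuffle-unshuffle : shuffle (unshuffle n k π) ≡ π
    shuffle-unshuffle = trans (cong₂ _++_ restore-prefix restore-suffix) P++S≡π

    unshuffle-∈ : unshuffle n k π ∈ shuffleData n k
    unshuffle-∈ = shuffleData-∈⁺ n k c (standardise S) (standardise P) (binWords-∈⁺ n k c length-c ones-c)
      (perms-∈⁺ k (standardise S) (subst (λ m → IsPerm m (standardise S)) S-length (standardise-isPerm S S-unique)))
      (perms-∈⁺ d (standardise P) (subst (λ m → IsPerm m (standardise P)) P-length (standardise-isPerm P P-unique)))

  perms-∼bag-shuffles : (n k : ℕ) → k ≤ n → perms n ∼bag map shuffle (shuffleData n k)
  perms-∼bag-shuffles n k k≤n = unique-same-members⇒∼bag (perms n) (map shuffle (shuffleData n k)) (perms-unique n)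
    (unique-map-on shuffle (shuffleData n k) (shuffleData-unique n k) shuffle-injective)
    (λ π π∈ → subst (_∈ map shuffle (shuffleData n k)) (shuffle-unshuffle n k π (perms-∈⁻ n π π∈) k≤n)
        (∈-map⁺ shuffle (unshuffle-∈ n k π (perms-∈⁻ n π π∈) k≤n)))
    (λ π π∈ → shuffles-are-perms π π∈)
    where
    unshuffle-shuffle′ : ∀ t → t ∈ shuffleData n k → unshuffle n k (shuffle t) ≡ t
    unshuffle-shuffle′ (c , τ , σ) t∈ = let a , b , d = shuffleData-∈⁻ n k c τ σ t∈ in unshuffle-shuffle n k c τ σ a (perms-∈⁻ k τ b) (perms-∈⁻ (n ∸ k) σ d)
    shuffle-injective : ∀ x y → x ∈ shuffleData n k → y ∈ shuffleData n k → shuffle x ≡ shuffle y → x ≡ y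
    shuffle-injective x y x∈ y∈ e = trans (sym (unshuffle-shuffle′ x x∈)) (trans (cong (unshuffle n k) e) (unshuffle-shuffle′ y y∈))
    shuffles-are-perms : ∀ π → π ∈ map shuffle (shuffleData n k) → π ∈ perms n
    shuffles-are-perms π π∈ with ∈-map⁻ shuffle π∈
    ... | (c , τ , σ) , t∈ , refl = let a , b , d = shuffleData-∈⁻ n k c τ σ t∈ in
      perms-∈⁺ n _ (shuffle-isPerm n k c τ σ a (perms-∈⁻ k τ b) (perms-∈⁻ (n ∸ k) σ d))

module Occurrences (p : SPOP) where

  open BoolComparisons
  open Counting
  open Lists
  open Permutations
  open Inversions
  open Standardisation
  open import Data.Nat as ℕ using (ℕ; zero; suc; _+_; _∸_; _≤_; _<_; s≤s; s≤s⁻¹; _≡ᵇ_; _<ᵇ_; _≤ᵇ_)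
  open import Data.Nat.Properties
  open import Data.Bool using (Bool; true; false; _∧_; _∨_; not)
  open import Data.Fin using (toℕ)
  open import Data.Fin.Properties using (toℕ<n)
  open import Data.List using (List; []; _∷_; _++_; map; length; upTo; take; drop; all; allFin)
  open import Data.List.Properties using (length-++; length-map; length-take; take++drop≡id)
  open import Data.List.Membership.Propositional.Properties using (∈-upTo⁺; ∈-upTo⁻)
  open import Data.Product using (_×_; _,_; proj₁; proj₂; ∃)
  open import Data.Sum using (_⊎_; inj₁; inj₂)
  open import Data.Empty using (⊥-elim)
  open import Function using (_∘_)
  open import Relation.Nullary using (Dec; yes; no; does)
  open import Relation.Binary.PropositionalEquality
  open import Relation.Binary using (tri<; tri≈; tri>)

  open SPOP p

  m : ℕ
  m = len

  occ : List ℕ → ℕ → Bool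
  occ = occursAt p

  private
    comparisons : List ℕ → ℕ → Bool
    comparisons π i =
      all (λ s → all (λ t → not (does (≺-dec s t)) ∨ (at π (i + toℕ s) <ᵇ at π (i + toℕ t))) (allFin len)) (allFin len)

  occ-cong : (π π′ : List ℕ) (i i′ : ℕ) → (i + m ≤ᵇ length π) ≡ (i′ + m ≤ᵇ length π′) →
    (i + m ≤ length π → ∀ s t → s < m → t < m → (at π (i + s) <ᵇ at π (i + t)) ≡ (at π′ (i′ + s) <ᵇ at π′ (i′ + t))) →
    occ π i ≡ occ π′ i′
  occ-cong π π′ i i′ e h with i + m ≤ᵇ length π in fits
  ... | false = cong (_∧ comparisons π′ i′) e
  ... | true = cong₂ _∧_ e (all-cong _ _ (allFin len) (λ s _ → all-cong _ _ (allFin len) (λ t _ →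
        cong (λ b → not (does (≺-dec s t)) ∨ b) (h (≤ᵇ-true⁻ _ _ fits) (toℕ s) (toℕ t) (toℕ<n s) (toℕ<n t)))))

  occ-out : (π : List ℕ) (i : ℕ) → length π < i + m → occ π i ≡ false
  occ-out π i lt = cong (_∧ comparisons π i) (≤ᵇ-false⁺ _ _ lt)

  occ-bound : (π : List ℕ) (i : ℕ) → occ π i ≡ true → i + m ≤ length π
  occ-bound π i e with i + m ≤ᵇ length π in fits
  ... | true = ≤ᵇ-true⁻ _ _ fits

  m≥1 : 1 ≤ m
  m≥1 = len≥1

  private
    at-map : (e : ℕ → ℕ) (xs : List ℕ) (j : ℕ) → j < length xs → at (map e xs) j ≡ e (at xs j)
    at-map e (x ∷ xs) zero lt = refl
    at-map e (x ∷ xs) (suc j) (s≤s lt) = at-map e xs j lt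

    at-++ˡ : (xs ys : List ℕ) (j : ℕ) → j < length xs → at (xs ++ ys) j ≡ at xs j
    at-++ˡ (x ∷ xs) ys zero lt = refl
    at-++ˡ (x ∷ xs) ys (suc j) (s≤s lt) = at-++ˡ xs ys j lt

    at-++ʳ : (xs ys : List ℕ) (j : ℕ) → at (xs ++ ys) (length xs + j) ≡ at ys j
    at-++ʳ [] ys j = refl
    at-++ʳ (x ∷ xs) ys j = at-++ʳ xs ys j

  occ-map : (e : ℕ → ℕ) → StrictMono e → (xs : List ℕ) (i : ℕ) → occ (map e xs) i ≡ occ xs i
  occ-map e mono xs i = occ-cong (map e xs) xs i i (cong (i + m ≤ᵇ_) (length-map e xs))
    (λ fits s t s< t< → trans (cong₂ _<ᵇ_ (at-map e xs (i + s) (inside fits s<)) (at-map e xs (i + t) (inside fits t<)))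
                              (<ᵇ-mono e mono _ _))
    where
    inside : i + m ≤ length (map e xs) → ∀ {s} → s < m → i + s < length xs
    inside fits s< = <-≤-trans (+-monoʳ-< i s<) (≤-trans fits (≤-reflexive (length-map e xs)))

  occ-++ˡ : (xs ys : List ℕ) (i : ℕ) → i + m ≤ length xs → occ (xs ++ ys) i ≡ occ xs i
  occ-++ˡ xs ys i fits = occ-cong (xs ++ ys) xs i i
    (trans (≤ᵇ-true⁺ _ _ (≤-trans fits (≤-trans (m≤m+n (length xs) (length ys)) (≤-reflexive (sym (length-++ xs))))))
           (sym (≤ᵇ-true⁺ _ _ fits)))
    (λ _ s t s< t< → cong₂ _<ᵇ_ (at-++ˡ xs ys (i + s) (<-≤-trans (+-monoʳ-< i s<) fits))
                                (at-++ˡ xs ys (i + t) (<-≤-trans (+-monoʳ-< i t<) fits)))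

  occ-++ʳ : (xs ys : List ℕ) (i : ℕ) → occ (xs ++ ys) (length xs + i) ≡ occ ys i
  occ-++ʳ xs ys i = occ-cong (xs ++ ys) ys (length xs + i) i
    (trans (cong₂ _≤ᵇ_ (+-assoc (length xs) i m) (length-++ xs)) (+-≤ᵇ-cancelˡ (length xs)))
    (λ _ s t _ _ → cong₂ _<ᵇ_ (trans (cong (at (xs ++ ys)) (+-assoc (length xs) i s)) (at-++ʳ xs ys (i + s)))
                              (trans (cong (at (xs ++ ys)) (+-assoc (length xs) i t)) (at-++ʳ xs ys (i + t))))
    where
    +-≤ᵇ-cancelˡ : (a : ℕ) {u v : ℕ} → (a + u ≤ᵇ a + v) ≡ (u ≤ᵇ v)
    +-≤ᵇ-cancelˡ a {u} {v} with u ℕ.≤? v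
    ... | yes u≤v = trans (≤ᵇ-true⁺ _ _ (+-monoʳ-≤ a u≤v)) (sym (≤ᵇ-true⁺ _ _ u≤v))
    ... | no u≰v = trans (≤ᵇ-false⁺ _ _ (+-monoʳ-< a (≰⇒> u≰v))) (sym (≤ᵇ-false⁺ _ _ (≰⇒> u≰v)))

  length-take≤ : (d : ℕ) (π : List ℕ) → d ≤ length π → length (take d π) ≡ d
  length-take≤ d π d≤ = trans (length-take d π) (m≤n⇒m⊓n≡m d≤)

  occ-take : (d : ℕ) (π : List ℕ) (i : ℕ) → d ≤ length π → i + m ≤ d → occ (take d π) i ≡ occ π i
  occ-take d π i d≤ fits = trans (sym (occ-++ˡ (take d π) (drop d π) i (subst (i + m ≤_) (sym (length-take≤ d π d≤)) fits)))
                                 (cong (λ l → occ l i) (take++drop≡id d π))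

  occ-take-out : (d : ℕ) (π : List ℕ) (i : ℕ) → d ≤ length π → d < i + m → occ (take d π) i ≡ false
  occ-take-out d π i d≤ lt = occ-out (take d π) i (subst (_< i + m) (sym (length-take≤ d π d≤)) lt)

  occurrenceCount : List ℕ → ℕ
  occurrenceCount π = countᵇ (occ π) (upTo (length π))

  avoids-true⁻ : (π : List ℕ) → avoids p π ≡ true → ∀ i → occ π i ≡ false
  avoids-true⁻ π e i with i ℕ.<? length π
  ... | yes lt = countᵇ-zero⁻ (occ π) (upTo (length π)) (≡ᵇ-true⁻ _ 0 e) i (∈-upTo⁺ lt)
  ... | no nlt = occ-out π i (<-≤-trans (s≤s (≮⇒≥ nlt)) (≤-trans (≤-reflexive (+-comm 1 i)) (+-monoʳ-≤ i m≥1)))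

  avoids-true⁺ : (π : List ℕ) → (∀ i → i < length π → occ π i ≡ false) → avoids p π ≡ true
  avoids-true⁺ π h = ≡ᵇ-true⁺ _ 0 (countᵇ-false (occ π) (upTo (length π)) (λ i i∈ → h i (∈-upTo⁻ i∈)))

  FirstOcc : List ℕ → ℕ → Set
  FirstOcc π j = occ π j ≡ true × (∀ i → i < j → occ π i ≡ false)

  first-unique : (π : List ℕ) (j j′ : ℕ) → FirstOcc π j → FirstOcc π j′ → j ≡ j′
  first-unique π j j′ (oj , before) (oj′ , before′) with <-cmp j j′
  ... | tri< lt _ _ = ⊥-elim (true≢false (trans (sym oj) (before′ j lt)))
  ... | tri≈ _ e _ = e
  ... | tri> _ _ gt = ⊥-elim (true≢false (trans (sym oj′) (before j′ gt)))

  first-or-none : (f : ℕ → Bool) (n : ℕ) →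
    (∃ λ j → j < n × f j ≡ true × (∀ i → i < j → f i ≡ false)) ⊎ (∀ i → i < n → f i ≡ false)
  first-or-none f zero = inj₂ (λ i ())
  first-or-none f (suc n) with first-or-none f n
  ... | inj₁ (j , j< , fj , before) = inj₁ (j , m≤n⇒m≤1+n j< , fj , before)
  ... | inj₂ none with f n in fn
  ... | true = inj₁ (n , ≤-refl , fn , none)
  ... | false = inj₂ (λ i i<1+n → [ (λ i<n → none i i<n) , (λ { refl → fn }) ]′ (m≤n⇒m<n∨m≡n (s≤s⁻¹ i<1+n)))
    where open import Data.Sum using ([_,_]′)

  occurrenceCount-split : (π : List ℕ) → m ≤ length π →
    occurrenceCount π ≡ countᵇ (occ π) (upTo (length π ∸ m)) + [ occ π (length π ∸ m) ]b
  occurrenceCount-split π m≤n = trans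
    (countᵇ-upTo-cut (occ π) (suc j) (length π) j<n
       (λ i 1+j≤i i<n → occ-out π i (subst (_< i + m) (m∸n+n≡m m≤n) (+-monoˡ-< m 1+j≤i))))
    (countᵇ-upTo-∷ʳ (occ π) j)
    where
    j = length π ∸ m
    j<n : j < length π
    j<n = ∸-monoʳ-< {o = 0} m≥1 m≤n

  quasiAvoids⁻ : (π : List ℕ) → quasiAvoids p π ≡ true → m ≤ length π × FirstOcc π (length π ∸ m)
  quasiAvoids⁻ π e with ∧-split _ _ e
  ... | one , rest with ∧-split _ _ rest
  ... | m≤ᵇn , oj = m≤n , oj , λ i i<j → countᵇ-zero⁻ (occ π) _ none-before i (∈-upTo⁺ i<j)
    where
    m≤n = ≤ᵇ-true⁻ _ _ m≤ᵇn
    none-before : countᵇ (occ π) (upTo (length π ∸ m)) ≡ 0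
    none-before = +-cancelʳ-≡ 1 _ 0 (trans (sym (cong (λ b → countᵇ (occ π) (upTo (length π ∸ m)) + [ b ]b) oj))
                    (trans (sym (occurrenceCount-split π m≤n)) (≡ᵇ-true⁻ _ 1 one)))

  quasiAvoids⁺ : (π : List ℕ) → m ≤ length π → FirstOcc π (length π ∸ m) → quasiAvoids p π ≡ true
  quasiAvoids⁺ π m≤n (oj , before) = ∧-intro (≡ᵇ-true⁺ _ 1 one) (∧-intro (≤ᵇ-true⁺ _ _ m≤n) oj)
    where
    one : occurrenceCount π ≡ 1
    one = trans (occurrenceCount-split π m≤n)
      (cong₂ (λ c b → c + [ b ]b) (countᵇ-false (occ π) _ (λ i i∈ → before i (∈-upTo⁻ i∈))) oj)

  quasiAvoids-take⁻ : (d : ℕ) (π : List ℕ) → d ≤ length π → quasiAvoids p (take d π) ≡ true →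
    m ≤ d × FirstOcc π (d ∸ m)
  quasiAvoids-take⁻ d π d≤ e with quasiAvoids⁻ (take d π) e
  ... | m≤ℓ , oj , before =
    m≤d , trans (sym (occ-take d π (d ∸ m) d≤ (i+m≤d ≤-refl))) (subst (λ z → occ (take d π) (z ∸ m) ≡ true) ℓ oj)
        , (λ i i< → trans (sym (occ-take d π i d≤ (i+m≤d (<⇒≤ i<)))) (before i (subst (λ z → i < z ∸ m) (sym ℓ) i<)))
    where
    ℓ = length-take≤ d π d≤
    m≤d = subst (m ≤_) ℓ m≤ℓ
    i+m≤d : ∀ {i} → i ≤ d ∸ m → i + m ≤ d
    i+m≤d i≤ = ≤-trans (+-monoˡ-≤ m i≤) (≤-reflexive (m∸n+n≡m m≤d))

  quasiAvoids-take⁺ : (d : ℕ) (π : List ℕ) → d ≤ length π → m ≤ d → FirstOcc π (d ∸ m) →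
    quasiAvoids p (take d π) ≡ true
  quasiAvoids-take⁺ d π d≤ m≤ (oj , before) = quasiAvoids⁺ (take d π) (subst (m ≤_) (sym ℓ) m≤)
    (subst (λ z → FirstOcc (take d π) (z ∸ m)) (sym ℓ)
      ( trans (occ-take d π (d ∸ m) d≤ (≤-reflexive (m∸n+n≡m m≤))) oj
      , λ i i< → trans (occ-take d π i d≤ (≤-trans (+-monoˡ-≤ m (<⇒≤ i<)) (≤-reflexive (m∸n+n≡m m≤)))) (before i i<)))
    where
    ℓ = length-take≤ d π d≤

  avoids-false⁺ : (π : List ℕ) (j : ℕ) → occ π j ≡ true → avoids p π ≡ false
  avoids-false⁺ π j oj = ¬≡true⇒≡false (λ av → true≢false (trans (sym oj) (avoids-true⁻ π av j)))

  unique-quasiAvoiding-prefix : (n : ℕ) (π : List ℕ) → length π ≡ n →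
    Σℕ (suc n) (λ k → [ quasiAvoids p (take (n ∸ k) π) ]b) ≡ [ not (avoids p π) ]b
  unique-quasiAvoiding-prefix _ π refl with first-or-none (occ π) (length π)
  ... | inj₂ none = trans (Σℕ-zero (suc (length π)) (λ k → [ quasiAvoids p (take (length π ∸ k) π) ]b)
                                  (λ k _ → cong [_]b (¬≡true⇒≡false (no-prefix k))))
                          (cong (λ b → [ not b ]b) (sym (avoids-true⁺ π none)))
    where
    no-prefix : ∀ k → quasiAvoids p (take (length π ∸ k) π) ≢ true
    no-prefix k qa with quasiAvoids-take⁻ (length π ∸ k) π (m∸n≤m _ k) qa
    ... | m≤ , oj , _ = true≢false (trans (sym oj) (none _ (<-≤-trans (∸-monoʳ-< {o = 0} m≥1 m≤) (m∸n≤m _ k))))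
  ... | inj₁ (j , _ , oj , before) = trans (Σℕ-single (suc n) k₀ _ (s≤s (m∸n≤m n (j + m))) others)
                                           (cong [_]b (trans hit (cong not (sym (avoids-false⁺ π j oj)))))
    where
    n = length π
    j+m≤n = occ-bound π j oj
    k₀ = n ∸ (j + m)
    hit : quasiAvoids p (take (n ∸ k₀) π) ≡ true
    hit rewrite m∸[m∸n]≡n j+m≤n =
      quasiAvoids-take⁺ (j + m) π j+m≤n (m≤n+m m j) (subst (FirstOcc π) (sym (m+n∸n≡m j m)) (oj , before))
    only-k₀ : ∀ k → k ≤ n → quasiAvoids p (take (n ∸ k) π) ≡ true → k ≡ k₀
    only-k₀ k k≤n qa with quasiAvoids-take⁻ (n ∸ k) π (m∸n≤m n k) qa
    ... | m≤ , first = trans (sym (m∸[m∸n]≡n k≤n))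
      (cong (n ∸_) (trans (sym (m∸n+n≡m m≤)) (cong (_+ m) (first-unique π _ _ first (oj , before)))))
    others : ∀ k → k < suc n → k ≢ k₀ → [ quasiAvoids p (take (n ∸ k) π) ]b ≡ 0
    others k k< k≢k₀ = cong [_]b (¬≡true⇒≡false (k≢k₀ ∘ only-k₀ k (s≤s⁻¹ k<)))

  avoids-take⁺ : (d : ℕ) (π : List ℕ) → d ≤ length π → (∀ i → i + m ≤ d → occ π i ≡ false) →
    avoids p (take d π) ≡ true
  avoids-take⁺ d π d≤ h = avoids-true⁺ (take d π) (λ i _ → occ-take-either i)
    where
    occ-take-either : ∀ i → occ (take d π) i ≡ false
    occ-take-either i with (i + m) ℕ.≤? d
    ... | yes fits = trans (occ-take d π i d≤ fits) (h i fits)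
    ... | no ¬fits = occ-take-out d π i d≤ (≰⇒> ¬fits)

  avoids-init : (n : ℕ) (π : List ℕ) → length π ≡ suc n → avoids p (take n π) ≡ avoids p π ∨ quasiAvoids p π
  avoids-init n π ℓ with first-or-none (occ π) (suc n)
  ... | inj₂ none = trans (avoids-take⁺ n π n≤ℓ (λ i _ → avoids-true⁻ π av i)) (sym (cong (_∨ quasiAvoids p π) av))
    where
    av = avoids-true⁺ π (λ i i< → none i (subst (i <_) ℓ i<))
    n≤ℓ = subst (n ≤_) (sym ℓ) (n≤1+n n)
  ... | inj₁ (j , _ , oj , before) =
    trans (by-fit ((j + m) ℕ.≤? n)) (sym (cong (_∨ quasiAvoids p π) (avoids-false⁺ π j oj)))
    where
    n≤ℓ = subst (n ≤_) (sym ℓ) (n≤1+n n)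
    by-fit : Dec (j + m ≤ n) → avoids p (take n π) ≡ quasiAvoids p π
    by-fit (yes j+m≤n) = trans (avoids-false⁺ (take n π) j (trans (occ-take n π j n≤ℓ j+m≤n) oj))
      (sym (¬≡true⇒≡false (λ qa → <-irrefl (first-unique π _ _ (oj , before) (proj₂ (quasiAvoids⁻ π qa))) j<ℓ∸m)))
      where
      j<ℓ∸m : j < length π ∸ m
      j<ℓ∸m = subst (j <_) (cong (_∸ m) (sym ℓ)) (subst (_< suc n ∸ m) (m+n∸n≡m j m) (∸-monoˡ-< (s≤s j+m≤n) (m≤n+m m j)))
    by-fit (no j+m≰n) = trans (avoids-take⁺ n π n≤ℓ (λ i fits → before i (+-cancelʳ-< m i j (<-≤-trans (s≤s fits) 1+n≤j+m))))
      (sym (quasiAvoids⁺ π (subst (m ≤_) j+m≡ℓ (m≤n+m m j)) (subst (FirstOcc π) j≡ℓ∸m (oj , before))))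
      where
      1+n≤j+m = ≰⇒> j+m≰n
      j+m≡ℓ : j + m ≡ length π
      j+m≡ℓ = ≤-antisym (occ-bound π j oj) (subst (_≤ j + m) (sym ℓ) 1+n≤j+m)
      j≡ℓ∸m : j ≡ length π ∸ m
      j≡ℓ∸m = trans (sym (m+n∸n≡m j m)) (cong (_∸ m) j+m≡ℓ)

  occurrenceCount-map : (e : ℕ → ℕ) → StrictMono e → (xs : List ℕ) → occurrenceCount (map e xs) ≡ occurrenceCount xs
  occurrenceCount-map e mono xs = trans (cong (λ l → countᵇ (occ (map e xs)) (upTo l)) (length-map e xs))
    (countᵇ-cong _ _ (upTo (length xs)) (λ i _ → occ-map e mono xs i))

  avoids-map : (e : ℕ → ℕ) → StrictMono e → (xs : List ℕ) → avoids p (map e xs) ≡ avoids p xs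
  avoids-map e mono xs = cong (_≡ᵇ 0) (occurrenceCount-map e mono xs)

  quasiAvoids-map : (e : ℕ → ℕ) → StrictMono e → (xs : List ℕ) → quasiAvoids p (map e xs) ≡ quasiAvoids p xs
  quasiAvoids-map e mono xs = cong₂ _∧_ (cong (_≡ᵇ 1) (occurrenceCount-map e mono xs))
    (cong₂ _∧_ (cong (len ≤ᵇ_) (length-map e xs))
               (trans (cong (λ l → occ (map e xs) (l ∸ len)) (length-map e xs)) (occ-map e mono xs _)))

  avoids⇒¬quasiAvoids : (π : List ℕ) → avoids p π ≡ true → quasiAvoids p π ≡ false
  avoids⇒¬quasiAvoids π av =
    ¬≡true⇒≡false (λ qa → true≢false (trans (sym (proj₁ (proj₂ (quasiAvoids⁻ π qa)))) (avoids-true⁻ π av _)))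

module MaxNonOverlap (p : SPOP) where

  open BoolComparisons
  open Counting
  open Lists
  open Permutations
  open Inversions
  open Standardisation
  open Occurrences p
  open import Data.Nat as ℕ using (ℕ; zero; suc; _+_; _∸_; _≤_; _<_; z≤n; s≤s; _≡ᵇ_; _≤ᵇ_; _⊔_)
  open import Data.Nat.Properties
  open import Data.Bool using (Bool; true; false; _∧_; _∨_)
  open import Data.List using (List; []; _∷_; _++_; map; length; filterᵇ; upTo; all; foldr)
  open import Data.List.Properties using (length-++; length-map)
  open import Data.List.Membership.Propositional using (_∈_)
  open import Data.List.Membership.Propositional.Properties using (∈-map⁺; ∈-map⁻; ∈-++⁺ˡ; ∈-++⁺ʳ; ∈-++⁻)
  open import Data.List.Relation.Unary.Any using (here; there)
  open import Data.Product using (_×_; _,_; proj₁; proj₂; ∃)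
  open import Data.Sum using (_⊎_; inj₁; inj₂)
  open import Data.Empty using (⊥-elim)
  open import Data.Unit using (⊤; tt)
  open import Relation.Nullary using (yes; no)
  open import Relation.Binary.PropositionalEquality

  open SPOP p using (len)

  separated : ℕ → ℕ → Bool
  separated i j = (i ≡ᵇ j) ∨ ((i + len) ≤ᵇ j) ∨ ((j + len) ≤ᵇ i)

  pairwiseSeparated : List ℕ → Bool
  pairwiseSeparated S = all (λ i → all (λ j → separated i j) S) S

  nonOverlappingAt : (ℕ → Bool) → List ℕ → Bool
  nonOverlappingAt O' S = all O' S ∧ pairwiseSeparated S

  sublistsL : List ℕ → List (List ℕ)
  sublistsL = sublists p

  -- maxNonOverlap p π unfolds to maxNO (occ π) (length π); abstracting over the occurrence test lets
  -- the first occurrence be cut off and the remaining positions be shifted.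
  maxNO : (ℕ → Bool) → ℕ → ℕ
  maxNO O' n = foldr _⊔_ 0 (map length (filterᵇ (nonOverlappingAt O') (sublistsL (upTo n))))

  maxNO-cong : (O₁ O₂ : ℕ → Bool) (n : ℕ) → (∀ i → O₁ i ≡ O₂ i) → maxNO O₁ n ≡ maxNO O₂ n
  maxNO-cong O₁ O₂ n h = cong (λ L → foldr _⊔_ 0 (map length L))
    (filterᵇ-cong (nonOverlappingAt O₁) (nonOverlappingAt O₂) (sublistsL (upTo n))
        (λ S _ → cong (_∧ pairwiseSeparated S) (all-cong O₁ O₂ S (λ i _ → h i))))

  range : ℕ → ℕ → List ℕ
  range lo zero = []
  range lo (suc l) = lo ∷ range (suc lo) l

  range-suc : (lo l : ℕ) → range (suc lo) l ≡ map suc (range lo l)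
  range-suc lo zero = refl
  range-suc lo (suc l) = cong (suc lo ∷_) (range-suc (suc lo) l)

  upTo≡range : (n : ℕ) → upTo n ≡ range 0 n
  upTo≡range zero = refl
  upTo≡range (suc n) = trans (upTo-suc n) (cong (0 ∷_) (trans (cong (map suc) (upTo≡range n)) (sym (range-suc 0 n))))

  IncreasingIn : ℕ → ℕ → List ℕ → Set
  IncreasingIn lo hi [] = ⊤
  IncreasingIn lo hi (x ∷ S) = lo ≤ x × x < hi × IncreasingIn (suc x) hi S

  IncreasingIn-weaken : (lo lo' hi : ℕ) (S : List ℕ) → lo ≤ lo' → IncreasingIn lo' hi S → IncreasingIn lo hi S
  IncreasingIn-weaken lo lo' hi [] le sb = tt
  IncreasingIn-weaken lo lo' hi (x ∷ S) le (a , b , c) = ≤-trans le a , b , c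

  IncreasingIn-bounds : (lo hi : ℕ) (S : List ℕ) → IncreasingIn lo hi S → ∀ s → s ∈ S → lo ≤ s × s < hi
  IncreasingIn-bounds lo hi (x ∷ S) (a , b , c) s (here refl) = a , b
  IncreasingIn-bounds lo hi (x ∷ S) (a , b , c) s (there s∈) = let u , v = IncreasingIn-bounds (suc x) hi S c s s∈ in ≤-trans a (<⇒≤ u) , v

  IncreasingIn-raise : ∀ {lo lo′ hi} (S : List ℕ) → IncreasingIn lo hi S → (∀ s → s ∈ S → lo′ ≤ s) → IncreasingIn lo′ hi S
  IncreasingIn-raise [] _ _ = tt
  IncreasingIn-raise (x ∷ S) (_ , x<hi , inc) lo′≤ = lo′≤ x (here refl) , x<hi , inc

  IncreasingIn-+ : (d lo hi : ℕ) (S : List ℕ) → IncreasingIn lo hi S → IncreasingIn (d + lo) (d + hi) (map (d +_) S)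
  IncreasingIn-+ d lo hi [] sb = tt
  IncreasingIn-+ d lo hi (x ∷ S) (a , b , c) = +-monoʳ-≤ d a , +-monoʳ-< d b , subst (λ z → IncreasingIn z (d + hi) (map (d +_) S)) (+-suc d x)
      (IncreasingIn-+ d (suc x) hi S c)

  IncreasingIn-∸ : (d lo hi : ℕ) (S : List ℕ) → d ≤ lo → IncreasingIn lo hi S → IncreasingIn (lo ∸ d) (hi ∸ d) (map (_∸ d) S)
  IncreasingIn-∸ d lo hi [] le sb = tt
  IncreasingIn-∸ d lo hi (x ∷ S) le (a , b , c) = ∸-monoˡ-≤ d a , ∸-monoˡ-< b (≤-trans le a) ,
    subst (λ z → IncreasingIn z (hi ∸ d) (map (_∸ d) S)) (+-∸-assoc 1 (≤-trans le a))
        (IncreasingIn-∸ d (suc x) hi S (≤-trans le (≤-trans a (n≤1+n x))) c)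

  []∈sublists : (xs : List ℕ) → [] ∈ sublistsL xs
  []∈sublists [] = here refl
  []∈sublists (x ∷ xs) = ∈-++⁺ʳ (map (x ∷_) (sublistsL xs)) ([]∈sublists xs)

  sublists-range⁻ : (lo l : ℕ) (S : List ℕ) → S ∈ sublistsL (range lo l) → IncreasingIn lo (lo + l) S
  sublists-range⁻ lo zero .[] (here refl) = tt
  sublists-range⁻ lo (suc l) S S∈ with ∈-++⁻ (map (lo ∷_) (sublistsL (range (suc lo) l))) S∈
  ... | inj₁ q with ∈-map⁻ (lo ∷_) q
  ... | S' , S'∈ , refl = ≤-refl , subst (lo <_) (sym (+-suc lo l)) (s≤s (m≤m+n lo l)) , subst (λ z → IncreasingIn (suc lo) z S') (sym (+-suc lo l))
      (sublists-range⁻ (suc lo) l S' S'∈)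
  sublists-range⁻ lo (suc l) S S∈ | inj₂ q = IncreasingIn-weaken lo (suc lo) (lo + suc l) S (n≤1+n lo)
      (subst (λ z → IncreasingIn (suc lo) z S) (sym (+-suc lo l)) (sublists-range⁻ (suc lo) l S q))

  sublists-range⁺ : (lo l : ℕ) (S : List ℕ) → IncreasingIn lo (lo + l) S → S ∈ sublistsL (range lo l)
  sublists-range⁺ lo zero [] sb = here refl
  sublists-range⁺ lo zero (x ∷ S) (a , b , c) = ⊥-elim (<-irrefl refl (<-≤-trans b (≤-trans (≤-reflexive (+-identityʳ lo)) a)))
  sublists-range⁺ lo (suc l) [] sb = []∈sublists (range lo (suc l))
  sublists-range⁺ lo (suc l) (x ∷ S) (a , b , c) with m≤n⇒m<n∨m≡n a
  ... | inj₂ refl = ∈-++⁺ˡ (∈-map⁺ (lo ∷_) (sublists-range⁺ (suc lo) l S (subst (λ z → IncreasingIn (suc lo) z S) (+-suc lo l) c)))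
  ... | inj₁ lt = ∈-++⁺ʳ (map (lo ∷_) (sublistsL (range (suc lo) l)))
      (sublists-range⁺ (suc lo) l (x ∷ S) (lt , subst (x <_) (+-suc lo l) b , subst (λ z → IncreasingIn (suc x) z S) (+-suc lo l) c))

  sublists-upTo⁻ : (n : ℕ) (S : List ℕ) → S ∈ sublistsL (upTo n) → IncreasingIn 0 n S
  sublists-upTo⁻ n S S∈ = sublists-range⁻ 0 n S (subst (λ L → S ∈ sublistsL L) (upTo≡range n) S∈)

  sublists-upTo⁺ : (n : ℕ) (S : List ℕ) → IncreasingIn 0 n S → S ∈ sublistsL (upTo n)
  sublists-upTo⁺ n S sb = subst (λ L → S ∈ sublistsL L) (sym (upTo≡range n)) (sublists-range⁺ 0 n S sb)

  maximum : List ℕ → ℕ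
  maximum = foldr _⊔_ 0

  maximum-upper : (xs : List ℕ) (x : ℕ) → x ∈ xs → x ≤ maximum xs
  maximum-upper (y ∷ xs) x (here refl) = m≤m⊔n y (maximum xs)
  maximum-upper (y ∷ xs) x (there x∈) = m≤n⇒m≤o⊔n y (maximum-upper xs x x∈)

  maximum-attained : (xs : List ℕ) → maximum xs ≡ 0 ⊎ maximum xs ∈ xs
  maximum-attained [] = inj₁ refl
  maximum-attained (y ∷ xs) with ⊔-sel y (maximum xs)
  ... | inj₁ e = inj₂ (here e)
  ... | inj₂ e with maximum-attained xs
  ... | inj₁ z = inj₁ (trans e z)
  ... | inj₂ i = inj₂ (there (subst (_∈ xs) (sym e) i))

  maxNO-upper : (O' : ℕ → Bool) (n : ℕ) (S : List ℕ) → S ∈ sublistsL (upTo n) → nonOverlappingAt O' S ≡ true → length S ≤ maxNO O' n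
  maxNO-upper O' n S S∈ e = maximum-upper _ (length S) (∈-map⁺ length (∈-filterᵇ⁺ (nonOverlappingAt O') (sublistsL (upTo n)) S∈ e))

  maxNO-attained : (O' : ℕ → Bool) (n : ℕ) → ∃ λ S → S ∈ sublistsL (upTo n) × nonOverlappingAt O' S ≡ true × length S ≡ maxNO O' n
  maxNO-attained O' n with maximum-attained (map length (filterᵇ (nonOverlappingAt O') (sublistsL (upTo n))))
  ... | inj₁ z = [] , []∈sublists (upTo n) , refl , sym z
  ... | inj₂ i with ∈-map⁻ length i
  ... | S , S∈ , e = let a , b = ∈-filterᵇ⁻ (nonOverlappingAt O') (sublistsL (upTo n)) S∈ in S , a , b , sym e

  maxNO-none : (O' : ℕ → Bool) (n : ℕ) → (∀ i → O' i ≡ false) → maxNO O' n ≡ 0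
  maxNO-none O' n h with maxNO-attained O' n
  ... | [] , _ , _ , e = sym e
  ... | x ∷ S , _ , e , _ = ⊥-elim (true≢false (trans (sym (proj₁ (∧-split _ _ (proj₁ (∧-split _ _ e))))) (h x)))

  pairwiseSeparated⁻ : (S : List ℕ) → pairwiseSeparated S ≡ true → ∀ i j → i ∈ S → j ∈ S → separated i j ≡ true
  pairwiseSeparated⁻ S e i j i∈ j∈ = all-true⁻ (λ j → separated i j) S (all-true⁻ (λ i → all (λ j → separated i j) S) S e i i∈) j j∈

  pairwiseSeparated⁺ : (S : List ℕ) → (∀ i j → i ∈ S → j ∈ S → separated i j ≡ true) → pairwiseSeparated S ≡ true
  pairwiseSeparated⁺ S h = all-true⁺ _ S (λ i i∈ → all-true⁺ _ S (λ j j∈ → h i j i∈ j∈))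

  separated-refl : (s : ℕ) → separated s s ≡ true
  separated-refl s = ∨-introˡ _ (≡ᵇ-true⁺ s s refl)

  separated-≤ : (s t : ℕ) → s + len ≤ t → separated s t ≡ true
  separated-≤ s t le = ∨-introʳ (s ≡ᵇ t) (∨-introˡ _ (≤ᵇ-true⁺ _ _ le))

  separated-≥ : (s t : ℕ) → s + len ≤ t → separated t s ≡ true
  separated-≥ s t le = ∨-introʳ (t ≡ᵇ s) (∨-introʳ (t + len ≤ᵇ s) (≤ᵇ-true⁺ _ _ le))

  separated-gap : (s₀ s : ℕ) → s₀ < s → separated s₀ s ≡ true → s₀ + len ≤ s
  separated-gap s₀ s lt e with ∨-split _ _ e
  ... | inj₁ equal = ⊥-elim (<-irrefl (≡ᵇ-true⁻ _ _ equal) lt)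
  ... | inj₂ not-equal with ∨-split _ _ not-equal
  ... | inj₁ before = ≤ᵇ-true⁻ _ _ before
  ... | inj₂ after = ⊥-elim (<-irrefl refl (<-≤-trans lt (≤-trans (m≤m+n s len) (≤ᵇ-true⁻ _ _ after))))

  separated-∸ : (d s t : ℕ) → d ≤ s → d ≤ t → separated (s ∸ d) (t ∸ d) ≡ separated s t
  separated-∸ d s t ds dt = cong₂ _∨_ (≡ᵇ-iff _ _ _ _ (λ e → trans (sym (m∸n+n≡m ds)) (trans (cong (_+ d) e) (m∸n+n≡m dt)))
                                                 (λ e → cong (_∸ d) e))
     (cong₂ _∨_ (≤ᵇ-iff _ _ _ _ (λ le → subst₂ _≤_ (l1 s ds) (m∸n+n≡m dt) (+-monoˡ-≤ d le))
                                (λ le → +-cancelʳ-≤ d _ _ (subst₂ _≤_ (sym (l1 s ds)) (sym (m∸n+n≡m dt)) le)))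
                (≤ᵇ-iff _ _ _ _ (λ le → subst₂ _≤_ (l1 t dt) (m∸n+n≡m ds) (+-monoˡ-≤ d le))
                                (λ le → +-cancelʳ-≤ d _ _ (subst₂ _≤_ (sym (l1 t dt)) (sym (m∸n+n≡m ds)) le))))
    where
    l1 : ∀ u → d ≤ u → u ∸ d + len + d ≡ u + len
    l1 u du = trans (+-assoc (u ∸ d) len d) (trans (cong (u ∸ d +_) (+-comm len d))
        (trans (sym (+-assoc (u ∸ d) d len)) (cong (_+ len) (m∸n+n≡m du))))

  separated-+ : (d s t : ℕ) → separated (d + s) (d + t) ≡ separated s t
  separated-+ d s t = trans (sym (separated-∸ d (d + s) (d + t) (m≤m+n d s) (m≤m+n d t))) (cong₂ separated (m+n∸m≡n d s) (m+n∸m≡n d t))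

  module _ (O₀ : ℕ → Bool) (n j : ℕ) (oj : O₀ j ≡ true) (j+len≤n : j + len ≤ n)
           (before : ∀ i → i < j → O₀ i ≡ false) where

    private
      d = j + len
      O′ : ℕ → Bool
      O′ i = O₀ (d + i)
      n′ = n ∸ d
      1+j≤d : suc j ≤ d
      1+j≤d = subst (_≤ d) (+-comm j 1) (+-monoʳ-≤ j m≥1)

    maxNO-first-≥ : suc (maxNO O′ n′) ≤ maxNO O₀ n
    maxNO-first-≥ with maxNO-attained O′ n′
    ... | S′ , S′∈ , noS′ , |S′| = subst (_≤ maxNO O₀ n) (cong suc (trans (length-map (d +_) S′) |S′|))
                                         (maxNO-upper O₀ n S₀ S₀∈ noS₀)
      where
      S₀ = j ∷ map (d +_) S′
      S₀∈ : S₀ ∈ sublistsL (upTo n)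
      S₀∈ = sublists-upTo⁺ n S₀ (z≤n , <-≤-trans (<-≤-trans (n<1+n j) 1+j≤d) j+len≤n
        , IncreasingIn-weaken (suc j) d n _ 1+j≤d
            (subst₂ (λ a b → IncreasingIn a b (map (d +_) S′)) (+-identityʳ d) (m+[n∸m]≡n j+len≤n)
                    (IncreasingIn-+ d 0 n′ S′ (sublists-upTo⁻ n′ S′ S′∈))))
      occS′ = proj₁ (∧-split (all O′ S′) _ noS′)
      sepS′ = proj₂ (∧-split (all O′ S′) _ noS′)
      sep : ∀ a b → a ∈ S₀ → b ∈ S₀ → separated a b ≡ true
      sep a b (here refl) (here refl) = separated-refl j
      sep a b (here refl) (there b∈) with ∈-map⁻ (d +_) b∈
      ... | t , _ , refl = separated-≤ j (d + t) (m≤m+n d t)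
      sep a b (there a∈) (here refl) with ∈-map⁻ (d +_) a∈
      ... | s , _ , refl = separated-≥ j (d + s) (m≤m+n d s)
      sep a b (there a∈) (there b∈) with ∈-map⁻ (d +_) a∈ | ∈-map⁻ (d +_) b∈
      ... | s , s∈ , refl | t , t∈ , refl = trans (separated-+ d s t) (pairwiseSeparated⁻ S′ sepS′ s t s∈ t∈)
      noS₀ : nonOverlappingAt O₀ S₀ ≡ true
      noS₀ = ∧-intro (∧-intro oj (trans (all-map O₀ (d +_) S′) occS′)) (pairwiseSeparated⁺ S₀ sep)

    -- An optimal family starts at some s₀ ≥ j, so all its other members lie at or beyond s₀ + m ≥ j + m.
    maxNO-first-≤ : maxNO O₀ n ≤ suc (maxNO O′ n′)
    maxNO-first-≤ with maxNO-attained O₀ n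
    ... | [] , _ , _ , e = subst (_≤ suc (maxNO O′ n′)) e z≤n
    ... | s₀ ∷ S′ , S∈ , noS , e = subst (_≤ suc (maxNO O′ n′)) e
          (s≤s (subst (_≤ maxNO O′ n′) (length-map (_∸ d) S′) (maxNO-upper O′ n′ S″ S″∈ noS″)))
      where
      incS = sublists-upTo⁻ n (s₀ ∷ S′) S∈
      occS = proj₁ (∧-split (all O₀ (s₀ ∷ S′)) _ noS)
      sepS = proj₂ (∧-split (all O₀ (s₀ ∷ S′)) _ noS)
      allOcc = all-true⁻ O₀ (s₀ ∷ S′) occS
      j≤s₀ : j ≤ s₀
      j≤s₀ with j ℕ.≤? s₀
      ... | yes j≤ = j≤
      ... | no j≰ = ⊥-elim (true≢false (trans (sym (allOcc s₀ (here refl))) (before s₀ (≰⇒> j≰))))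
      d≤ : ∀ s → s ∈ S′ → d ≤ s
      d≤ s s∈ = ≤-trans (+-monoˡ-≤ len j≤s₀)
        (separated-gap s₀ s (proj₁ (IncreasingIn-bounds (suc s₀) n S′ (proj₂ (proj₂ incS)) s s∈))
                            (pairwiseSeparated⁻ (s₀ ∷ S′) sepS s₀ s (here refl) (there s∈)))
      S″ = map (_∸ d) S′
      S″∈ : S″ ∈ sublistsL (upTo n′)
      S″∈ = sublists-upTo⁺ n′ S″ (subst (λ z → IncreasingIn z n′ S″) (n∸n≡0 d)
              (IncreasingIn-∸ d d n S′ ≤-refl (IncreasingIn-raise S′ (proj₂ (proj₂ incS)) d≤)))
      noS″ : nonOverlappingAt O′ S″ ≡ true
      noS″ = ∧-intro
        (trans (all-map O′ (_∸ d) S′) (all-true⁺ _ S′ (λ s s∈ → trans (cong O₀ (m+[n∸m]≡n (d≤ s s∈))) (allOcc s (there s∈)))))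
        (pairwiseSeparated⁺ S″ sep)
        where
        sep : ∀ a b → a ∈ S″ → b ∈ S″ → separated a b ≡ true
        sep a b a∈ b∈ with ∈-map⁻ (_∸ d) a∈ | ∈-map⁻ (_∸ d) b∈
        ... | s , s∈ , refl | t , t∈ , refl =
          trans (separated-∸ d s t (d≤ s s∈) (d≤ t t∈)) (pairwiseSeparated⁻ (s₀ ∷ S′) sepS s t (there s∈) (there t∈))

    maxNO-first : maxNO O₀ n ≡ suc (maxNO (λ i → O₀ (j + len + i)) (n ∸ (j + len)))
    maxNO-first = ≤-antisym maxNO-first-≤ maxNO-first-≥

  maxNonOverlap-avoids : (π : List ℕ) → avoids p π ≡ true → maxNonOverlap p π ≡ 0
  maxNonOverlap-avoids π e = maxNO-none (occ π) (length π) (avoids-true⁻ π e)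

  maxNonOverlap-map : (e : ℕ → ℕ) → StrictMono e → (τ : List ℕ) → maxNonOverlap p (map e τ) ≡ maxNonOverlap p τ
  maxNonOverlap-map e sm τ = trans (maxNO-cong (occ (map e τ)) (occ τ) (length (map e τ)) (occ-map e sm τ)) (cong (maxNO (occ τ)) (length-map e τ))

  maxNonOverlap-quasiAvoids-++ : (P S : List ℕ) → quasiAvoids p P ≡ true → maxNonOverlap p (P ++ S) ≡ suc (maxNonOverlap p S)
  maxNonOverlap-quasiAvoids-++ P S e = trans (maxNO-first (occ (P ++ S)) (length (P ++ S)) j oj' jm before')
    (cong suc (trans (maxNO-cong (λ i → occ (P ++ S) (j + len + i)) (occ S) (length (P ++ S) ∸ (j + len))
        (λ i → trans (cong (λ z → occ (P ++ S) (z + i)) jmP) (occ-++ʳ P S i)))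
                     (cong (maxNO (occ S)) (trans (cong₂ _∸_ (length-++ P {S}) jmP) (m+n∸m≡n (length P) (length S))))))
    where
    q = quasiAvoids⁻ P e
    ml = proj₁ q
    j = length P ∸ m
    jmP : j + len ≡ length P
    jmP = m∸n+n≡m ml
    jm : j + len ≤ length (P ++ S)
    jm = subst (_≤ length (P ++ S)) (sym jmP) (subst (length P ≤_) (sym (length-++ P)) (m≤m+n (length P) (length S)))
    oj' : occ (P ++ S) j ≡ true
    oj' = trans (occ-++ˡ P S j (≤-reflexive jmP)) (proj₁ (proj₂ q))
    before' : ∀ i → i < j → occ (P ++ S) i ≡ false
    before' i i< = trans (occ-++ˡ P S i (≤-trans (+-monoˡ-≤ len (<⇒≤ i<)) (≤-reflexive jmP))) (proj₂ (proj₂ q) i i<)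

module ShuffleStatistics where

  open BoolComparisons
  open Counting
  open Lists
  open Permutations
  open Inversions
  open Standardisation
  open BinaryWords
  open Shuffle
  open import Data.Nat as ℕ using (ℕ; _+_; _∸_; _≤_; _<ᵇ_)
  open import Data.Nat.Properties
  open import Data.Bool using (Bool; true; false)
  open import Data.List using (List; _++_; map; length; upTo; take)
  open import Data.List.Properties using (length-map)
  open import Data.List.Membership.Propositional using (_∈_)
  open import Data.Product using (_,_; proj₁; proj₂)
  open import Function using (_∘_)
  open import Relation.Binary.PropositionalEquality

  countᵇ-perms-shuffle : (n k : ℕ) → k ≤ n → (t : List ℕ → Bool) →
    countᵇ t (perms n) ≡ sumL (λ c → sumL (λ τ → countᵇ (λ σ → t (shuffle (c , τ , σ))) (perms (n ∸ k))) (perms k)) (binWords n k)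
  countᵇ-perms-shuffle n k k≤n t = trans (perms-∼bag-shuffles n k k≤n t) (trans (countᵇ-map t shuffle (shuffleData n k))
    (trans (countᵇ-concatMap (t ∘ shuffle) _ (binWords n k)) (sumL-cong _ _ (binWords n k) (λ c _ →
      trans (countᵇ-concatMap (t ∘ shuffle) _ (perms k)) (sumL-cong _ _ (perms k)
          (λ τ _ → countᵇ-map (t ∘ shuffle) (λ σ → (c , τ , σ)) (perms (n ∸ k))))))))

  module _ (n k : ℕ) (c : List Bool) (τ σ : List ℕ) (c∈ : c ∈ binWords n k) (τ-perm : IsPerm k τ) (σ-perm : IsPerm (n ∸ k) σ) where

    private
      length-c : length c ≡ n
      length-c = proj₁ (binWords-∈⁻ n k c c∈)
      ones-c : countBit true c ≡ k
      ones-c = proj₂ (binWords-∈⁻ n k c c∈)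
      zeros-c : countBit false c ≡ n ∸ k
      zeros-c = trans (sym (m+n∸n≡m (countBit false c) (countBit true c))) (cong₂ _∸_ (trans (countBit-false+true c) length-c) ones-c)
      atZeros atOnes : ℕ → ℕ
      atZeros = bitPos false c
      atOnes = bitPos true c
      prefix-length : length (map atZeros σ) ≡ n ∸ k
      prefix-length = trans (length-map atZeros σ) (proj₁ σ-perm)

    take-shuffle : take (n ∸ k) (shuffle (c , τ , σ)) ≡ map atZeros σ
    take-shuffle = trans (cong (λ m → take m (shuffle (c , τ , σ))) (sym prefix-length)) (take-++-len (map atZeros σ) (map atOnes τ))

    inv-shuffle : inv (shuffle (c , τ , σ)) ≡ binInv c + (inv σ + inv τ)
    inv-shuffle = trans (inv≡invRec (map atZeros σ ++ map atOnes τ)) (trans (invRec-++ (map atZeros σ) (map atOnes τ))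
      (cong₂ _+_ cross≡binInv (cong₂ _+_ (trans (invRec-map atZeros (bitPos-mono false c) σ) (sym (inv≡invRec σ)))
          (trans (invRec-map atOnes (bitPos-mono true c) τ) (sym (inv≡invRec τ))))))
      where
      countBelow-ones : ∀ x → countᵇ (_<ᵇ x) (map atOnes τ) ≡ countᵇ (_<ᵇ x) (bitPositions true c)
      countBelow-ones x = trans (countᵇ-map (_<ᵇ x) atOnes τ) (trans (perm-∼bag-upTo k τ τ-perm _)
        (trans (sym (countᵇ-map (_<ᵇ x) atOnes (upTo k))) (cong (λ m → countᵇ (_<ᵇ x) (map atOnes (upTo m))) (sym ones-c))))
      cross≡binInv : crossInv (map atZeros σ) (map atOnes τ) ≡ binInv c
      cross≡binInv = begin
        sumL (λ x → countᵇ (_<ᵇ x) (map atOnes τ)) (map atZeros σ) ≡⟨ sumL-map _ atZeros σ ⟩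
        sumL (λ i → countᵇ (_<ᵇ atZeros i) (map atOnes τ)) σ ≡⟨ sumL-resp-∼bag _ σ (upTo (n ∸ k)) (perm-∼bag-upTo (n ∸ k) σ σ-perm) ⟩
        sumL (λ i → countᵇ (_<ᵇ atZeros i) (map atOnes τ)) (upTo (n ∸ k)) ≡⟨ sumL-cong _ _ (upTo (n ∸ k)) (λ i _ → countBelow-ones (atZeros i)) ⟩
        sumL (λ i → countᵇ (_<ᵇ atZeros i) (bitPositions true c)) (upTo (n ∸ k)) ≡⟨ sym (sumL-map _ atZeros (upTo (n ∸ k))) ⟩
        sumL (λ x → countᵇ (_<ᵇ x) (bitPositions true c)) (map atZeros (upTo (n ∸ k))) ≡⟨ cong
            (λ m → sumL (λ x → countᵇ (_<ᵇ x) (bitPositions true c)) (map atZeros (upTo m))) (sym zeros-c) ⟩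
        binInv c ∎
        where open ≡-Reasoning

module Decompositions (p : SPOP) where

  open BoolComparisons
  open Counting
  open Lists
  open Permutations
  open Inversions
  open Standardisation
  open BinaryWords
  open Shuffle
  open Monomials
  open ShuffleStatistics
  open Occurrences p
  open MaxNonOverlap p
  open import Data.Nat as ℕ using (ℕ; zero; suc; _+_; _∸_; _≤_; _<_; z≤n; s≤s; s≤s⁻¹)
  open import Data.Nat.Properties
  open import Data.Bool using (Bool; true; false; _∧_; _∨_; not)
  open import Data.List using (List; []; _∷_; _++_; map; length; filterᵇ; take)
  open import Data.List.Membership.Propositional using (_∈_)
  open import Data.List.Relation.Unary.Any using (here)
  open import Data.Product using (_,_; proj₁)
  open import Function using (_∘_)
  open import Relation.Binary.PropositionalEquality

  N : List ℕ → ℕ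
  N = maxNonOverlap p

  statistics : List ℕ → Monomial
  statistics π = (N π , inv π)

  -- The n-th Eulerian coefficients of F, A, B, yB and 1, each as the multiset of its monomials y^a q^b.
  Fᴹ Aᴹ Bᴹ yBᴹ 1ᴹ : ℕ → List Monomial
  Fᴹ n = map statistics (perms n)
  Aᴹ n = map (λ π → (0 , inv π)) (filterᵇ (avoids p) (perms n))
  Bᴹ n = map (λ π → (0 , inv π)) (filterᵇ (quasiAvoids p) (perms n))
  yBᴹ n = map (λ π → (1 , inv π)) (filterᵇ (quasiAvoids p) (perms n))
  1ᴹ zero = (0 , 0) ∷ []
  1ᴹ (suc n) = []

  qbinomᴹ : ℕ → ℕ → List Monomial
  qbinomᴹ n k = map (λ c → (0 , binInv c)) (binWords n k)

  prefixQuasiAvoiding-∼bag : (n k : ℕ) → k ≤ n →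
    map statistics (filterᵇ (quasiAvoids p ∘ take (n ∸ k)) (perms n)) ∼bag (qbinomᴹ n k ⊗ (Fᴹ k ⊗ yBᴹ (n ∸ k)))
  prefixQuasiAvoiding-∼bag n k k≤n t = begin
    countᵇ t (map statistics (filterᵇ Q (perms n)))
      ≡⟨ trans (countᵇ-map t statistics (filterᵇ Q (perms n))) (countᵇ-filter (t ∘ statistics) Q (perms n)) ⟩
    countᵇ (λ π → Q π ∧ t (statistics π)) (perms n)
      ≡⟨ countᵇ-perms-shuffle n k k≤n _ ⟩
    sumL (λ c → sumL (λ τ → countᵇ (λ σ → Q (shuffle (c , τ , σ)) ∧ t (statistics (shuffle (c , τ , σ))))
                                   (perms (n ∸ k))) (perms k)) (binWords n k)
      ≡⟨ sumL-cong _ _ (binWords n k) (λ c c∈ → sumL-cong _ _ (perms k) (λ τ τ∈ → countᵇ-cong _ _ (perms (n ∸ k)) (λ σ σ∈ →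
           shuffled c τ σ c∈ (perms-∈⁻ k τ τ∈) (perms-∈⁻ (n ∸ k) σ σ∈)))) ⟩
    sumL (λ c → sumL (λ τ → countᵇ (λ σ → quasiAvoids p σ ∧ t (suc (N τ) , binInv c + (inv σ + inv τ)))
                                   (perms (n ∸ k))) (perms k)) (binWords n k)
      ≡⟨ trans (countᵇ-⊗ t (qbinomᴹ n k) _) (trans (sumL-map _ (λ c → (0 , binInv c)) (binWords n k))
                                                   (sumL-cong _ _ (binWords n k) (λ c _ → product c))) ⟨
    countᵇ t (qbinomᴹ n k ⊗ (Fᴹ k ⊗ yBᴹ (n ∸ k))) ∎
    where
    open ≡-Reasoning
    Q : List ℕ → Bool
    Q = quasiAvoids p ∘ take (n ∸ k)
    shuffled : ∀ c τ σ → c ∈ binWords n k → IsPerm k τ → IsPerm (n ∸ k) σ →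
      (Q (shuffle (c , τ , σ)) ∧ t (statistics (shuffle (c , τ , σ)))) ≡
      (quasiAvoids p σ ∧ t (suc (N τ) , binInv c + (inv σ + inv τ)))
    shuffled c τ σ c∈ ipτ ipσ = trans (cong (_∧ t (statistics (shuffle (c , τ , σ)))) prefix)
      (∧-cong-when (quasiAvoids p σ) (λ qa → cong t (cong₂ _,_
        (trans (maxNonOverlap-quasiAvoids-++ (map (bitPos false c) σ) (map (bitPos true c) τ)
                  (trans (quasiAvoids-map (bitPos false c) (bitPos-mono false c) σ) qa))
               (cong suc (maxNonOverlap-map (bitPos true c) (bitPos-mono true c) τ)))
        (inv-shuffle n k c τ σ c∈ ipτ ipσ))))
      where
      prefix : Q (shuffle (c , τ , σ)) ≡ quasiAvoids p σ
      prefix = trans (cong (quasiAvoids p) (take-shuffle n k c τ σ c∈ ipτ ipσ))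
                     (quasiAvoids-map (bitPos false c) (bitPos-mono false c) σ)
    product : ∀ c → countᵇ (λ y → t ((0 , binInv c) *ₘ y)) (Fᴹ k ⊗ yBᴹ (n ∸ k)) ≡
      sumL (λ τ → countᵇ (λ σ → quasiAvoids p σ ∧ t (suc (N τ) , binInv c + (inv σ + inv τ))) (perms (n ∸ k))) (perms k)
    product c = trans (countᵇ-⊗ _ (Fᴹ k) (yBᴹ (n ∸ k))) (trans (sumL-map _ statistics (perms k)) (sumL-cong _ _ (perms k) (λ τ _ →
      trans (countᵇ-map _ (λ π → (1 , inv π)) (filterᵇ (quasiAvoids p) (perms (n ∸ k))))
      (trans (countᵇ-filter _ (quasiAvoids p) (perms (n ∸ k)))
        (countᵇ-cong _ _ (perms (n ∸ k)) (λ σ _ → cong (λ z → quasiAvoids p σ ∧ t z)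
          (cong₂ _,_ (+-comm (N τ) 1) (cong (binInv c +_) (+-comm (inv τ) (inv σ))))))))))

  Fᴹ-decomposition : (n : ℕ) →
    Fᴹ n ∼bag (Aᴹ n ++ concat< (suc n) (λ k → qbinomᴹ n k ⊗ (Fᴹ k ⊗ yBᴹ (n ∸ k))))
  Fᴹ-decomposition n t = begin
    countᵇ t (Fᴹ n)
      ≡⟨ countᵇ-map t statistics (perms n) ⟩
    countᵇ (t ∘ statistics) (perms n)
      ≡⟨ countᵇ-split _ _ _ (perms n) (λ π _ → by-avoidance (avoids p π) (t (statistics π))) ⟩
    countᵇ (λ π → avoids p π ∧ t (statistics π)) (perms n) + countᵇ (λ π → not (avoids p π) ∧ t (statistics π)) (perms n)
      ≡⟨ cong₂ _+_ avoiders nonAvoiders ⟩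
    countᵇ t (Aᴹ n) + countᵇ t (concat< (suc n) (λ k → qbinomᴹ n k ⊗ (Fᴹ k ⊗ yBᴹ (n ∸ k))))
      ≡⟨ countᵇ-++ t (Aᴹ n) _ ⟨
    countᵇ t (Aᴹ n ++ concat< (suc n) (λ k → qbinomᴹ n k ⊗ (Fᴹ k ⊗ yBᴹ (n ∸ k)))) ∎
    where
    open ≡-Reasoning
    by-avoidance : (a u : Bool) → [ u ]b ≡ [ a ∧ u ]b + [ not a ∧ u ]b
    by-avoidance true u = sym (+-identityʳ _)
    by-avoidance false u = refl
    avoiders : countᵇ (λ π → avoids p π ∧ t (statistics π)) (perms n) ≡ countᵇ t (Aᴹ n)
    avoiders = trans (countᵇ-cong _ _ (perms n) (λ π _ → ∧-cong-when (avoids p π) (λ av →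
                        cong (λ z → t (z , inv π)) (maxNonOverlap-avoids π av))))
      (sym (trans (countᵇ-map t (λ π → (0 , inv π)) (filterᵇ (avoids p) (perms n))) (countᵇ-filter _ (avoids p) (perms n))))
    Qₖ : ℕ → List ℕ → Bool
    Qₖ k = quasiAvoids p ∘ take (n ∸ k)
    nonAvoiders : countᵇ (λ π → not (avoids p π) ∧ t (statistics π)) (perms n) ≡
                  countᵇ t (concat< (suc n) (λ k → qbinomᴹ n k ⊗ (Fᴹ k ⊗ yBᴹ (n ∸ k))))
    nonAvoiders = begin
      countᵇ (λ π → not (avoids p π) ∧ t (statistics π)) (perms n)
        ≡⟨ countᵇ-filter (t ∘ statistics) (not ∘ avoids p) (perms n) ⟨
      countᵇ (t ∘ statistics) (filterᵇ (not ∘ avoids p) (perms n))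
        ≡⟨ filter-∼bag-concat< (perms n) (not ∘ avoids p) (suc n) Qₖ
             (λ π π∈ → unique-quasiAvoiding-prefix n π (proj₁ (perms-∈⁻ n π π∈))) (t ∘ statistics) ⟩
      countᵇ (t ∘ statistics) (concat< (suc n) (λ k → filterᵇ (Qₖ k) (perms n)))
        ≡⟨ countᵇ-concat< (t ∘ statistics) (suc n) _ ⟩
      Σℕ (suc n) (λ k → countᵇ (t ∘ statistics) (filterᵇ (Qₖ k) (perms n)))
        ≡⟨ Σℕ-cong (suc n) _ _ (λ k k< → trans (sym (countᵇ-map t statistics (filterᵇ (Qₖ k) (perms n))))
                                                (prefixQuasiAvoiding-∼bag n k (s≤s⁻¹ k<) t)) ⟩
      Σℕ (suc n) (λ k → countᵇ t (qbinomᴹ n k ⊗ (Fᴹ k ⊗ yBᴹ (n ∸ k))))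
        ≡⟨ countᵇ-concat< t (suc n) _ ⟨
      countᵇ t (concat< (suc n) (λ k → qbinomᴹ n k ⊗ (Fᴹ k ⊗ yBᴹ (n ∸ k)))) ∎

  Aᴹ++Bᴹ-decomposition : (n : ℕ) → (Aᴹ (suc n) ++ Bᴹ (suc n)) ∼bag (qbinomᴹ (suc n) 1 ⊗ Aᴹ n)
  Aᴹ++Bᴹ-decomposition n t = begin
    countᵇ t (Aᴹ (suc n) ++ Bᴹ (suc n))
      ≡⟨ countᵇ-++ t (Aᴹ (suc n)) (Bᴹ (suc n)) ⟩
    countᵇ t (Aᴹ (suc n)) + countᵇ t (Bᴹ (suc n))
      ≡⟨ cong₂ _+_ (filtered (avoids p) (suc n)) (filtered (quasiAvoids p) (suc n)) ⟩
    countᵇ (λ π → avoids p π ∧ t (0 , inv π)) (perms (suc n)) + countᵇ (λ π → quasiAvoids p π ∧ t (0 , inv π)) (perms (suc n))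
      ≡⟨ countᵇ-split _ _ _ (perms (suc n)) (λ π π∈ → by-last-letter π (proj₁ (perms-∈⁻ (suc n) π π∈))) ⟨
    countᵇ (λ π → avoids p (take n π) ∧ t (0 , inv π)) (perms (suc n))
      ≡⟨ countᵇ-perms-shuffle (suc n) 1 (s≤s z≤n) _ ⟩
    sumL (λ c → sumL (λ τ → countᵇ (λ σ → avoids p (take n (shuffle (c , τ , σ))) ∧ t (0 , inv (shuffle (c , τ , σ))))
                                   (perms n)) (perms 1)) (binWords (suc n) 1)
      ≡⟨ sumL-cong _ _ (binWords (suc n) 1) (λ c c∈ → trans (+-identityʳ _)
           (countᵇ-cong _ _ (perms n) (λ σ σ∈ → shuffled c σ c∈ (perms-∈⁻ n σ σ∈)))) ⟩
    sumL (λ c → countᵇ (λ σ → avoids p σ ∧ t (0 , binInv c + inv σ)) (perms n)) (binWords (suc n) 1)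
      ≡⟨ trans (countᵇ-⊗ t (qbinomᴹ (suc n) 1) (Aᴹ n)) (trans (sumL-map _ (λ c → (0 , binInv c)) (binWords (suc n) 1))
           (sumL-cong _ _ (binWords (suc n) 1) (λ c _ → filtered (avoids p) n))) ⟨
    countᵇ t (qbinomᴹ (suc n) 1 ⊗ Aᴹ n) ∎
    where
    open ≡-Reasoning
    filtered : ∀ {t′ : Monomial → Bool} (P : List ℕ → Bool) (m : ℕ) →
      countᵇ t′ (map (λ π → (0 , inv π)) (filterᵇ P (perms m))) ≡ countᵇ (λ π → P π ∧ t′ (0 , inv π)) (perms m)
    filtered P m = trans (countᵇ-map _ (λ π → (0 , inv π)) (filterᵇ P (perms m))) (countᵇ-filter _ P (perms m))
    by-last-letter : ∀ π → length π ≡ suc n →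
      [ avoids p (take n π) ∧ t (0 , inv π) ]b ≡ [ avoids p π ∧ t (0 , inv π) ]b + [ quasiAvoids p π ∧ t (0 , inv π) ]b
    by-last-letter π ℓ = trans (cong (λ b → [ b ∧ t (0 , inv π) ]b) (avoids-init n π ℓ)) (by-cases (avoids p π) refl)
      where
      by-cases : (a : Bool) → avoids p π ≡ a →
        [ (a ∨ quasiAvoids p π) ∧ t (0 , inv π) ]b ≡ [ a ∧ t (0 , inv π) ]b + [ quasiAvoids p π ∧ t (0 , inv π) ]b
      by-cases true av rewrite avoids⇒¬quasiAvoids π av = sym (+-identityʳ _)
      by-cases false _ = refl
    shuffled : ∀ c σ → c ∈ binWords (suc n) 1 → IsPerm n σ →
      (avoids p (take n (shuffle (c , 0 ∷ [] , σ))) ∧ t (0 , inv (shuffle (c , 0 ∷ [] , σ)))) ≡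
      (avoids p σ ∧ t (0 , binInv c + inv σ))
    shuffled c σ c∈ ipσ = cong₂ _∧_
      (trans (cong (avoids p) (take-shuffle (suc n) 1 c (0 ∷ []) σ c∈ ip1 ipσ)) (avoids-map (bitPos false c) (bitPos-mono false c) σ))
      (cong (λ z → t (0 , z)) (trans (inv-shuffle (suc n) 1 c (0 ∷ []) σ c∈ ip1 ipσ) (cong (binInv c +_) (+-identityʳ (inv σ)))))
      where
      ip1 : IsPerm 1 (0 ∷ [])
      ip1 = perms-∈⁻ 1 (0 ∷ []) (here refl)

  qbinomᴹ-diagonal : (n : ℕ) → qbinomᴹ n n ≡ (0 , 0) ∷ []
  qbinomᴹ-diagonal n rewrite binWords-full n | binInv-allTrue n = refl

  1ᴹ-positive : ∀ {k n} → k < n → 1ᴹ (n ∸ k) ≡ []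
  1ᴹ-positive {zero} {suc n} _ = refl
  1ᴹ-positive {suc k} {suc n} (s≤s k<n) = 1ᴹ-positive k<n

  Fᴹ⊗1ᴹ : (n : ℕ) → concat< (suc n) (λ k → qbinomᴹ n k ⊗ (Fᴹ k ⊗ 1ᴹ (n ∸ k))) ≡ Fᴹ n
  Fᴹ⊗1ᴹ n = cong₂ _++_ (concat<-[] n _ lower) top
    where
    lower : ∀ k → k < n → qbinomᴹ n k ⊗ (Fᴹ k ⊗ 1ᴹ (n ∸ k)) ≡ []
    lower k k<n rewrite 1ᴹ-positive k<n | ⊗-zeroʳ (Fᴹ k) = ⊗-zeroʳ (qbinomᴹ n k)
    top : qbinomᴹ n n ⊗ (Fᴹ n ⊗ 1ᴹ (n ∸ n)) ≡ Fᴹ n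
    top rewrite n∸n≡0 n | qbinomᴹ-diagonal n | ⊗-identityʳ (Fᴹ n) = ⊗-identityˡ (Fᴹ n)

module GeneratingFunctions (p : SPOP) where

  open Counting
  open Lists
  open Permutations
  open Inversions
  open Standardisation
  open BinaryWords
  open PolynomialAlgebra
  open Monomials
  open Decompositions p
  open import Data.Nat as ℕ using (ℕ; zero; suc; _∸_; _≡ᵇ_)
  open import Data.Integer as ℤ using (+_; _+_; _-_)
  import Data.Integer.Properties as ℤP
  open import Data.Integer.Solver using (module +-*-Solver)
  open import Data.Bool using (Bool; _∧_)
  open import Data.List using (List; _++_; map; filterᵇ)
  open import Data.Product using (_,_)
  open import Relation.Binary.PropositionalEquality

  Fₚ-poly : ∀ n → Fₚ p n ≈₂ poly (Fᴹ n)
  Fₚ-poly n a b = cong +_ (sym (countᵇ-map _ statistics (perms n)))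

  lift-count-poly : (P : List ℕ → Bool) (n : ℕ) →
    lift (λ b′ → countℤ (perms n) (λ π → P π ∧ (inv π ≡ᵇ b′))) ≈₂ poly (map (λ π → (0 , inv π)) (filterᵇ P (perms n)))
  lift-count-poly P n zero b =
    cong +_ (sym (trans (countᵇ-map _ (λ π → (0 , inv π)) (filterᵇ P (perms n))) (countᵇ-filter _ P (perms n))))
  lift-count-poly P n (suc a) b =
    cong +_ (sym (trans (countᵇ-map _ (λ π → (0 , inv π)) (filterᵇ P (perms n))) (countᵇ-false _ (filterᵇ P (perms n)) (λ _ _ → refl))))

  Aₚ-poly : ∀ n → Aₚ p n ≈₂ poly (Aᴹ n)
  Aₚ-poly = lift-count-poly (avoids p)

  Bₚ-poly : ∀ n → Bₚ p n ≈₂ poly (Bᴹ n)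
  Bₚ-poly = lift-count-poly (quasiAvoids p)

  yBₚ-poly : ∀ n → yₑ (Bₚ p) n ≈₂ poly (yBᴹ n)
  yBₚ-poly n zero b = cong +_ (sym (trans (countᵇ-map _ (λ π → (1 , inv π)) (filterᵇ (quasiAvoids p) (perms n)))
                                         (countᵇ-false _ (filterᵇ (quasiAvoids p) (perms n)) (λ _ _ → refl))))
  yBₚ-poly n (suc a) b = trans (Bₚ-poly n a b) (cong +_ (trans (countᵇ-map _ (λ π → (0 , inv π)) (filterᵇ (quasiAvoids p) (perms n)))
                                                            (sym (countᵇ-map _ (λ π → (1 , inv π)) (filterᵇ (quasiAvoids p) (perms n))))))

  oneₑ-poly : ∀ n → oneₑ n ≈₂ poly (1ᴹ n)
  oneₑ-poly zero zero zero = refl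
  oneₑ-poly zero zero (suc b) = refl
  oneₑ-poly zero (suc a) b = refl
  oneₑ-poly (suc n) a b = refl

  qbinom-poly : ∀ n k → lift (qbinom n k) ≈₂ poly (qbinomᴹ n k)
  qbinom-poly n k zero b = trans (qbinom-binWords n k b) (cong +_ (sym (countᵇ-map _ (λ c → (0 , binInv c)) (binWords n k))))
  qbinom-poly n k (suc a) b =
    cong +_ (sym (trans (countᵇ-map _ (λ c → (0 , binInv c)) (binWords n k)) (countᵇ-false _ (binWords n k) (λ _ _ → refl))))

  qint≡qbinom1 : (n b : ℕ) → qint n b ≡ qbinom n 1 b
  qint≡qbinom1 zero b = refl
  qint≡qbinom1 (suc n) zero = refl
  qint≡qbinom1 (suc n) (suc b) = trans (qint≡qbinom1 n b) (sym (ℤP.+-identityˡ _))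

  xₑAₚ-poly : ∀ n → xₑ (Aₚ p) (suc n) ≈₂ poly (qbinomᴹ (suc n) 1 ⊗ Aᴹ n)
  xₑAₚ-poly n a b = trans (*₂-cong qint≈ (Aₚ-poly n) a b) (poly-*₂ (qbinomᴹ (suc n) 1) (Aᴹ n) a b)
    where
    qint≈ : lift (qint (suc n)) ≈₂ poly (qbinomᴹ (suc n) 1)
    qint≈ zero b′ = trans (qint≡qbinom1 (suc n) b′) (qbinom-poly (suc n) 1 zero b′)
    qint≈ (suc a′) b′ = qbinom-poly (suc n) 1 (suc a′) b′

  private
    [x+y]-y≡x : ∀ x y → (x + y) - y ≡ x
    [x+y]-y≡x = solve 2 (λ x y → (x :+ y) :- y := x) refl
      where open +-*-Solver
    [x+y]-x+0≡y : ∀ x y → ((x + y) - x) + + 0 ≡ y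
    [x+y]-x+0≡y = solve 2 (λ x y → ((x :+ y) :- x) :+ con (+ 0) := y) refl
      where open +-*-Solver

  Fₚ*[1-yBₚ]≈Aₚ : (Fₚ p *ₑ (oneₑ -ₑ yₑ (Bₚ p))) ≈ₑ Aₚ p
  Fₚ*[1-yBₚ]≈Aₚ n a b = begin
    (Fₚ p *ₑ (oneₑ -ₑ yₑ (Bₚ p))) n a b
      ≡⟨ *ₑ-distribˡ--ₑ (Fₚ p) oneₑ (yₑ (Bₚ p)) n a b ⟩
    (Fₚ p *ₑ oneₑ) n a b - (Fₚ p *ₑ yₑ (Bₚ p)) n a b
      ≡⟨ cong₂ _-_ (poly-*ₑ (Fₚ p) oneₑ qbinomᴹ Fᴹ 1ᴹ qbinom-poly Fₚ-poly oneₑ-poly n a b)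
                   (poly-*ₑ (Fₚ p) (yₑ (Bₚ p)) qbinomᴹ Fᴹ yBᴹ qbinom-poly Fₚ-poly yBₚ-poly n a b) ⟩
    poly (concat< (suc n) (λ k → qbinomᴹ n k ⊗ (Fᴹ k ⊗ 1ᴹ (n ∸ k)))) a b - poly Rest a b
      ≡⟨ cong (λ L → poly L a b - poly Rest a b) (Fᴹ⊗1ᴹ n) ⟩
    poly (Fᴹ n) a b - poly Rest a b
      ≡⟨ cong (_- poly Rest a b) (trans (poly-resp-∼bag (Fᴹ n) (Aᴹ n ++ Rest) (Fᴹ-decomposition n) a b)
                                            (poly-++ (Aᴹ n) Rest a b)) ⟩
    (poly (Aᴹ n) a b + poly Rest a b) - poly Rest a b
      ≡⟨ [x+y]-y≡x (poly (Aᴹ n) a b) (poly Rest a b) ⟩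
    poly (Aᴹ n) a b
      ≡⟨ Aₚ-poly n a b ⟨
    Aₚ p n a b ∎
    where
    open ≡-Reasoning
    Rest = concat< (suc n) (λ k → qbinomᴹ n k ⊗ (Fᴹ k ⊗ yBᴹ (n ∸ k)))

  xₑAₚ-Aₚ+1≈Bₚ : ((xₑ (Aₚ p) -ₑ Aₚ p) +ₑ oneₑ) ≈ₑ Bₚ p
  xₑAₚ-Aₚ+1≈Bₚ zero zero zero = refl
  xₑAₚ-Aₚ+1≈Bₚ zero zero (suc b) = refl
  xₑAₚ-Aₚ+1≈Bₚ zero (suc a) b = refl
  xₑAₚ-Aₚ+1≈Bₚ (suc n) a b = begin
    (xₑ (Aₚ p) (suc n) a b - Aₚ p (suc n) a b) + + 0
      ≡⟨ cong (λ x → (x - Aₚ p (suc n) a b) + + 0) (xₑAₚ-poly n a b) ⟩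
    (poly (qbinomᴹ (suc n) 1 ⊗ Aᴹ n) a b - Aₚ p (suc n) a b) + + 0
      ≡⟨ cong₂ (λ x y → (x - y) + + 0)
           (trans (sym (poly-resp-∼bag (Aᴹ (suc n) ++ Bᴹ (suc n)) (qbinomᴹ (suc n) 1 ⊗ Aᴹ n) (Aᴹ++Bᴹ-decomposition n) a b))
                  (poly-++ (Aᴹ (suc n)) (Bᴹ (suc n)) a b))
           (Aₚ-poly (suc n) a b) ⟩
    ((poly (Aᴹ (suc n)) a b + poly (Bᴹ (suc n)) a b) - poly (Aᴹ (suc n)) a b) + + 0
      ≡⟨ [x+y]-x+0≡y (poly (Aᴹ (suc n)) a b) (poly (Bᴹ (suc n)) a b) ⟩
    poly (Bᴹ (suc n)) a b
      ≡⟨ Bₚ-poly (suc n) a b ⟨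
    Bₚ p (suc n) a b ∎
    where open ≡-Reasoning

mainTheorem14 : (p : SPOP) →
    ((Fₚ p *ₑ (oneₑ -ₑ yₑ (Bₚ p))) ≈ₑ Aₚ p) ×
    ((Fₚ p *ₑ (oneₑ -ₑ yₑ ((xₑ (Aₚ p) -ₑ Aₚ p) +ₑ oneₑ))) ≈ₑ Aₚ p)
mainTheorem14 p =
  Fₚ*[1-yBₚ]≈Aₚ ,
  ≈ₑ-trans (*ₑ-cong {f = Fₚ p} ≈ₑ-refl (-ₑ-congˡ oneₑ (yₑ-cong xₑAₚ-Aₚ+1≈Bₚ))) Fₚ*[1-yBₚ]≈Aₚ
  where
  open PolynomialAlgebra
  open GeneratingFunctions p
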